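{- Let $q\ge5$ be a prime power with $q\equiv1\pmod3$. Then no $0_{\mathcal C}$-, $2_{\mathcal C}$-, $3_{\mathcal C}$-plane and no $\Gamma$-plane contains an imaginary axis. All $q+1$ planes through an imaginary axis are $\overline{1_{\mathcal C}}$-planes, forming a pencil, and the set of all $\overline{1_{\mathcal C}}$-planes, of size $\binom q2(q+1)$, can be partitioned into $\binom q2$ pencils of planes each having an imaginary axis as axis.
   Context: Let $\mathrm{PG}(3,q)$ have points $\mathbf{P}(x_0,x_1,x_2,x_3)$; put $P(t)=\mathbf{P}(t^3,t^2,t,1)$ ($t\in\mathbb{F}_q$), $P(\infty)=\mathbf{P}(1,0,0,0)$, $\mathcal{C}=\{P(t):t\in\mathbb{F}_q\cup\{\infty\}\}$ the twisted cubic. Write $\boldsymbol{\pi}(c_0,c_1,c_2,c_3)$ for the plane $c_0x_0+c_1x_1+c_2x_2+c_3x_3=0$. The $\Gamma$-planes are the osculating planes $\boldsymbol{\pi}(1,-3t,3t^2,-t^3)$ ($t\in\mathbb{F}_q$) and $\boldsymbol{\pi}(0,0,0,1)$. A $d_{\mathcal C}$-plane ($d\in\{0,2,3\}$) contains exactly $d$ points of $\mathcal C$; a $\overline{1_{\mathcal C}}$-plane is a non-$\Gamma$-plane containing exactly one point of $\mathcal C$. An imaginary axis is the line of $\mathrm{PG}(3,q)$ that is the intersection of $\boldsymbol{\pi}(1,-3s,3s^2,-s^3)$ and $\boldsymbol{\pi}(1,-3s^q,3s^{2q},-s^{3q})$ for some $s\in\mathbb{F}_{q^2}\setminus\mathbb{F}_q$;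 there are $\binom q2$ imaginary axes. -}

module Defs where

open import Level using (0ℓ)
open import Data.Nat using (ℕ; zero; suc)
open import Data.List using (List; length)
open import Data.List.Membership.Propositional using (_∈_)
open import Data.List.Relation.Unary.Unique.Propositional using (Unique)
open import Data.Product using (Σ; ∃; _×_; _,_)
open import Data.Sum using (_⊎_)
open import Relation.Binary.PropositionalEquality using (_≡_)
open import Relation.Nullary using (¬_; Dec)
open import Algebra.Structures using (IsCommutativeRing)
open import Function.Bundles using (_⇔_)

record FiniteField (q : ℕ) : Set₁ where
  infixl 6 _+_
  infixl 7 _*_
  field
    Carrier : Set
    _≟_     : (x y : Carrier) → Dec (x ≡ y)
    _+_ _*_ : Carrier → Carrier → Carrier
    -_      : Carrier → Carrier
    0# 1#   : Carrier
    isCommutativeRing :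
      IsCommutativeRing {A = Carrier} _≡_ _+_ _*_ -_ 0# 1#
    _⁻¹     : Carrier → Carrier
    0≢1     : ¬ (0# ≡ 1#)
    inverse : ∀ x → ¬ (x ≡ 0#) → x * (x ⁻¹) ≡ 1#
    elements : List Carrier
    unique   : Unique elements
    complete : ∀ x → x ∈ elements
    size     : length elements ≡ q

  _^_ : Carrier → ℕ → Carrier
  x ^ zero  = 1#
  x ^ suc n = x * (x ^ n)

  3# : Carrier
  3# = 1# + 1# + 1#

record Embedding {q r : ℕ} (F : FiniteField q) (K : FiniteField r) : Set where
  private
    module F = FiniteField F
    module K = FiniteField K
  field
    ι     : F.Carrier → K.Carrier
    ι-0#  : ι F.0# ≡ K.0#
    ι-1#  : ι F.1# ≡ K.1#
    ι-+   : ∀ x y → ι (x F.+ y) ≡ ι x K.+ ι y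
    ι-*   : ∀ x y → ι (x F.* y) ≡ ι x K.* ι y

HasCount : {A : Set} → (A → Set) → ℕ → Set
HasCount {A} P N =
  Σ (List A) λ l → Unique l × (∀ a → (a ∈ l) ⇔ P a) × length l ≡ N

module Geometry {q : ℕ} (F : FiniteField q) {r : ℕ} (K : FiniteField r)
                (E : Embedding F K) where
  open FiniteField F
  private module K = FiniteField K
  open Embedding E

  -- coordinate vectors (x0,x1,x2,x3) of F^4 (for points and for planes)
  record V4 : Set where
    constructor ⟨_,_,_,_⟩
    field
      c0 c1 c2 c3 : Carrier

  open V4 public

  Zero : V4 → Set
  Zero v = c0 v ≡ 0# × c1 v ≡ 0# × c2 v ≡ 0# × c3 v ≡ 0#

  _·_ : Carrier → V4 → V4
  λ' · ⟨ a , b , c , d ⟩ = ⟨ λ' * a , λ' * b , λ' * c , λ' * d ⟩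

  -- Normalized representative of a projective point/plane:
  -- the first nonzero coordinate equals 1.  Planes of PG(3,q) are in
  -- bijection with normalized coefficient vectors.
  Normalized : V4 → Set
  Normalized v =
      c0 v ≡ 1#
    ⊎ (c0 v ≡ 0# × c1 v ≡ 1#)
    ⊎ (c0 v ≡ 0# × c1 v ≡ 0# × c2 v ≡ 1#)
    ⊎ (c0 v ≡ 0# × c1 v ≡ 0# × c2 v ≡ 0# × c3 v ≡ 1#)

  -- incidence: point x lies on plane π(c)  iff  c0x0+c1x1+c2x2+c3x3 = 0
  _∙_ : V4 → V4 → Carrier
  c ∙ x = c0 c * c0 x + c1 c * c1 x + c2 c * c2 x + c3 c * c3 x

  P : Carrier → V4
  P t = ⟨ t ^ 3 , t ^ 2 , t , 1# ⟩

  P∞ : V4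
  P∞ = ⟨ 1# , 0# , 0# , 0# ⟩

  data CIndex : Set where
    fin : Carrier → CIndex
    ∞   : CIndex

  Cpt : CIndex → V4
  Cpt (fin t) = P t
  Cpt ∞       = P∞

  PlaneMeetsC : V4 → ℕ → Set
  PlaneMeetsC c d = HasCount (λ i → c ∙ Cpt i ≡ 0#) d

  Proportional : V4 → V4 → Set
  Proportional c d = Σ Carrier λ λ' → ¬ (λ' ≡ 0#) × c ≡ λ' · d

  Osc : Carrier → V4
  Osc t = ⟨ 1# , - (3# * t) , 3# * (t ^ 2) , - (t ^ 3) ⟩

  ΓPlane : V4 → Set
  ΓPlane c = (Σ Carrier λ t → Proportional c (Osc t))
           ⊎ Proportional c ⟨ 0# , 0# , 0# , 1# ⟩

  dCPlane : ℕ → V4 → Set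
  dCPlane d c = PlaneMeetsC c d

  OneBarPlane : V4 → Set
  OneBarPlane c = ¬ ΓPlane c × PlaneMeetsC c 1

  -- Imaginary axes.  For s ∈ F_{q^2}, the osculating plane
  -- π(1,-3s,3s^2,-s^3) over F_{q^2}; evaluated at a point x ∈ F_q^4.
  OscK : K.Carrier → V4 → K.Carrier
  OscK s x = ι (c0 x) K.+ K.- (K.3# K.* s) K.* ι (c1 x)
           K.+ K.3# K.* (s K.^ 2) K.* ι (c2 x) K.+ K.- (s K.^ 3) K.* ι (c3 x)

  NotInF : K.Carrier → Set
  NotInF s = ¬ (Σ Carrier λ a → ι a ≡ s)

  -- the F_q-rational points (as coordinate vectors) of the imaginary axis
  -- π(1,-3s,3s^2,-s^3) ∩ π(1,-3s^q,3s^{2q},-s^{3q})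
  OnAxis : K.Carrier → V4 → Set
  OnAxis s x = OscK s x ≡ K.0# × OscK (s K.^ q) x ≡ K.0#

  ContainsAxis : V4 → K.Carrier → Set
  ContainsAxis c s = ∀ x → OnAxis s x → c ∙ x ≡ 0#

  SameAxis : K.Carrier → K.Carrier → Set
  SameAxis s s' = ∀ x → (OnAxis s x ⇔ OnAxis s' x)

-- Fix s ∈ F_{q²} \ F_q with conjugate s̄ = s^q. The osculating planes at s and s̄ are
-- R + s I and R + s̄ I for two F_q-rational linear forms R and I, so the planes of PG(3,q)
-- through the imaginary axis are the q + 1 planes l R + m I. Such a plane contains P(∞)
-- iff l = 0, and P(t) iff ρ(t)³ = μ, where ρ(t) = (t - s)/(t - s̄) and μ = (l s - m)/(l s̄ - m)
-- both have norm one. Since q ≡ 1 (mod 3), 3 is prime to q + 1 and cubing is injective on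
-- the norm-one group; so each plane of the pencil meets C at most once, and counting the
-- roots of X^(q+1) - 1 shows it meets C exactly once. A Γ-plane through the axis would force
-- t ∈ {s, s̄}. A plane through two axes gives a Vandermonde system in s, s̄, s′, s̄′, so
-- distinct axes lie in no common plane and the q C 2 pencils are disjoint. Finally the q²
-- normalized planes through a point of C are the (q + 1) C 2 planes cut out by split
-- quadratics, which are not 1̄_C-planes, and the q C 2 pencil planes through that point;
-- hence every 1̄_C-plane lies in one of the pencils.

module Submission where

open import Defs
open import Algebra.Bundles using (CommutativeRing)
open import Data.Nat as ℕ using (ℕ; _≤_)
open import Data.Nat.DivMod using (_%_)
open import Data.Nat.Combinatorics using (_C_)
open import Data.Product using (Σ; _×_; _,_; proj₁)
open import Data.Sum using (_⊎_)
open import Relation.Binary.PropositionalEquality using (_≡_)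
open import Relation.Nullary using (¬_)

-- The ring solver of Tactic.RingSolver.NonReflective takes its coefficients from the
-- ring itself and cannot recognise zero coefficients in an abstract ring; here the
-- coefficients are integers, so normal forms are compared by computation in ℤ.
module IntegerCoefficientSolver {c ℓ} (R : CommutativeRing c ℓ) where

  open CommutativeRing R
  open import Data.Bool using (Bool; true; false; T)
  open import Data.Integer as ℤ using (ℤ; -[1+_]; _⊖_; sign; ∣_∣; _◃_)
  import Data.Integer.Properties as ℤ
  open import Data.Maybe using (nothing)
  open import Data.Nat as ℕ using (ℕ; zero; suc)
  import Data.Nat.Properties as ℕ
  open import Data.Sign as Sign using (Sign)
  open import Data.Vec using (Vec)
  open import Relation.Binary.PropositionalEquality using (cong)
  open import Relation.Binary.Reasoning.Setoid setoid
  import Tactic.RingSolver.Core.AlmostCommutativeRing as ACR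
  open import Tactic.RingSolver.Core.Polynomial.Parameters using (Homomorphism)
  open import Tactic.RingSolver.Core.Expression public using (Expr; Κ; Ι; _⊕_; _⊗_; ⊝_)
  open import Tactic.RingSolver.Core.Expression using (_⊛_; module Eval)
  open import Algebra.Properties.Ring ring using (-‿distribˡ-*; -‿distribʳ-*; -‿involutive; -0#≈0#; -‿+-comm)
  open import Algebra.Properties.Semiring.Mult.TCOptimised semiring
    using (1+×; ×-homo-+; ×1-homo-*) renaming (_×_ to _×′_)
  open import Algebra.Properties.CommutativeSemigroup +-commutativeSemigroup using (interchange)

  -- With the type-checking-optimised multiple, fromℕ 1 is 1# and fromℕ 3 is 1# + 1# + 1#.
  fromℕ : ℕ → Carrier
  fromℕ n = n ×′ 1#

  fromℕ-suc : ∀ n → fromℕ (suc n) ≈ 1# + fromℕ n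
  fromℕ-suc n = 1+× n 1#

  fromℕ-+ : ∀ m n → fromℕ (m ℕ.+ n) ≈ fromℕ m + fromℕ n
  fromℕ-+ = ×-homo-+ 1#

  fromℕ-* : ∀ m n → fromℕ (m ℕ.* n) ≈ fromℕ m * fromℕ n
  fromℕ-* = ×1-homo-*

  signed : Sign → Carrier → Carrier
  signed Sign.+ x = x
  signed Sign.- x = - x

  fromℤ : ℤ → Carrier
  fromℤ i = signed (sign i) (fromℕ ∣ i ∣)

  fromℤ-◃ : ∀ s n → fromℤ (s ◃ n) ≈ signed s (fromℕ n)
  fromℤ-◃ Sign.+ zero    = refl
  fromℤ-◃ Sign.- zero    = sym -0#≈0#
  fromℤ-◃ Sign.+ (suc n) = refl
  fromℤ-◃ Sign.- (suc n) = refl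

  signed-cong : ∀ s {x y} → x ≈ y → signed s x ≈ signed s y
  signed-cong Sign.+ eq = eq
  signed-cong Sign.- eq = -‿cong eq

  signed-* : ∀ s t x y → signed (s Sign.* t) (x * y) ≈ signed s x * signed t y
  signed-* Sign.+ Sign.+ x y = refl
  signed-* Sign.+ Sign.- x y = -‿distribʳ-* x y
  signed-* Sign.- Sign.+ x y = -‿distribˡ-* x y
  signed-* Sign.- Sign.- x y = begin
    x * y             ≈⟨ -‿involutive _ ⟨
    - - (x * y)       ≈⟨ -‿cong (-‿distribʳ-* x y) ⟩
    - (x * - y)       ≈⟨ -‿distribˡ-* x (- y) ⟩
    - x * - y         ∎

  fromℤ-* : ∀ i j → fromℤ (i ℤ.* j) ≈ fromℤ i * fromℤ j
  fromℤ-* i j = begin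
    fromℤ (i ℤ.* j)                                           ≈⟨ fromℤ-◃ (sign i Sign.* sign j) (∣ i ∣ ℕ.* ∣ j ∣) ⟩
    signed (sign i Sign.* sign j) (fromℕ (∣ i ∣ ℕ.* ∣ j ∣))   ≈⟨ signed-cong (sign i Sign.* sign j) (fromℕ-* ∣ i ∣ ∣ j ∣) ⟩
    signed (sign i Sign.* sign j) (fromℕ ∣ i ∣ * fromℕ ∣ j ∣) ≈⟨ signed-* (sign i) (sign j) _ _ ⟩
    fromℤ i * fromℤ j                                         ∎

  fromℤ-⊖ : ∀ m n → fromℤ (m ⊖ n) ≈ fromℕ m - fromℕ n
  fromℤ-⊖ m zero = begin
    fromℕ m           ≈⟨ +-identityʳ _ ⟨
    fromℕ m + 0#      ≈⟨ +-congˡ -0#≈0# ⟨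
    fromℕ m - 0#      ∎
  fromℤ-⊖ zero (suc n) = sym (+-identityˡ _)
  fromℤ-⊖ (suc m) (suc n) = begin
    fromℤ (suc m ⊖ suc n)                 ≡⟨ cong fromℤ (ℤ.[1+m]⊖[1+n]≡m⊖n m n) ⟩
    fromℤ (m ⊖ n)                         ≈⟨ fromℤ-⊖ m n ⟩
    fromℕ m - fromℕ n                     ≈⟨ +-identityˡ _ ⟨
    0# + (fromℕ m - fromℕ n)              ≈⟨ +-congʳ (-‿inverseʳ 1#) ⟨
    (1# - 1#) + (fromℕ m - fromℕ n)       ≈⟨ interchange 1# (- 1#) (fromℕ m) (- fromℕ n) ⟩
    (1# + fromℕ m) + (- 1# - fromℕ n)     ≈⟨ +-congˡ (-‿+-comm 1# (fromℕ n)) ⟩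
    (1# + fromℕ m) - (1# + fromℕ n)       ≈⟨ +-cong (fromℕ-suc m) (-‿cong (fromℕ-suc n)) ⟨
    fromℕ (suc m) - fromℕ (suc n)         ∎

  fromℤ-+ : ∀ i j → fromℤ (i ℤ.+ j) ≈ fromℤ i + fromℤ j
  fromℤ-+ -[1+ m ] -[1+ n ] = begin
    - fromℕ (suc (suc (m ℕ.+ n)))         ≡⟨ cong (λ k → - fromℕ (suc k)) (ℕ.+-suc m n) ⟨
    - fromℕ (suc m ℕ.+ suc n)             ≈⟨ -‿cong (fromℕ-+ (suc m) (suc n)) ⟩
    - (fromℕ (suc m) + fromℕ (suc n))     ≈⟨ -‿+-comm _ _ ⟨
    - fromℕ (suc m) - fromℕ (suc n)       ∎
  fromℤ-+ -[1+ m ] (ℤ.+ n) = trans (fromℤ-⊖ n (suc m)) (+-comm _ _)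
  fromℤ-+ (ℤ.+ m) -[1+ n ] = fromℤ-⊖ m (suc n)
  fromℤ-+ (ℤ.+ m) (ℤ.+ n) = fromℕ-+ m n

  fromℤ-neg : ∀ i → fromℤ (ℤ.- i) ≈ - fromℤ i
  fromℤ-neg -[1+ n ] = sym (-‿involutive _)
  fromℤ-neg (ℤ.+ zero) = sym -0#≈0#
  fromℤ-neg (ℤ.+ suc n) = refl

  private
    almostCommutativeRing : ACR.AlmostCommutativeRing _ _
    almostCommutativeRing = ACR.fromCommutativeRing R (λ _ → nothing)

    isZero : ℤ → Bool
    isZero (ℤ.+ zero) = true
    isZero _ = false

    isZero-sound : ∀ i → T (isZero i) → 0# ≈ fromℤ i
    isZero-sound (ℤ.+ zero) _ = refl

    homomorphism : Homomorphism _ _ _ _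
    homomorphism = record
      { from = record { rawRing = ℤ.+-*-rawRing ; isZero = isZero }
      ; to = almostCommutativeRing
      ; morphism = record
        { ⟦_⟧ = fromℤ ; +-homo = fromℤ-+ ; *-homo = fromℤ-* ; -‿homo = fromℤ-neg
        ; 0-homo = refl ; 1-homo = refl }
      ; Zero-C⟶Zero-R = isZero-sound }

    open Eval rawRing fromℤ
    open import Tactic.RingSolver.Core.Polynomial.Base (Homomorphism.from homomorphism)
    open import Tactic.RingSolver.Core.Polynomial.Semantics homomorphism renaming (⟦_⟧ to ⟦_⟧ₚ)
    open import Tactic.RingSolver.Core.Polynomial.Homomorphism homomorphism
    open import Algebra.Properties.Semiring.Exp.TCOptimised semiring using (^-congˡ)

    normalise : ∀ {n} → Expr ℤ n → Poly n
    normalise (Κ x) = κ x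
    normalise (Ι x) = ι x
    normalise (x ⊕ y) = normalise x ⊞ normalise y
    normalise (x ⊗ y) = normalise x ⊠ normalise y
    normalise (⊝ x) = ⊟ normalise x
    normalise (x ⊛ i) = normalise x ⊡ i

    ⟦_⇓⟧ : ∀ {n} → Expr ℤ n → Vec Carrier n → Carrier
    ⟦ e ⇓⟧ = ⟦ normalise e ⟧ₚ

    normalise-correct : ∀ {n} (e : Expr ℤ n) ρ → ⟦ e ⇓⟧ ρ ≈ ⟦ e ⟧ ρ
    normalise-correct (Κ x) ρ = κ-hom x ρ
    normalise-correct (Ι x) ρ = ι-hom x ρ
    normalise-correct (x ⊕ y) ρ =
      trans (⊞-hom (normalise x) (normalise y) ρ) (+-cong (normalise-correct x ρ) (normalise-correct y ρ))
    normalise-correct (x ⊗ y) ρ =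
      trans (⊠-hom (normalise x) (normalise y) ρ) (*-cong (normalise-correct x ρ) (normalise-correct y ρ))
    normalise-correct (⊝ x) ρ = trans (⊟-hom (normalise x) ρ) (-‿cong (normalise-correct x ρ))
    normalise-correct (x ⊛ i) ρ = trans (⊡-hom (normalise x) i ρ) (^-congˡ i (normalise-correct x ρ))

  open import Relation.Binary.Reflection setoid Ι ⟦_⟧ ⟦_⇓⟧ normalise-correct public
    using (solve) renaming (_⊜_ to _:=_)

  infixl 6 _:+_ _:-_
  infixl 7 _:*_
  infix 8 :-_
  _:+_ _:*_ _:-_ : ∀ {n} → Expr ℤ n → Expr ℤ n → Expr ℤ n
  _:+_ = _⊕_
  _:*_ = _⊗_
  x :- y = x ⊕ (⊝ y)

  :-_ : ∀ {n} → Expr ℤ n → Expr ℤ n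
  :-_ = ⊝_

  con : ∀ {n} → ℤ → Expr ℤ n
  con = Κ

  -- Iterated products rather than the solver's own exponent, so that
  -- e :^ k evaluates definitionally to a power x * (x * ... 1#).
  _:^_ : ∀ {n} → Expr ℤ n → ℕ → Expr ℤ n
  e :^ zero = Κ (ℤ.+ 1)
  e :^ suc k = e ⊗ (e :^ k)

module UniqueLists where

  open import Data.Empty using (⊥-elim)
  open import Data.List using (List; []; _∷_; _++_; length; map; foldr; concat; cartesianProduct)
  open import Data.List.Properties using (length-++; length-map)
  open import Data.List.Membership.Propositional using (_∈_; _∉_)
  open import Data.List.Membership.Propositional.Properties
    using (∈-∃++; ∈-map⁻; ∈-++⁻)
  open import Data.List.Membership.Propositional.Properties.WithK using (unique∧set⇒bag)
  open import Data.List.Relation.Binary.BagAndSetEquality using (∼bag⇒↭)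
  open import Data.List.Relation.Binary.Permutation.Propositional as ↭ using (_↭_; prep; swap)
  open import Data.List.Relation.Binary.Permutation.Propositional.Properties using (↭-length; ∈-resp-↭; shift)
  open import Data.List.Relation.Unary.All as All using (All; []; _∷_)
  open import Data.List.Relation.Unary.All.Properties using (All¬⇒¬Any; ¬Any⇒All¬)
  open import Data.List.Relation.Unary.AllPairs as AllPairs using (AllPairs; []; _∷_)
  open import Data.List.Relation.Unary.Any using (here; there)
  open import Data.List.Relation.Unary.Unique.Propositional using (Unique)
  import Data.List.Relation.Unary.Unique.Propositional.Properties as Unique
  open import Data.Nat using (zero; suc; _≤_; _+_; _*_; z≤n; s≤s)
  open import Data.Nat.Properties using (≤-trans; 1+n≰n; n≤1+n; +-suc)
  open import Data.Nat.Combinatorics using (_C_; nC1≡n; nCk+nC[k+1]≡[n+1]C[k+1])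
  open import Data.List.Relation.Binary.Disjoint.Propositional using (Disjoint)
  open import Data.Product using (∃; _×_; _,_; proj₁; proj₂)
  open import Data.Sum using (inj₁; inj₂)
  open import Function.Bundles using (_⇔_; mk⇔; Equivalence)
  open import Relation.Binary.PropositionalEquality
  open import Relation.Nullary using (¬_; Dec; yes; no)

  suc-C2 : ∀ n → suc n C 2 ≡ n + n C 2
  suc-C2 n = trans (sym (nCk+nC[k+1]≡[n+1]C[k+1] n 1)) (cong (_+ n C 2) (nC1≡n n))

  C2-double : ∀ n → n C 2 + n C 2 + n ≡ n * n
  C2-double zero = refl
  C2-double (suc n) = begin
    suc n C 2 + suc n C 2 + suc n              ≡⟨ cong (λ k → k + k + suc n) (suc-C2 n) ⟩
    (n + n C 2) + (n + n C 2) + suc n          ≡⟨ rearrange n (n C 2) ⟩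
    (n C 2 + n C 2 + n) + (n + n + 1)          ≡⟨ cong (_+ (n + n + 1)) (C2-double n) ⟩
    n * n + (n + n + 1)                        ≡⟨ square-suc n ⟩
    suc n * suc n                              ∎
    where
    open ≡-Reasoning
    open import Data.Nat.Tactic.RingSolver using (solve-∀)
    rearrange : ∀ n c → (n + c) + (n + c) + suc n ≡ (c + c + n) + (n + n + 1)
    rearrange = solve-∀
    square-suc : ∀ n → n * n + (n + n + 1) ≡ suc n * suc n
    square-suc = solve-∀

  unique-∷ : ∀ {A : Set} {x : A} {xs} → x ∉ xs → Unique xs → Unique (x ∷ xs)
  unique-∷ x∉xs u = ¬Any⇒All¬ _ x∉xs ∷ u

  module _ {A : Set} where

    ∈⇒↭∷ : ∀ {x : A} {ys} → x ∈ ys → ∃ λ ys′ → ys ↭ x ∷ ys′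
    ∈⇒↭∷ {x} x∈ys with ∈-∃++ x∈ys
    ... | ws , zs , refl = ws ++ zs , shift x ws zs

    unique-⊆⇒length≤ : ∀ {xs ys : List A} → Unique xs → (∀ {x} → x ∈ xs → x ∈ ys) → length xs ≤ length ys
    unique-⊆⇒length≤ {[]} _ _ = z≤n
    unique-⊆⇒length≤ {x ∷ xs} (x∉xs ∷ u) xs⊆ys with ∈⇒↭∷ (xs⊆ys (here refl))
    ... | ys′ , ys↭ = subst (suc (length xs) ≤_) (sym (↭-length ys↭)) (s≤s (unique-⊆⇒length≤ u xs⊆ys′))
      where
      xs⊆ys′ : ∀ {y} → y ∈ xs → y ∈ ys′
      xs⊆ys′ y∈xs with ∈-resp-↭ ys↭ (xs⊆ys (there y∈xs))
      ... | here refl = ⊥-elim (All¬⇒¬Any x∉xs y∈xs)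
      ... | there y∈ys′ = y∈ys′

    unique-⇔⇒↭ : ∀ {xs ys : List A} → Unique xs → Unique ys → (∀ {x} → x ∈ xs ⇔ x ∈ ys) → xs ↭ ys
    unique-⇔⇒↭ uxs uys same = ∼bag⇒↭ (unique∧set⇒bag uxs uys same)

    unique-⇔⇒length≡ : ∀ {xs ys : List A} → Unique xs → Unique ys → (∀ {x} → x ∈ xs ⇔ x ∈ ys) →
                       length xs ≡ length ys
    unique-⇔⇒length≡ uxs uys same = ↭-length (unique-⇔⇒↭ uxs uys same)

    module _ (_≟_ : (x y : A) → Dec (x ≡ y)) where
      open import Data.List.Membership.DecPropositional _≟_ using (_∈?_)

      unique-⊆-covers : ∀ {xs ys} → Unique xs → (∀ {x} → x ∈ xs → x ∈ ys) → length ys ≤ length xs →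
                        ∀ {y} → y ∈ ys → y ∈ xs
      unique-⊆-covers {xs} {ys} u xs⊆ys ys≤xs {y} y∈ys with y ∈? xs
      ... | yes y∈xs = y∈xs
      ... | no y∉xs = ⊥-elim (1+n≰n (≤-trans (unique-⊆⇒length≤ (unique-∷ y∉xs u) y∷xs⊆ys) ys≤xs))
        where
        y∷xs⊆ys : ∀ {x} → x ∈ y ∷ xs → x ∈ ys
        y∷xs⊆ys (here refl) = y∈ys
        y∷xs⊆ys (there x∈xs) = xs⊆ys x∈xs

    foldr-↭ : ∀ {B : Set} (g : A → B → B) (b : B) → (∀ x y c → g x (g y c) ≡ g y (g x c)) →
              ∀ {xs ys} → xs ↭ ys → foldr g b xs ≡ foldr g b ys
    foldr-↭ g b comm ↭.refl = refl
    foldr-↭ g b comm (prep x p) = cong (g x) (foldr-↭ g b comm p)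
    foldr-↭ g b comm (swap x y p) = trans (cong (λ c → g x (g y c)) (foldr-↭ g b comm p)) (comm x y _)
    foldr-↭ g b comm (↭.trans p p′) = trans (foldr-↭ g b comm p) (foldr-↭ g b comm p′)

    map-unique-on : ∀ {B : Set} (f : A → B) {xs} → Unique xs →
                    (∀ {x y} → x ∈ xs → y ∈ xs → f x ≡ f y → x ≡ y) → Unique (map f xs)
    map-unique-on f {[]} _ _ = []
    map-unique-on f {x ∷ xs} (x∉xs ∷ u) inj =
      unique-∷ fx∉ (map-unique-on f u (λ i j → inj (there i) (there j)))
      where
      fx∉ : f x ∉ map f xs
      fx∉ fx∈ with ∈-map⁻ f fx∈
      ... | y , y∈xs , fx≡fy = All¬⇒¬Any x∉xs (subst (_∈ xs) (sym (inj (here refl) (there y∈xs) fx≡fy)) y∈xs)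

    unique-resp-↭ : ∀ {xs ys : List A} → Unique xs → xs ↭ ys → Unique ys
    unique-resp-↭ u p = Perm.Unique-resp-↭ (↭.↭⇒↭ₛ′ isEquivalence p) u
      where import Data.List.Relation.Binary.Permutation.Setoid.Properties (setoid A) as Perm

    unorderedPairs : List A → List (A × A)
    unorderedPairs [] = []
    unorderedPairs (x ∷ xs) = map (x ,_) (x ∷ xs) ++ unorderedPairs xs

    length-unorderedPairs : ∀ xs → length (unorderedPairs xs) ≡ suc (length xs) C 2
    length-unorderedPairs [] = refl
    length-unorderedPairs (x ∷ xs) = begin
      length (map (x ,_) (x ∷ xs) ++ unorderedPairs xs) ≡⟨ length-++ (map (x ,_) (x ∷ xs)) ⟩
      length (map (x ,_) (x ∷ xs)) + length (unorderedPairs xs)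
        ≡⟨ cong₂ _+_ (length-map (x ,_) (x ∷ xs)) (length-unorderedPairs xs) ⟩
      suc (length xs) + suc (length xs) C 2 ≡⟨ sym (suc-C2 (suc (length xs))) ⟩
      suc (suc (length xs)) C 2 ∎
      where open ≡-Reasoning

    ∈-unorderedPairs⁻ : ∀ {a b} xs → (a , b) ∈ unorderedPairs xs → a ∈ xs × b ∈ xs
    ∈-unorderedPairs⁻ (x ∷ xs) ab∈ with ∈-++⁻ (map (x ,_) (x ∷ xs)) ab∈
    ... | inj₂ ab∈′ = let (a∈ , b∈) = ∈-unorderedPairs⁻ xs ab∈′ in there a∈ , there b∈
    ... | inj₁ ab∈x with ∈-map⁻ (x ,_) ab∈x
    ...   | _ , b∈ , refl = here refl , b∈

    unorderedPairs-unique : ∀ {xs} → Unique xs → Unique (unorderedPairs xs)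
    unorderedPairs-unique {[]} _ = []
    unorderedPairs-unique {x ∷ xs} u@(x∉xs ∷ u′) =
      Unique.++⁺ (Unique.map⁺ (cong proj₂) u) (unorderedPairs-unique u′) disjoint
      where
      disjoint : ∀ {v} → ¬ (v ∈ map (x ,_) (x ∷ xs) × v ∈ unorderedPairs xs)
      disjoint (v∈x , v∈) with ∈-map⁻ (x ,_) v∈x
      ... | _ , _ , refl = All¬⇒¬Any x∉xs (proj₁ (∈-unorderedPairs⁻ xs v∈))

    unorderedPairs-antisym : ∀ {xs a b} → Unique xs → (a , b) ∈ unorderedPairs xs →
                             (b , a) ∈ unorderedPairs xs → a ≡ b
    unorderedPairs-antisym {x ∷ xs} (x∉xs ∷ u) ab∈ ba∈
      with ∈-++⁻ (map (x ,_) (x ∷ xs)) ab∈ | ∈-++⁻ (map (x ,_) (x ∷ xs)) ba∈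
    ... | inj₁ ab∈x | inj₁ ba∈x with ∈-map⁻ (x ,_) ab∈x | ∈-map⁻ (x ,_) ba∈x
    ...   | _ , _ , refl | _ , _ , refl = refl
    unorderedPairs-antisym {x ∷ xs} (x∉xs ∷ u) ab∈ ba∈ | inj₁ ab∈x | inj₂ ba∈′ with ∈-map⁻ (x ,_) ab∈x
    ... | _ , _ , refl = ⊥-elim (All¬⇒¬Any x∉xs (proj₂ (∈-unorderedPairs⁻ xs ba∈′)))
    unorderedPairs-antisym {x ∷ xs} (x∉xs ∷ u) ab∈ ba∈ | inj₂ ab∈′ | inj₁ ba∈x with ∈-map⁻ (x ,_) ba∈x
    ... | _ , _ , refl = ⊥-elim (All¬⇒¬Any x∉xs (proj₂ (∈-unorderedPairs⁻ xs ab∈′)))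
    unorderedPairs-antisym {x ∷ xs} (x∉xs ∷ u) ab∈ ba∈ | inj₂ ab∈′ | inj₂ ba∈′ = unorderedPairs-antisym u ab∈′ ba∈′

    module _ (φ : A → A) (φ-involutive : ∀ x → φ (φ x) ≡ x) where

      record OrbitRepresentatives (xs : List A) : Set where
        field
          reps : List A
          reps-unique : Unique reps
          reps-⊆ : ∀ {x} → x ∈ reps → x ∈ xs
          reps-separated : ∀ {x y} → x ∈ reps → y ∈ reps → ¬ y ≡ φ x
          length-double : length xs ≡ length reps + length reps

      -- The natural number is fuel bounding the length of the list.
      orbitRepresentatives : ∀ n xs → length xs ≤ n → Unique xs →
                             (∀ {x} → x ∈ xs → φ x ∈ xs) → (∀ {x} → x ∈ xs → ¬ φ x ≡ x) →
                             OrbitRepresentatives xs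
      orbitRepresentatives _ [] _ _ _ _ = record
        { reps = [] ; reps-unique = [] ; reps-⊆ = λ () ; reps-separated = λ () ; length-double = refl }
      orbitRepresentatives (suc n) (w ∷ ws) (s≤s len≤n) (w∉ws ∷ u) closed fixed-point-free = record
        { reps = w ∷ R.reps
        ; reps-unique = unique-∷ (λ w∈ → All¬⇒¬Any w∉ws (ws′⊆ws (R.reps-⊆ w∈))) R.reps-unique
        ; reps-⊆ = λ { (here refl) → here refl ; (there x∈) → there (ws′⊆ws (R.reps-⊆ x∈)) }
        ; reps-separated = separated
        ; length-double = cong suc (trans (↭-length ws↭) (trans (cong suc R.length-double)
                            (sym (+-suc (length R.reps) (length R.reps)))))
        }
        where
        φw∈ws : φ w ∈ ws
        φw∈ws with closed (here refl)
        ... | here φw≡w = ⊥-elim (fixed-point-free (here refl) φw≡w)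
        ... | there φw∈ = φw∈
        ws′ : List A
        ws′ = proj₁ (∈⇒↭∷ φw∈ws)
        ws↭ : ws ↭ φ w ∷ ws′
        ws↭ = proj₂ (∈⇒↭∷ φw∈ws)
        φw∷ws′-unique : Unique (φ w ∷ ws′)
        φw∷ws′-unique = unique-resp-↭ u ws↭
        φw∉ws′ : φ w ∉ ws′
        φw∉ws′ = All¬⇒¬Any (AllPairs.head φw∷ws′-unique)
        ws′⊆ws : ∀ {x} → x ∈ ws′ → x ∈ ws
        ws′⊆ws x∈ = ∈-resp-↭ (↭.↭-sym ws↭) (there x∈)
        closed′ : ∀ {x} → x ∈ ws′ → φ x ∈ ws′
        closed′ {x} x∈ with closed (there (ws′⊆ws x∈))
        ... | here φx≡w = ⊥-elim (φw∉ws′ (subst (_∈ ws′) (trans (sym (φ-involutive x)) (cong φ φx≡w)) x∈))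
        ... | there φx∈ws with ∈-resp-↭ ws↭ φx∈ws
        ...   | here φx≡φw = ⊥-elim (All¬⇒¬Any w∉ws (subst (_∈ ws)
                  (trans (sym (φ-involutive x)) (trans (cong φ φx≡φw) (φ-involutive w))) (ws′⊆ws x∈)))
        ...   | there φx∈ = φx∈
        module R = OrbitRepresentatives (orbitRepresentatives n ws′
          (≤-trans (n≤1+n _) (subst (_≤ n) (↭-length ws↭) len≤n)) (AllPairs.tail φw∷ws′-unique)
          closed′ (λ x∈ → fixed-point-free (there (ws′⊆ws x∈))))
        separated : ∀ {x y} → x ∈ w ∷ R.reps → y ∈ w ∷ R.reps → ¬ y ≡ φ x
        separated (here refl) (here refl) w≡φw = fixed-point-free (here refl) (sym w≡φw)
        separated (here refl) (there y∈) y≡φw = φw∉ws′ (subst (_∈ ws′) y≡φw (R.reps-⊆ y∈))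
        separated (there x∈) (here refl) w≡φx =
          φw∉ws′ (subst (_∈ ws′) (trans (sym (φ-involutive _)) (cong φ (sym w≡φx))) (R.reps-⊆ x∈))
        separated (there x∈) (there y∈) = R.reps-separated x∈ y∈

  HasCount-unique : ∀ {A : Set} {P : A → Set} {m n} → HasCount P m → HasCount P n → m ≡ n
  HasCount-unique (xs , uxs , xs⇔ , refl) (ys , uys , ys⇔ , refl) =
    unique-⇔⇒length≡ uxs uys (λ {x} → mk⇔ (λ x∈ → Equivalence.from (ys⇔ x) (Equivalence.to (xs⇔ x) x∈))
                                          (λ x∈ → Equivalence.from (xs⇔ x) (Equivalence.to (ys⇔ x) x∈)))

  length-concat-const : ∀ {A B : Set} (f : A → List B) (xs : List A) k →
                        (∀ {x} → x ∈ xs → length (f x) ≡ k) → length (concat (map f xs)) ≡ length xs * k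
  length-concat-const f [] k _ = refl
  length-concat-const f (x ∷ xs) k len =
    trans (length-++ (f x)) (cong₂ _+_ (len (here refl)) (length-concat-const f xs k (λ x∈ → len (there x∈))))

  concat-map-unique : ∀ {A B : Set} (f : A → List B) {xs} → Unique xs → (∀ {x} → x ∈ xs → Unique (f x)) →
                      (∀ {x y} → x ∈ xs → y ∈ xs → ¬ x ≡ y → ∀ {v} → ¬ (v ∈ f x × v ∈ f y)) →
                      Unique (concat (map f xs))
  concat-map-unique f {xs} u each disjoint = Unique.concat⁺ (all xs each) (allPairs u disjoint)
    where
    all : ∀ ys → (∀ {x} → x ∈ ys → Unique (f x)) → All Unique (map f ys)
    all [] _ = []
    all (y ∷ ys) h = h (here refl) ∷ all ys (λ x∈ → h (there x∈))
    allPairs : ∀ {ys} → Unique ys → (∀ {x y} → x ∈ ys → y ∈ ys → ¬ x ≡ y → ∀ {v} → ¬ (v ∈ f x × v ∈ f y)) →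
               AllPairs Disjoint (map f ys)
    allPairs {[]} _ _ = []
    allPairs {y ∷ ys} (y∉ys ∷ u′) h = heads ys y∉ys (λ x∈ → x∈) ∷ allPairs u′ (λ x∈ y∈ → h (there x∈) (there y∈))
      where
      heads : ∀ zs → All (λ z → ¬ y ≡ z) zs → (∀ {z} → z ∈ zs → z ∈ ys) → All (Disjoint (f y)) (map f zs)
      heads [] _ _ = []
      heads (z ∷ zs) (y≢z ∷ y∉) zs⊆ = h (here refl) (there (zs⊆ (here refl))) y≢z ∷ heads zs y∉ (λ z∈ → zs⊆ (there z∈))

  length-cartesianProduct : ∀ {A B : Set} (xs : List A) (ys : List B) →
                            length (cartesianProduct xs ys) ≡ length xs * length ys
  length-cartesianProduct [] ys = refl
  length-cartesianProduct (x ∷ xs) ys =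
    trans (length-++ (map (x ,_) ys)) (cong₂ _+_ (length-map (x ,_) ys) (length-cartesianProduct xs ys))

module FiniteFieldProperties {n : ℕ} (F : FiniteField n) where

  open FiniteField F public
  open import Data.Empty using (⊥-elim)
  open import Data.Integer as ℤ using (ℤ)
  open import Data.List using (List; []; _∷_; _++_; length; foldr; map; replicate)
  open import Data.List.Properties using (length-++; length-replicate)
  open import Data.List.Membership.Propositional using (_∈_)
  open import Data.List.Membership.Propositional.Properties using (∈-map⁺; ∈-map⁻)
  open import Data.List.Relation.Binary.Permutation.Propositional using (_↭_)
  open import Data.List.Relation.Binary.Permutation.Propositional.Properties using (↭-length; ∈-resp-↭)
  open import Data.List.Relation.Unary.All as All using (All; []; _∷_)
  open import Data.List.Relation.Unary.All.Properties using (All¬⇒¬Any; ++⁻ʳ)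
  open import Data.List.Relation.Unary.AllPairs as AllPairs using (_∷_)
  open import Data.List.Relation.Unary.Any using (here; there)
  open import Data.List.Relation.Unary.Unique.Propositional using (Unique)
  import Data.List.Relation.Unary.Unique.Propositional.Properties as Unique
  open import Data.Nat as ℕ using (zero; suc; _≤_; z≤n; s≤s)
  import Data.Nat.Properties as ℕ
  open import Data.Product using (_,_; proj₁; proj₂)
  open import Data.Sum using (_⊎_; inj₁; inj₂)
  open import Function.Bundles using (mk⇔)
  open import Relation.Binary.PropositionalEquality
  open import Relation.Nullary using (¬_; yes; no)
  open UniqueLists

  ring : CommutativeRing _ _
  ring = record { isCommutativeRing = isCommutativeRing }

  open CommutativeRing ring public
    using (_-_; +-comm; +-assoc; *-comm; *-assoc; +-identityˡ; +-identityʳ; *-identityˡ; *-identityʳ;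
           zeroˡ; zeroʳ; -‿inverseˡ; -‿inverseʳ)
  open IntegerCoefficientSolver ring public
    using (fromℕ; fromℕ-suc; fromℕ-+; fromℕ-*; solve; _:=_; _:+_; _:-_; _:*_; :-_; _:^_; con)

  1≢0 : ¬ 1# ≡ 0#
  1≢0 1≡0 = 0≢1 (sym 1≡0)

  -‿involutive : ∀ x → - - x ≡ x
  -‿involutive = solve 1 (λ x → :- (:- x) := x) refl

  -0≡0 : - 0# ≡ 0#
  -0≡0 = solve 0 (:- con (ℤ.+ 0) := con (ℤ.+ 0)) refl

  -‿injective : ∀ {x y} → - x ≡ - y → x ≡ y
  -‿injective {x} {y} eq = trans (sym (-‿involutive x)) (trans (cong -_ eq) (-‿involutive y))

  -‿nonzero : ∀ {x} → ¬ x ≡ 0# → ¬ - x ≡ 0#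
  -‿nonzero x≢0 -x≡0 = x≢0 (-‿injective (trans -x≡0 (sym -0≡0)))

  x-y≡0⇒x≡y : ∀ {x y} → x - y ≡ 0# → x ≡ y
  x-y≡0⇒x≡y {x} {y} eq = begin
    x             ≡⟨ solve 2 (λ x y → x := (x :- y) :+ y) refl x y ⟩
    (x - y) + y   ≡⟨ cong (_+ y) eq ⟩
    0# + y        ≡⟨ +-identityˡ y ⟩
    y             ∎
    where open ≡-Reasoning

  0-x*0≡0 : ∀ x → 0# - x * 0# ≡ 0#
  0-x*0≡0 = solve 1 (λ x → con (ℤ.+ 0) :- x :* con (ℤ.+ 0) := con (ℤ.+ 0)) refl

  x≢y⇒x-y≢0 : ∀ {x y} → ¬ x ≡ y → ¬ x - y ≡ 0#
  x≢y⇒x-y≢0 x≢y eq = x≢y (x-y≡0⇒x≡y eq)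

  x+z≡y+z⇒x≡y : ∀ {x y} z → x + z ≡ y + z → x ≡ y
  x+z≡y+z⇒x≡y {x} {y} z eq = x-y≡0⇒x≡y (begin
    x - y                  ≡⟨ solve 3 (λ x y z → x :- y := (x :+ z) :- (y :+ z)) refl x y z ⟩
    (x + z) - (y + z)      ≡⟨ cong (_- (y + z)) eq ⟩
    (y + z) - (y + z)      ≡⟨ -‿inverseʳ (y + z) ⟩
    0#                     ∎)
    where open ≡-Reasoning

  ⁻¹-inverseˡ : ∀ x → ¬ x ≡ 0# → x ⁻¹ * x ≡ 1#
  ⁻¹-inverseˡ x x≢0 = trans (*-comm _ _) (inverse x x≢0)

  *-cancelˡ : ∀ x {y z} → ¬ x ≡ 0# → x * y ≡ x * z → y ≡ z
  *-cancelˡ x {y} {z} x≢0 eq = begin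
    y                ≡⟨ sym (*-identityˡ y) ⟩
    1# * y           ≡⟨ cong (_* y) (sym (⁻¹-inverseˡ x x≢0)) ⟩
    x ⁻¹ * x * y     ≡⟨ *-assoc _ _ _ ⟩
    x ⁻¹ * (x * y)   ≡⟨ cong (x ⁻¹ *_) eq ⟩
    x ⁻¹ * (x * z)   ≡⟨ sym (*-assoc _ _ _) ⟩
    x ⁻¹ * x * z     ≡⟨ cong (_* z) (⁻¹-inverseˡ x x≢0) ⟩
    1# * z           ≡⟨ *-identityˡ z ⟩
    z                ∎
    where open ≡-Reasoning

  *-zero-product : ∀ x y → x * y ≡ 0# → x ≡ 0# ⊎ y ≡ 0#
  *-zero-product x y xy≡0 with x ≟ 0#
  ... | yes x≡0 = inj₁ x≡0
  ... | no x≢0 = inj₂ (*-cancelˡ x x≢0 (trans xy≡0 (sym (zeroʳ x))))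

  *-nonzero : ∀ {x y} → ¬ x ≡ 0# → ¬ y ≡ 0# → ¬ x * y ≡ 0#
  *-nonzero x≢0 y≢0 xy≡0 with *-zero-product _ _ xy≡0
  ... | inj₁ x≡0 = x≢0 x≡0
  ... | inj₂ y≡0 = y≢0 y≡0

  *-cancelˡ-zero : ∀ {x y} → ¬ x ≡ 0# → x * y ≡ 0# → y ≡ 0#
  *-cancelˡ-zero {x} x≢0 xy≡0 = *-cancelˡ x x≢0 (trans xy≡0 (sym (zeroʳ x)))

  ⁻¹-nonzero : ∀ x → ¬ x ≡ 0# → ¬ x ⁻¹ ≡ 0#
  ⁻¹-nonzero x x≢0 x⁻¹≡0 = 0≢1 (trans (sym (zeroʳ x)) (trans (cong (x *_) (sym x⁻¹≡0)) (inverse x x≢0)))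

  ^-homo-* : ∀ x a b → x ^ (a ℕ.+ b) ≡ x ^ a * x ^ b
  ^-homo-* x zero b = sym (*-identityˡ _)
  ^-homo-* x (suc a) b = trans (cong (x *_) (^-homo-* x a b)) (sym (*-assoc _ _ _))

  ^-assocʳ : ∀ x a b → x ^ (a ℕ.* b) ≡ (x ^ a) ^ b
  ^-assocʳ x a zero = cong (x ^_) (ℕ.*-zeroʳ a)
  ^-assocʳ x a (suc b) = begin
    x ^ (a ℕ.* suc b)        ≡⟨ cong (x ^_) (ℕ.*-suc a b) ⟩
    x ^ (a ℕ.+ a ℕ.* b)      ≡⟨ ^-homo-* x a (a ℕ.* b) ⟩
    x ^ a * x ^ (a ℕ.* b)    ≡⟨ cong (x ^ a *_) (^-assocʳ x a b) ⟩
    x ^ a * (x ^ a) ^ b      ∎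
    where open ≡-Reasoning

  ^-distrib-* : ∀ x y a → (x * y) ^ a ≡ x ^ a * y ^ a
  ^-distrib-* x y zero = sym (*-identityˡ 1#)
  ^-distrib-* x y (suc a) = trans (cong ((x * y) *_) (^-distrib-* x y a))
    (solve 4 (λ x y p q → (x :* y) :* (p :* q) := (x :* p) :* (y :* q)) refl x y (x ^ a) (y ^ a))

  1^ : ∀ a → 1# ^ a ≡ 1#
  1^ zero = refl
  1^ (suc a) = trans (*-identityˡ _) (1^ a)

  ^-nonzero : ∀ x a → ¬ x ≡ 0# → ¬ x ^ a ≡ 0#
  ^-nonzero x zero x≢0 = 1≢0
  ^-nonzero x (suc a) x≢0 = *-nonzero x≢0 (^-nonzero x a x≢0)

  ^-⁻¹ : ∀ x a → ¬ x ≡ 0# → x ^ a * (x ⁻¹) ^ a ≡ 1#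
  ^-⁻¹ x a x≢0 = trans (sym (^-distrib-* x (x ⁻¹) a)) (trans (cong (_^ a) (inverse x x≢0)) (1^ a))


  sum product : List Carrier → Carrier
  sum = foldr _+_ 0#
  product = foldr _*_ 1#

  sum-↭ : ∀ {xs ys} → xs ↭ ys → sum xs ≡ sum ys
  sum-↭ = foldr-↭ _+_ 0# (solve 3 (λ x y c → x :+ (y :+ c) := y :+ (x :+ c)) refl)

  product-↭ : ∀ {xs ys} → xs ↭ ys → product xs ≡ product ys
  product-↭ = foldr-↭ _*_ 1# (solve 3 (λ x y c → x :* (y :* c) := y :* (x :* c)) refl)

  sum-map-1+ : ∀ xs → sum (map (1# +_) xs) ≡ fromℕ (length xs) + sum xs
  sum-map-1+ [] = sym (+-identityʳ 0#)
  sum-map-1+ (x ∷ xs) = begin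
    (1# + x) + sum (map (1# +_) xs)           ≡⟨ cong ((1# + x) +_) (sum-map-1+ xs) ⟩
    (1# + x) + (fromℕ (length xs) + sum xs)   ≡⟨ solve 4 (λ o x k s → (o :+ x) :+ (k :+ s) := (o :+ k) :+ (x :+ s))
                                                   refl 1# x (fromℕ (length xs)) (sum xs) ⟩
    (1# + fromℕ (length xs)) + (x + sum xs)   ≡⟨ cong (_+ (x + sum xs)) (sym (fromℕ-suc (length xs))) ⟩
    fromℕ (suc (length xs)) + (x + sum xs)    ∎
    where open ≡-Reasoning

  -- Translation by 1 permutes the field, so summing over it shows n · 1 = 0.
  fromℕ-order≡0 : fromℕ n ≡ 0#
  fromℕ-order≡0 = x+z≡y+z⇒x≡y (sum elements) (begin
    fromℕ n + sum elements                      ≡⟨ cong (λ k → fromℕ k + sum elements) (sym size) ⟩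
    fromℕ (length elements) + sum elements      ≡⟨ sym (sum-map-1+ elements) ⟩
    sum (map (1# +_) elements)                  ≡⟨ sum-↭ translation-↭ ⟩
    sum elements                                ≡⟨ sym (+-identityˡ _) ⟩
    0# + sum elements                           ∎)
    where
    open ≡-Reasoning
    translation-↭ : map (1# +_) elements ↭ elements
    translation-↭ = unique-⇔⇒↭ (Unique.map⁺ (λ {x} {y} eq → x+z≡y+z⇒x≡y 1# (trans (+-comm x 1#) (trans eq (+-comm 1# y)))) unique)
      unique (λ {y} → mk⇔ (λ _ → complete y) (λ _ → subst (_∈ map (1# +_) elements)
        (solve 1 (λ y → con (ℤ.+ 1) :+ (y :- con (ℤ.+ 1)) := y) refl y) (∈-map⁺ (1# +_) (complete (y - 1#)))))

  private
    elements↭0∷ = ∈⇒↭∷ (complete 0#)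

  nonzeroElements : List Carrier
  nonzeroElements = proj₁ elements↭0∷

  nonzeroElements-unique : Unique nonzeroElements
  nonzeroElements-unique = AllPairs.tail (unique-resp-↭ unique (proj₂ elements↭0∷))

  nonzeroElements-sound : ∀ {y} → y ∈ nonzeroElements → ¬ y ≡ 0#
  nonzeroElements-sound y∈ refl = All¬⇒¬Any (AllPairs.head (unique-resp-↭ unique (proj₂ elements↭0∷))) y∈

  nonzeroElements-complete : ∀ y → ¬ y ≡ 0# → y ∈ nonzeroElements
  nonzeroElements-complete y y≢0 with ∈-resp-↭ (proj₂ elements↭0∷) (complete y)
  ... | here y≡0 = ⊥-elim (y≢0 y≡0)
  ... | there y∈ = y∈

  order≡1+ : n ≡ suc (length nonzeroElements)
  order≡1+ = trans (sym size) (↭-length (proj₂ elements↭0∷))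

  1≤order : 1 ≤ n
  1≤order = subst (1 ≤_) (sym order≡1+) (s≤s z≤n)

  2≤order : 2 ≤ n
  2≤order with nonzeroElements | nonzeroElements-complete 1# 1≢0 | order≡1+
  ... | _ ∷ _ | _ | n≡ = subst (2 ≤_) (sym n≡) (s≤s (s≤s z≤n))

  product-map-* : ∀ x xs → product (map (x *_) xs) ≡ x ^ length xs * product xs
  product-map-* x [] = sym (*-identityˡ 1#)
  product-map-* x (y ∷ xs) = trans (cong (x * y *_) (product-map-* x xs))
    (solve 4 (λ x y p s → (x :* y) :* (p :* s) := (x :* p) :* (y :* s)) refl x y (x ^ length xs) (product xs))

  product-nonzero : ∀ xs → (∀ {y} → y ∈ xs → ¬ y ≡ 0#) → ¬ product xs ≡ 0#
  product-nonzero [] _ = 1≢0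
  product-nonzero (y ∷ xs) h = *-nonzero (h (here refl)) (product-nonzero xs (λ y∈ → h (there y∈)))

  -- Multiplication by x ≠ 0 permutes the nonzero elements.
  fermat-nonzero : ∀ x → ¬ x ≡ 0# → x ^ length nonzeroElements ≡ 1#
  fermat-nonzero x x≢0 = *-cancelˡ P (product-nonzero nonzeroElements nonzeroElements-sound) (begin
    P * x ^ length nonzeroElements   ≡⟨ *-comm _ _ ⟩
    x ^ length nonzeroElements * P   ≡⟨ sym (product-map-* x nonzeroElements) ⟩
    product (map (x *_) nonzeroElements) ≡⟨ product-↭ scaling-↭ ⟩
    P                                ≡⟨ sym (*-identityʳ P) ⟩
    P * 1#                           ∎)
    where
    open ≡-Reasoning
    P = product nonzeroElements
    scaling-↭ : map (x *_) nonzeroElements ↭ nonzeroElements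
    scaling-↭ = unique-⇔⇒↭ (Unique.map⁺ (*-cancelˡ x x≢0) nonzeroElements-unique) nonzeroElements-unique
      (λ {y} → mk⇔ (λ y∈ → let (a , a∈ , y≡) = ∈-map⁻ (x *_) y∈ in
                   subst (_∈ nonzeroElements) (sym y≡)
                     (nonzeroElements-complete _ (*-nonzero x≢0 (nonzeroElements-sound a∈))))
           (λ y∈ → subst (_∈ map (x *_) nonzeroElements) (x*x⁻¹y≡y y)
              (∈-map⁺ (x *_) (nonzeroElements-complete (x ⁻¹ * y)
                (*-nonzero (⁻¹-nonzero x x≢0) (nonzeroElements-sound y∈))))))
      where
      x*x⁻¹y≡y : ∀ y → x * (x ⁻¹ * y) ≡ y
      x*x⁻¹y≡y y = trans (sym (*-assoc _ _ _)) (trans (cong (_* y) (inverse x x≢0)) (*-identityˡ y))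

  fermat : ∀ x → x ^ n ≡ x
  fermat x with x ≟ 0#
  ... | yes refl = subst (λ k → 0# ^ k ≡ 0#) (sym order≡1+) (zeroˡ _)
  ... | no x≢0 = subst (λ k → x ^ k ≡ x) (sym order≡1+)
                   (trans (cong (x *_) (fermat-nonzero x x≢0)) (*-identityʳ x))

  *-difference-zero : ∀ {x a b} → ¬ a ≡ b → x * (a - b) ≡ 0# → x ≡ 0#
  *-difference-zero {x} {a} {b} a≢b eq =
    *-cancelˡ-zero (x≢y⇒x-y≢0 a≢b) (trans (*-comm (a - b) x) eq)

  vandermonde₂ : ∀ x₁ x₂ σ₁ σ₂ → ¬ σ₁ ≡ σ₂ → x₁ + x₂ ≡ 0# → x₁ * σ₁ + x₂ * σ₂ ≡ 0# → x₁ ≡ 0#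
  vandermonde₂ x₁ x₂ σ₁ σ₂ σ₁≢σ₂ e₀ e₁ = *-difference-zero σ₁≢σ₂ (begin
    x₁ * (σ₁ - σ₂)                          ≡⟨ solve 4 (λ x₁ x₂ s₁ s₂ → x₁ :* (s₁ :- s₂) := (x₁ :* s₁ :+ x₂ :* s₂) :- s₂ :* (x₁ :+ x₂))
                                                 refl x₁ x₂ σ₁ σ₂ ⟩
    (x₁ * σ₁ + x₂ * σ₂) - σ₂ * (x₁ + x₂)    ≡⟨ cong₂ (λ u v → u - σ₂ * v) e₁ e₀ ⟩
    0# - σ₂ * 0#                            ≡⟨ 0-x*0≡0 σ₂ ⟩
    0#                                      ∎)
    where open ≡-Reasoning

  vandermonde₃ : ∀ x₁ x₂ x₃ σ₁ σ₂ σ₃ → ¬ σ₁ ≡ σ₂ → ¬ σ₁ ≡ σ₃ → ¬ σ₂ ≡ σ₃ →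
                 x₁ + x₂ + x₃ ≡ 0# → x₁ * σ₁ + x₂ * σ₂ + x₃ * σ₃ ≡ 0# →
                 x₁ * (σ₁ * σ₁) + x₂ * (σ₂ * σ₂) + x₃ * (σ₃ * σ₃) ≡ 0# → x₁ ≡ 0#
  vandermonde₃ x₁ x₂ x₃ σ₁ σ₂ σ₃ σ₁≢σ₂ σ₁≢σ₃ σ₂≢σ₃ e₀ e₁ e₂ =
    *-difference-zero σ₁≢σ₃ (vandermonde₂ _ _ σ₁ σ₂ σ₁≢σ₂ f₀ f₁)
    where
    f₀ : x₁ * (σ₁ - σ₃) + x₂ * (σ₂ - σ₃) ≡ 0#
    f₀ = trans (solve 6 (λ x₁ x₂ x₃ s₁ s₂ s₃ → x₁ :* (s₁ :- s₃) :+ x₂ :* (s₂ :- s₃)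
                 := (x₁ :* s₁ :+ x₂ :* s₂ :+ x₃ :* s₃) :- s₃ :* (x₁ :+ x₂ :+ x₃)) refl x₁ x₂ x₃ σ₁ σ₂ σ₃)
           (trans (cong₂ (λ u v → u - σ₃ * v) e₁ e₀) (0-x*0≡0 σ₃))
    f₁ : x₁ * (σ₁ - σ₃) * σ₁ + x₂ * (σ₂ - σ₃) * σ₂ ≡ 0#
    f₁ = trans (solve 6 (λ x₁ x₂ x₃ s₁ s₂ s₃ → x₁ :* (s₁ :- s₃) :* s₁ :+ x₂ :* (s₂ :- s₃) :* s₂
                 := (x₁ :* (s₁ :* s₁) :+ x₂ :* (s₂ :* s₂) :+ x₃ :* (s₃ :* s₃)) :- s₃ :* (x₁ :* s₁ :+ x₂ :* s₂ :+ x₃ :* s₃))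
                 refl x₁ x₂ x₃ σ₁ σ₂ σ₃)
           (trans (cong₂ (λ u v → u - σ₃ * v) e₂ e₁) (0-x*0≡0 σ₃))

  vandermonde₄ : ∀ x₁ x₂ x₃ x₄ σ₁ σ₂ σ₃ σ₄ → ¬ σ₁ ≡ σ₂ → ¬ σ₁ ≡ σ₃ → ¬ σ₁ ≡ σ₄ → ¬ σ₂ ≡ σ₃ →
                 x₁ + x₂ + x₃ + x₄ ≡ 0# → x₁ * σ₁ + x₂ * σ₂ + x₃ * σ₃ + x₄ * σ₄ ≡ 0# →
                 x₁ * (σ₁ * σ₁) + x₂ * (σ₂ * σ₂) + x₃ * (σ₃ * σ₃) + x₄ * (σ₄ * σ₄) ≡ 0# →
                 x₁ * (σ₁ * σ₁ * σ₁) + x₂ * (σ₂ * σ₂ * σ₂) + x₃ * (σ₃ * σ₃ * σ₃) + x₄ * (σ₄ * σ₄ * σ₄) ≡ 0# → x₁ ≡ 0#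
  vandermonde₄ x₁ x₂ x₃ x₄ σ₁ σ₂ σ₃ σ₄ σ₁≢σ₂ σ₁≢σ₃ σ₁≢σ₄ σ₂≢σ₃ e₀ e₁ e₂ e₃ =
    *-difference-zero σ₁≢σ₄ (vandermonde₃ _ _ _ σ₁ σ₂ σ₃ σ₁≢σ₂ σ₁≢σ₃ σ₂≢σ₃ f₀ f₁ f₂)
    where
    y : Carrier → Carrier → Carrier
    y x σ = x * (σ - σ₄)
    f₀ : y x₁ σ₁ + y x₂ σ₂ + y x₃ σ₃ ≡ 0#
    f₀ = trans (solve 8 (λ x₁ x₂ x₃ x₄ s₁ s₂ s₃ s₄ → x₁ :* (s₁ :- s₄) :+ x₂ :* (s₂ :- s₄) :+ x₃ :* (s₃ :- s₄)
                 := (x₁ :* s₁ :+ x₂ :* s₂ :+ x₃ :* s₃ :+ x₄ :* s₄) :- s₄ :* (x₁ :+ x₂ :+ x₃ :+ x₄)) refl x₁ x₂ x₃ x₄ σ₁ σ₂ σ₃ σ₄)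
           (trans (cong₂ (λ u v → u - σ₄ * v) e₁ e₀) (0-x*0≡0 σ₄))
    f₁ : y x₁ σ₁ * σ₁ + y x₂ σ₂ * σ₂ + y x₃ σ₃ * σ₃ ≡ 0#
    f₁ = trans (solve 8 (λ x₁ x₂ x₃ x₄ s₁ s₂ s₃ s₄ → x₁ :* (s₁ :- s₄) :* s₁ :+ x₂ :* (s₂ :- s₄) :* s₂ :+ x₃ :* (s₃ :- s₄) :* s₃
                 := (x₁ :* (s₁ :* s₁) :+ x₂ :* (s₂ :* s₂) :+ x₃ :* (s₃ :* s₃) :+ x₄ :* (s₄ :* s₄))
                    :- s₄ :* (x₁ :* s₁ :+ x₂ :* s₂ :+ x₃ :* s₃ :+ x₄ :* s₄)) refl x₁ x₂ x₃ x₄ σ₁ σ₂ σ₃ σ₄)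
           (trans (cong₂ (λ u v → u - σ₄ * v) e₂ e₁) (0-x*0≡0 σ₄))
    f₂ : y x₁ σ₁ * (σ₁ * σ₁) + y x₂ σ₂ * (σ₂ * σ₂) + y x₃ σ₃ * (σ₃ * σ₃) ≡ 0#
    f₂ = trans (solve 8 (λ x₁ x₂ x₃ x₄ s₁ s₂ s₃ s₄ →
                   x₁ :* (s₁ :- s₄) :* (s₁ :* s₁) :+ x₂ :* (s₂ :- s₄) :* (s₂ :* s₂) :+ x₃ :* (s₃ :- s₄) :* (s₃ :* s₃)
                 := (x₁ :* (s₁ :* s₁ :* s₁) :+ x₂ :* (s₂ :* s₂ :* s₂) :+ x₃ :* (s₃ :* s₃ :* s₃) :+ x₄ :* (s₄ :* s₄ :* s₄))
                    :- s₄ :* (x₁ :* (s₁ :* s₁) :+ x₂ :* (s₂ :* s₂) :+ x₃ :* (s₃ :* s₃) :+ x₄ :* (s₄ :* s₄)))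
                 refl x₁ x₂ x₃ x₄ σ₁ σ₂ σ₃ σ₄)
           (trans (cong₂ (λ u v → u - σ₄ * v) e₃ e₂) (0-x*0≡0 σ₄))

  module Polynomial where

    -- Coefficient lists, constant term first.
    Poly : Set
    Poly = List Carrier

    eval : Poly → Carrier → Carrier
    eval [] x = 0#
    eval (a ∷ as) x = a + x * eval as x

    IsZero : Poly → Set
    IsZero = All (_≡ 0#)

    eval-IsZero : ∀ p x → IsZero p → eval p x ≡ 0#
    eval-IsZero [] x _ = refl
    eval-IsZero (a ∷ p) x (a≡0 ∷ p≡0) =
      trans (cong₂ (λ u v → u + x * v) a≡0 (eval-IsZero p x p≡0)) (trans (+-identityˡ _) (zeroʳ x))

    divide : Carrier → Poly → Poly
    divide r [] = []
    divide r (a ∷ []) = []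
    divide r (a ∷ b ∷ bs) = eval (b ∷ bs) r ∷ divide r (b ∷ bs)

    length-divide : ∀ r p → length (divide r p) ≡ ℕ.pred (length p)
    length-divide r [] = refl
    length-divide r (a ∷ []) = refl
    length-divide r (a ∷ b ∷ bs) = cong suc (length-divide r (b ∷ bs))

    eval-divide : ∀ r p x → eval p x ≡ eval p r + (x - r) * eval (divide r p) x
    eval-divide r [] x = solve 2 (λ x r → con (ℤ.+ 0) := con (ℤ.+ 0) :+ (x :- r) :* con (ℤ.+ 0)) refl x r
    eval-divide r (a ∷ []) x =
      solve 3 (λ a x r → a :+ x :* con (ℤ.+ 0) := (a :+ r :* con (ℤ.+ 0)) :+ (x :- r) :* con (ℤ.+ 0)) refl a x r
    eval-divide r (a ∷ b ∷ bs) x = begin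
      a + x * E                        ≡⟨ cong (λ e → a + x * e) (eval-divide r (b ∷ bs) x) ⟩
      a + x * (Er + (x - r) * Q)       ≡⟨ solve 5 (λ a x r er q → a :+ x :* (er :+ (x :- r) :* q)
                                            := (a :+ r :* er) :+ (x :- r) :* (er :+ x :* q)) refl a x r Er Q ⟩
      (a + r * Er) + (x - r) * (Er + x * Q) ∎
      where
      open ≡-Reasoning
      E = eval (b ∷ bs) x
      Er = eval (b ∷ bs) r
      Q = eval (divide r (b ∷ bs)) x

    IsZero-divide⇒IsZero : ∀ r p → IsZero (divide r p) → eval p r ≡ 0# → IsZero p
    IsZero-divide⇒IsZero r [] _ _ = []
    IsZero-divide⇒IsZero r (a ∷ []) _ pr≡0 = trans (sym (trans (cong (a +_) (zeroʳ r)) (+-identityʳ a))) pr≡0 ∷ []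
    IsZero-divide⇒IsZero r (a ∷ b ∷ bs) (q≡0 ∷ qs≡0) pr≡0 =
      trans (sym (trans (cong (λ w → a + r * w) q≡0) (trans (cong (a +_) (zeroʳ r)) (+-identityʳ a)))) pr≡0
      ∷ IsZero-divide⇒IsZero r (b ∷ bs) qs≡0 q≡0

    root-divide : ∀ r p r′ → eval p r ≡ 0# → ¬ r′ ≡ r → eval p r′ ≡ 0# → eval (divide r p) r′ ≡ 0#
    root-divide r p r′ pr≡0 r′≢r pr′≡0 with *-zero-product (r′ - r) (eval (divide r p) r′) (begin
      (r′ - r) * eval (divide r p) r′            ≡⟨ sym (+-identityˡ _) ⟩
      0# + (r′ - r) * eval (divide r p) r′       ≡⟨ cong (_+ ((r′ - r) * eval (divide r p) r′)) (sym pr≡0) ⟩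
      eval p r + (r′ - r) * eval (divide r p) r′ ≡⟨ sym (eval-divide r p r′) ⟩
      eval p r′                                  ≡⟨ pr′≡0 ⟩
      0#                                         ∎)
      where open ≡-Reasoning
    ... | inj₁ r′-r≡0 = ⊥-elim (x≢y⇒x-y≢0 r′≢r r′-r≡0)
    ... | inj₂ q≡0 = q≡0

    roots⇒IsZero : ∀ rs p → Unique rs → length p ≤ length rs → All (λ r → eval p r ≡ 0#) rs → IsZero p
    roots⇒IsZero [] [] _ _ _ = []
    roots⇒IsZero (r ∷ rs) [] _ _ _ = []
    roots⇒IsZero (r ∷ rs) (a ∷ as) (r∉rs ∷ u) (s≤s len≤) (pr≡0 ∷ prs≡0) =
      IsZero-divide⇒IsZero r (a ∷ as)
        (roots⇒IsZero rs (divide r (a ∷ as)) u (subst (_≤ length rs) (sym (length-divide r (a ∷ as))) len≤)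
          (roots-divide rs r∉rs prs≡0))
        pr≡0
      where
      roots-divide : ∀ rs′ → All (λ r′ → ¬ r ≡ r′) rs′ → All (λ r′ → eval (a ∷ as) r′ ≡ 0#) rs′ →
                     All (λ r′ → eval (divide r (a ∷ as)) r′ ≡ 0#) rs′
      roots-divide [] [] [] = []
      roots-divide (r′ ∷ rs′) (r≢r′ ∷ r∉) (e ∷ es) =
        root-divide r (a ∷ as) r′ pr≡0 (λ r′≡r → r≢r′ (sym r′≡r)) e ∷ roots-divide rs′ r∉ es

    eval-++ : ∀ c d x → eval (c ++ d) x ≡ eval c x + x ^ length c * eval d x
    eval-++ [] d x = sym (trans (+-identityˡ _) (*-identityˡ _))
    eval-++ (a ∷ c) d x = trans (cong (λ w → a + x * w) (eval-++ c d x))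
      (solve 5 (λ a x e p d → a :+ x :* (e :+ p :* d) := (a :+ x :* e) :+ (x :* p) :* d)
        refl a x (eval c x) (x ^ length c) (eval d x))

    monic : Poly → ℕ → Poly
    monic c m = c ++ replicate m 0# ++ 1# ∷ []

    eval-monic : ∀ c m x → eval (monic c m) x ≡ eval c x + x ^ (length c ℕ.+ m)
    eval-monic c m x = trans (eval-++ c _ x)
      (cong (eval c x +_) (trans (cong (x ^ length c *_) (eval-X^ m)) (sym (^-homo-* x (length c) m))))
      where
      eval-X^ : ∀ m → eval (replicate m 0# ++ 1# ∷ []) x ≡ x ^ m
      eval-X^ zero = trans (cong (1# +_) (zeroʳ x)) (+-identityʳ 1#)
      eval-X^ (suc m) = trans (+-identityˡ _) (cong (x *_) (eval-X^ m))

    monic-nonzero : ∀ c m → ¬ IsZero (monic c m)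
    monic-nonzero c m p≡0 = 1≢0 (leading m (++⁻ʳ c p≡0))
      where
      leading : ∀ m → IsZero (replicate m 0# ++ 1# ∷ []) → 1# ≡ 0#
      leading zero (1≡0 ∷ _) = 1≡0
      leading (suc m) (_ ∷ z) = leading m z

    length-monic : ∀ c m → length (monic c m) ≡ suc (length c ℕ.+ m)
    length-monic c m = begin
      length (c ++ replicate m 0# ++ 1# ∷ [])          ≡⟨ length-++ c ⟩
      length c ℕ.+ length (replicate m 0# ++ 1# ∷ [])  ≡⟨ cong (length c ℕ.+_) (length-++ (replicate m 0#)) ⟩
      length c ℕ.+ (length (replicate m 0#) ℕ.+ 1)     ≡⟨ cong (λ k → length c ℕ.+ (k ℕ.+ 1)) (length-replicate m) ⟩
      length c ℕ.+ (m ℕ.+ 1)                           ≡⟨ cong (length c ℕ.+_) (ℕ.+-comm m 1) ⟩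
      length c ℕ.+ suc m                               ≡⟨ ℕ.+-suc (length c) m ⟩
      suc (length c ℕ.+ m)                             ∎
      where open ≡-Reasoning

    monic-root-bound : ∀ c m rs → Unique rs → suc (length c ℕ.+ m) ≤ length rs →
                       ¬ All (λ r → eval c r + r ^ (length c ℕ.+ m) ≡ 0#) rs
    monic-root-bound c m rs u len≤ roots = monic-nonzero c m
      (roots⇒IsZero rs (monic c m) u (subst (_≤ length rs) (sym (length-monic c m)) len≤)
        (All.map (λ {r} e → trans (eval-monic c m r) e) roots))

    infixl 6 _+ₚ_
    _+ₚ_ : Poly → Poly → Poly
    [] +ₚ q = q
    (a ∷ p) +ₚ [] = a ∷ p
    (a ∷ p) +ₚ (b ∷ q) = (a + b) ∷ (p +ₚ q)

    eval-+ₚ : ∀ p q x → eval (p +ₚ q) x ≡ eval p x + eval q x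
    eval-+ₚ [] q x = sym (+-identityˡ _)
    eval-+ₚ (a ∷ p) [] x = sym (+-identityʳ _)
    eval-+ₚ (a ∷ p) (b ∷ q) x = trans (cong (λ w → a + b + x * w) (eval-+ₚ p q x))
      (solve 5 (λ a b x e f → a :+ b :+ x :* (e :+ f) := (a :+ x :* e) :+ (b :+ x :* f)) refl a b x (eval p x) (eval q x))

    length-+ₚ : ∀ p q → length q ≤ length p → length (p +ₚ q) ≡ length p
    length-+ₚ [] [] _ = refl
    length-+ₚ (a ∷ p) [] _ = refl
    length-+ₚ (a ∷ p) (b ∷ q) (s≤s len≤) = cong suc (length-+ₚ p q len≤)

    eval-map-* : ∀ y p x → eval (map (y *_) p) x ≡ y * eval p x
    eval-map-* y [] x = sym (zeroʳ y)
    eval-map-* y (a ∷ p) x = trans (cong (λ w → y * a + x * w) (eval-map-* y p x))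
      (solve 4 (λ y a x e → y :* a :+ x :* (y :* e) := y :* (a :+ x :* e)) refl y a x (eval p x))

module QuadraticExtension {q : ℕ} (F₀ : FiniteField q) (K₀ : FiniteField (q ℕ.* q)) (E : Embedding F₀ K₀) where

  open import Data.Empty using (⊥-elim)
  open import Data.Integer as ℤ using (ℤ)
  open import Data.List using (List; []; _∷_; _++_; length; map)
  open import Data.List.Properties using (length-map; length-++)
  open import Data.List.Membership.Propositional using (_∉_; lose)
  open import Data.List.Membership.Propositional.Properties using (∈-map⁻)
  open import Data.List.Relation.Unary.All using (All; []; _∷_)
  open import Data.List.Relation.Unary.Any using (Any; any?; satisfied)
  open import Data.List.Relation.Unary.Unique.Propositional using (Unique)
  import Data.List.Relation.Unary.Unique.Propositional.Properties as Unique
  open import Data.Nat using (zero; suc; _≤_)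
  open import Data.Nat.DivMod using (_%_; _/_; m≡m%n+[m/n]*n)
  import Data.Nat.Properties as ℕ
  open import Data.Product using (Σ; _,_; proj₁; proj₂)
  open import Relation.Binary.PropositionalEquality
  open import Relation.Nullary using (¬_; Dec; yes; no)
  open UniqueLists using (unique-∷)

  module F = FiniteFieldProperties F₀
  module K = FiniteFieldProperties K₀
  open Embedding E public
  open K using (_+_; _*_; -_; _-_; 0#; 1#; _^_; _⁻¹; solve; _:=_; _:+_; _:*_; _:-_; :-_; _:^_; con)

  ι-neg : ∀ a → ι (F.- a) ≡ - ι a
  ι-neg a = K.x+z≡y+z⇒x≡y (ι a) (begin
    ι (F.- a) + ι a       ≡⟨ sym (ι-+ (F.- a) a) ⟩
    ι (F.- a F.+ a)       ≡⟨ cong ι (F.-‿inverseˡ a) ⟩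
    ι F.0#                ≡⟨ ι-0# ⟩
    0#                    ≡⟨ sym (K.-‿inverseˡ (ι a)) ⟩
    - ι a + ι a           ∎)
    where open ≡-Reasoning

  ι-nonzero : ∀ {a} → ¬ a ≡ F.0# → ¬ ι a ≡ 0#
  ι-nonzero {a} a≢0 ιa≡0 = K.0≢1 (begin
    0#                      ≡⟨ sym (K.zeroˡ (ι (a F.⁻¹))) ⟩
    0# * ι (a F.⁻¹)         ≡⟨ cong (_* ι (a F.⁻¹)) (sym ιa≡0) ⟩
    ι a * ι (a F.⁻¹)        ≡⟨ sym (ι-* a (a F.⁻¹)) ⟩
    ι (a F.* a F.⁻¹)        ≡⟨ cong ι (F.inverse a a≢0) ⟩
    ι F.1#                  ≡⟨ ι-1# ⟩
    1#                      ∎)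
    where open ≡-Reasoning

  ι-injective : ∀ {a b} → ι a ≡ ι b → a ≡ b
  ι-injective {a} {b} ιa≡ιb with (a F.- b) F.≟ F.0#
  ... | yes a-b≡0 = F.x-y≡0⇒x≡y a-b≡0
  ... | no a-b≢0 = ⊥-elim (ι-nonzero a-b≢0
        (trans (ι-+ a (F.- b)) (trans (cong (ι a +_) (ι-neg b)) (trans (cong (_- ι b) ιa≡ιb) (K.-‿inverseʳ (ι b))))))

  ι≡0⇒≡0 : ∀ {a} → ι a ≡ 0# → a ≡ F.0#
  ι≡0⇒≡0 ιa≡0 = ι-injective (trans ιa≡0 (sym ι-0#))

  ι-^ : ∀ a m → ι (a F.^ m) ≡ ι a ^ m
  ι-^ a zero = ι-1#
  ι-^ a (suc m) = trans (ι-* a (a F.^ m)) (cong (ι a *_) (ι-^ a m))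

  ι-fromℕ : ∀ m → ι (F.fromℕ m) ≡ K.fromℕ m
  ι-fromℕ zero = ι-0#
  ι-fromℕ (suc m) = begin
    ι (F.fromℕ (suc m))          ≡⟨ cong ι (F.fromℕ-suc m) ⟩
    ι (F.1# F.+ F.fromℕ m)       ≡⟨ ι-+ _ _ ⟩
    ι F.1# + ι (F.fromℕ m)       ≡⟨ cong₂ _+_ ι-1# (ι-fromℕ m) ⟩
    1# + K.fromℕ m               ≡⟨ sym (K.fromℕ-suc m) ⟩
    K.fromℕ (suc m)              ∎
    where open ≡-Reasoning

  ι-fermat : ∀ a → ι a ^ q ≡ ι a
  ι-fermat a = trans (sym (ι-^ a q)) (cong ι (F.fermat a))

  InF : K.Carrier → Set
  InF x = Σ F.Carrier λ a → ι a ≡ x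

  InF? : ∀ w → Dec (Any (λ a → ι a ≡ w) F.elements)
  InF? w = any? (λ a → ι a K.≟ w) F.elements


  φ : K.Carrier → K.Carrier
  φ x = x ^ q

  φ-* : ∀ x y → φ (x * y) ≡ φ x * φ y
  φ-* x y = K.^-distrib-* x y q

  φ-0 : φ 0# ≡ 0#
  φ-0 = subst (λ k → 0# ^ k ≡ 0#) (sym F.order≡1+) (K.zeroˡ _)

  φ-1 : φ 1# ≡ 1#
  φ-1 = K.1^ q

  φ-ι : ∀ a → φ (ι a) ≡ ι a
  φ-ι = ι-fermat

  φ-involutive : ∀ x → φ (φ x) ≡ x
  φ-involutive x = trans (sym (K.^-assocʳ x q q)) (K.fermat x)

  φ-injective : ∀ {x y} → φ x ≡ φ y → x ≡ y
  φ-injective {x} {y} eq = trans (sym (φ-involutive x)) (trans (cong φ eq) (φ-involutive y))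

  φ-nonzero : ∀ {x} → ¬ x ≡ 0# → ¬ φ x ≡ 0#
  φ-nonzero x≢0 φx≡0 = x≢0 (φ-injective (trans φx≡0 (sym φ-0)))

  φ-⁻¹ : ∀ x → ¬ x ≡ 0# → φ (x ⁻¹) ≡ (φ x) ⁻¹
  φ-⁻¹ x x≢0 = K.*-cancelˡ (φ x) (φ-nonzero x≢0) (begin
    φ x * φ (x ⁻¹)          ≡⟨ sym (φ-* x (x ⁻¹)) ⟩
    φ (x * x ⁻¹)            ≡⟨ cong φ (K.inverse x x≢0) ⟩
    φ 1#                    ≡⟨ φ-1 ⟩
    1#                      ≡⟨ sym (K.inverse (φ x) (φ-nonzero x≢0)) ⟩
    φ x * (φ x) ⁻¹          ∎)
    where open ≡-Reasoning

  module _ where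
    open K.Polynomial

    binomialLower : K.Carrier → ℕ → Poly
    binomialLower y zero = []
    binomialLower y (suc m) = map (y *_) (binomialLower y m ++ 1# ∷ []) +ₚ (0# ∷ binomialLower y m)

    length-binomialLower : ∀ y m → length (binomialLower y m) ≡ m
    length-binomialLower y zero = refl
    length-binomialLower y (suc m) =
      trans (length-+ₚ (map (y *_) (binomialLower y m ++ 1# ∷ [])) (0# ∷ binomialLower y m) len≤) len-scaled
      where
      len-scaled : length (map (y *_) (binomialLower y m ++ 1# ∷ [])) ≡ suc m
      len-scaled = trans (length-map (y *_) (binomialLower y m ++ 1# ∷ []))
        (trans (length-++ (binomialLower y m)) (trans (cong (ℕ._+ 1) (length-binomialLower y m)) (ℕ.+-comm m 1)))
      len≤ : length (0# ∷ binomialLower y m) ≤ length (map (y *_) (binomialLower y m ++ 1# ∷ []))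
      len≤ = subst₂ _≤_ (sym (cong suc (length-binomialLower y m))) (sym len-scaled) ℕ.≤-refl

    eval-binomialLower : ∀ y m x → eval (binomialLower y m) x + x ^ m ≡ (x + y) ^ m
    eval-binomialLower y zero x = K.+-identityˡ 1#
    eval-binomialLower y (suc m) x = begin
      eval (binomialLower y (suc m)) x + x * x ^ m
        ≡⟨ cong (_+ x * x ^ m) (eval-+ₚ (map (y *_) (binomialLower y m ++ 1# ∷ [])) (0# ∷ binomialLower y m) x) ⟩
      (eval (map (y *_) (binomialLower y m ++ 1# ∷ [])) x + (0# + x * L)) + x * x ^ m
        ≡⟨ cong (λ w → (w + (0# + x * L)) + x * x ^ m) (eval-map-* y (binomialLower y m ++ 1# ∷ []) x) ⟩
      (y * eval (binomialLower y m ++ 1# ∷ []) x + (0# + x * L)) + x * x ^ m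
        ≡⟨ cong (λ w → (y * w + (0# + x * L)) + x * x ^ m) (eval-++ (binomialLower y m) (1# ∷ []) x) ⟩
      (y * (L + x ^ length (binomialLower y m) * (1# + x * 0#)) + (0# + x * L)) + x * x ^ m
        ≡⟨ cong (λ k → (y * (L + x ^ k * (1# + x * 0#)) + (0# + x * L)) + x * x ^ m) (length-binomialLower y m) ⟩
      (y * (L + x ^ m * (1# + x * 0#)) + (0# + x * L)) + x * x ^ m
        ≡⟨ solve 4 (λ y x e p → (y :* (e :+ p :* (con (ℤ.+ 1) :+ x :* con (ℤ.+ 0))) :+ (con (ℤ.+ 0) :+ x :* e)) :+ x :* p
                               := (x :+ y) :* (e :+ p)) refl y x L (x ^ m) ⟩
      (x + y) * (L + x ^ m)
        ≡⟨ cong ((x + y) *_) (eval-binomialLower y m x) ⟩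
      (x + y) * (x + y) ^ m ∎
      where
      open ≡-Reasoning
      L = eval (binomialLower y m) x

    -- (X + y)^q - X^q - y^q has q coefficients but vanishes at the q points ι a · y.
    eval-binomialLower-order : ∀ y → ¬ y ≡ 0# → ∀ x → eval (binomialLower y q) x ≡ y ^ q
    eval-binomialLower-order y y≢0 x = K.x-y≡0⇒x≡y (begin
      eval (binomialLower y q) x - (y ^ q)               ≡⟨ solve 2 (λ e t → e :- t := e :+ (:- t :+ con (ℤ.+ 0))) refl _ (y ^ q) ⟩
      eval (binomialLower y q) x + (- (y ^ q) + 0#)      ≡⟨ cong (λ w → eval (binomialLower y q) x + (- (y ^ q) + w)) (sym (K.zeroʳ x)) ⟩
      eval (binomialLower y q) x + (- (y ^ q) + x * 0#)  ≡⟨ sym (eval-D x) ⟩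
      eval D x                                         ≡⟨ eval-IsZero D x (roots⇒IsZero points D points-unique len≤ (roots F.elements)) ⟩
      0#                                               ∎)
      where
      open ≡-Reasoning
      D : Poly
      D = binomialLower y q +ₚ (- (y ^ q) ∷ [])
      eval-D : ∀ z → eval D z ≡ eval (binomialLower y q) z + (- (y ^ q) + z * 0#)
      eval-D z = eval-+ₚ (binomialLower y q) (- (y ^ q) ∷ []) z
      points : List K.Carrier
      points = map (λ a → ι a * y) F.elements
      points-unique : Unique points
      points-unique = Unique.map⁺ (λ {a} {b} eq → ι-injective
        (K.*-cancelˡ y y≢0 (trans (K.*-comm y (ι a)) (trans eq (K.*-comm (ι b) y))))) F.unique
      len≤ : length D ≤ length points
      len≤ = subst₂ _≤_
        (sym (trans (length-+ₚ (binomialLower y q) (- (y ^ q) ∷ [])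
          (subst (1 ≤_) (sym (length-binomialLower y q)) F.1≤order)) (length-binomialLower y q)))
        (sym (trans (length-map _ F.elements) F.size)) ℕ.≤-refl
      root : ∀ a → eval D (ι a * y) ≡ 0#
      root a = begin
        eval D r                                             ≡⟨ eval-D r ⟩
        eval (binomialLower y q) r + (- Y + r * 0#)          ≡⟨ cong (_+ (- Y + r * 0#)) (K.x+z≡y+z⇒x≡y (r ^ q)
                                                                  (trans (eval-binomialLower y q r)
                                                                    (solve 2 (λ s p → s := (s :- p) :+ p) refl _ _))) ⟩
        ((r + y) ^ q - r ^ q) + (- Y + r * 0#)               ≡⟨ cong (λ w → (w ^ q - r ^ q) + (- Y + r * 0#)) r+y≡ ⟩
        ((ι (a F.+ F.1#) * y) ^ q - (ι a * y) ^ q) + (- Y + r * 0#)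
          ≡⟨ cong₂ (λ u v → (u - v) + (- Y + r * 0#)) (K.^-distrib-* _ y q) (K.^-distrib-* (ι a) y q) ⟩
        (ι (a F.+ F.1#) ^ q * Y - ι a ^ q * Y) + (- Y + r * 0#)
          ≡⟨ cong₂ (λ u v → (u * Y - v * Y) + (- Y + r * 0#)) (ι-fermat _) (ι-fermat a) ⟩
        (ι (a F.+ F.1#) * Y - ι a * Y) + (- Y + r * 0#)      ≡⟨ cong (λ u → (u * Y - ι a * Y) + (- Y + r * 0#)) ι-a+1 ⟩
        ((ι a + 1#) * Y - ι a * Y) + (- Y + r * 0#)          ≡⟨ solve 3 (λ u t r → ((u :+ con (ℤ.+ 1)) :* t :- u :* t)
                                                                  :+ (:- t :+ r :* con (ℤ.+ 0)) := con (ℤ.+ 0)) refl (ι a) Y r ⟩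
        0#                                                   ∎
        where
        Y = y ^ q
        r = ι a * y
        ι-a+1 : ι (a F.+ F.1#) ≡ ι a + 1#
        ι-a+1 = trans (ι-+ a F.1#) (cong (ι a +_) ι-1#)
        r+y≡ : r + y ≡ ι (a F.+ F.1#) * y
        r+y≡ = trans (solve 2 (λ u y → u :* y :+ y := (u :+ con (ℤ.+ 1)) :* y) refl (ι a) y) (cong (_* y) (sym ι-a+1))
      roots : ∀ as → All (λ r → eval D r ≡ 0#) (map (λ a → ι a * y) as)
      roots [] = []
      roots (a ∷ as) = root a ∷ roots as

  φ-+ : ∀ x y → φ (x + y) ≡ φ x + φ y
  φ-+ x y with y K.≟ 0#
  ... | yes refl = trans (cong φ (K.+-identityʳ x)) (sym (trans (cong (φ x +_) φ-0) (K.+-identityʳ (φ x))))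
  ... | no y≢0 = begin
    (x + y) ^ q                                          ≡⟨ sym (eval-binomialLower y q x) ⟩
    eval (binomialLower y q) x + x ^ q                   ≡⟨ cong (_+ x ^ q) (eval-binomialLower-order y y≢0 x) ⟩
    y ^ q + x ^ q                                        ≡⟨ K.+-comm _ _ ⟩
    x ^ q + y ^ q                                        ∎
    where
    open ≡-Reasoning
    open K.Polynomial using (eval)

  φ-neg : ∀ x → φ (- x) ≡ - φ x
  φ-neg x = K.x+z≡y+z⇒x≡y (φ x) (begin
    φ (- x) + φ x          ≡⟨ sym (φ-+ (- x) x) ⟩
    φ (- x + x)            ≡⟨ cong φ (K.-‿inverseˡ x) ⟩
    φ 0#                   ≡⟨ φ-0 ⟩
    0#                     ≡⟨ sym (K.-‿inverseˡ (φ x)) ⟩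
    - φ x + φ x            ∎)
    where open ≡-Reasoning

  φ-fixed⇒InF : ∀ x → φ x ≡ x → InF x
  φ-fixed⇒InF x φx≡x with InF? x
  ... | yes found = satisfied found
  ... | no not-found = ⊥-elim (monic-root-bound (0# ∷ - 1# ∷ []) m (x ∷ map ι F.elements)
          (unique-∷ x∉ (Unique.map⁺ ι-injective F.unique))
          (subst (λ k → suc k ≤ length (x ∷ map ι F.elements)) (sym 2+m≡q)
            (ℕ.≤-reflexive (sym (cong suc (trans (length-map ι F.elements) F.size)))))
          (root x φx≡x ∷ roots F.elements))
    where
    open K.Polynomial using (eval; monic-root-bound)
    m = proj₁ (ℕ.m≤n⇒∃[o]m+o≡n F.2≤order)
    2+m≡q : 2 ℕ.+ m ≡ q
    2+m≡q = proj₂ (ℕ.m≤n⇒∃[o]m+o≡n F.2≤order)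
    root : ∀ r → r ^ q ≡ r → eval (0# ∷ - 1# ∷ []) r + r ^ (2 ℕ.+ m) ≡ 0#
    root r r^q≡r = trans (cong (eval (0# ∷ - 1# ∷ []) r +_) (trans (cong (r ^_) 2+m≡q) r^q≡r))
      (solve 1 (λ r → (con (ℤ.+ 0) :+ r :* (:- con (ℤ.+ 1) :+ r :* con (ℤ.+ 0))) :+ r := con (ℤ.+ 0)) refl r)
    roots : ∀ as → All (λ r → eval (0# ∷ - 1# ∷ []) r + r ^ (2 ℕ.+ m) ≡ 0#) (map ι as)
    roots [] = []
    roots (a ∷ as) = root (ι a) (ι-fermat a) ∷ roots as
    x∉ : x ∉ map ι F.elements
    x∉ x∈ = let (a , a∈ , x≡ιa) = ∈-map⁻ ι x∈ in not-found (lose a∈ (sym x≡ιa))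

  module OrderOneModThree (q%3≡1 : q % 3 ≡ 1) where

    k : ℕ
    k = q / 3

    q≡1+k*3 : q ≡ 1 ℕ.+ k ℕ.* 3
    q≡1+k*3 = trans (m≡m%n+[m/n]*n q 3) (cong (ℕ._+ k ℕ.* 3) q%3≡1)

    3≢0 : ¬ F.3# ≡ F.0#
    3≢0 3≡0 = F.1≢0 (begin
      F.1#                                  ≡⟨ sym (F.+-identityʳ F.1#) ⟩
      F.1# F.+ F.0#                         ≡⟨ cong (F.1# F.+_) (sym (F.zeroʳ (F.fromℕ k))) ⟩
      F.1# F.+ F.fromℕ k F.* F.0#           ≡⟨ cong (λ z → F.1# F.+ F.fromℕ k F.* z) (sym 3≡0) ⟩
      F.1# F.+ F.fromℕ k F.* F.fromℕ 3      ≡⟨ cong (F.1# F.+_) (sym (F.fromℕ-* k 3)) ⟩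
      F.1# F.+ F.fromℕ (k ℕ.* 3)            ≡⟨ sym (F.fromℕ-+ 1 (k ℕ.* 3)) ⟩
      F.fromℕ (1 ℕ.+ k ℕ.* 3)               ≡⟨ cong F.fromℕ (sym q≡1+k*3) ⟩
      F.fromℕ q                             ≡⟨ F.fromℕ-order≡0 ⟩
      F.0#                                  ∎)
      where open ≡-Reasoning

    ^-suc-order : ∀ w → w ^ suc q ≡ w ^ 2 * (w ^ 3) ^ k
    ^-suc-order w = begin
      w ^ suc q                  ≡⟨ cong (λ m → w ^ suc m) q≡1+k*3 ⟩
      w ^ (2 ℕ.+ k ℕ.* 3)        ≡⟨ K.^-homo-* w 2 (k ℕ.* 3) ⟩
      w ^ 2 * w ^ (k ℕ.* 3)      ≡⟨ cong (λ m → w ^ 2 * w ^ m) (ℕ.*-comm k 3) ⟩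
      w ^ 2 * w ^ (3 ℕ.* k)      ≡⟨ cong (w ^ 2 *_) (K.^-assocʳ w 3 k) ⟩
      w ^ 2 * (w ^ 3) ^ k        ∎
      where open ≡-Reasoning

    -- Since gcd(3, q + 1) = 1, a cube root of unity of norm one is trivial.
    cube-root-of-unity : ∀ w → w ^ 3 ≡ 1# → w ^ suc q ≡ 1# → w ≡ 1#
    cube-root-of-unity w w³≡1 w^[q+1]≡1 = begin
      w                ≡⟨ sym (K.*-identityʳ w) ⟩
      w * 1#           ≡⟨ cong (w *_) (sym w²≡1) ⟩
      w * w ^ 2        ≡⟨ solve 1 (λ w → w :* (w :^ 2) := w :^ 3) refl w ⟩
      w ^ 3            ≡⟨ w³≡1 ⟩
      1#               ∎
      where
      open ≡-Reasoning
      w²≡1 : w ^ 2 ≡ 1#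
      w²≡1 = begin
        w ^ 2                  ≡⟨ sym (K.*-identityʳ (w ^ 2)) ⟩
        w ^ 2 * 1#             ≡⟨ cong (w ^ 2 *_) (sym (trans (cong (_^ k) w³≡1) (K.1^ k))) ⟩
        w ^ 2 * (w ^ 3) ^ k    ≡⟨ sym (^-suc-order w) ⟩
        w ^ suc q              ≡⟨ w^[q+1]≡1 ⟩
        1#                     ∎

    cube-injective : ∀ x y → x ^ 3 ≡ y ^ 3 → x ^ suc q ≡ 1# → y ^ suc q ≡ 1# → ¬ y ≡ 0# → x ≡ y
    cube-injective x y x³≡y³ x^[q+1]≡1 y^[q+1]≡1 y≢0 = begin
      x                  ≡⟨ solve 3 (λ x y y′ → x := (x :* y′) :* y :+ x :* (con (ℤ.+ 1) :- y :* y′)) refl x y (y ⁻¹) ⟩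
      (x * y ⁻¹) * y + x * (1# - y * y ⁻¹)  ≡⟨ cong₂ (λ u v → u * y + x * (1# - v)) (cube-root-of-unity (x * y ⁻¹) w³≡1 w^[q+1]≡1)
                                                  (K.inverse y y≢0) ⟩
      1# * y + x * (1# - 1#)                ≡⟨ solve 2 (λ x y → con (ℤ.+ 1) :* y :+ x :* (con (ℤ.+ 1) :- con (ℤ.+ 1)) := y) refl x y ⟩
      y                                     ∎
      where
      open ≡-Reasoning
      y⁻¹^ : ∀ m → y ^ m ≡ 1# → (y ⁻¹) ^ m ≡ 1#
      y⁻¹^ m y^m≡1 = trans (sym (K.*-identityˡ _)) (trans (cong (_* (y ⁻¹) ^ m) (sym y^m≡1)) (K.^-⁻¹ y m y≢0))
      w³≡1 : (x * y ⁻¹) ^ 3 ≡ 1#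
      w³≡1 = trans (K.^-distrib-* x (y ⁻¹) 3) (trans (cong (_* (y ⁻¹) ^ 3) x³≡y³) (K.^-⁻¹ y 3 y≢0))
      w^[q+1]≡1 : (x * y ⁻¹) ^ suc q ≡ 1#
      w^[q+1]≡1 = trans (K.^-distrib-* x (y ⁻¹) (suc q))
        (trans (cong₂ _*_ x^[q+1]≡1 (y⁻¹^ (suc q) y^[q+1]≡1)) (K.*-identityˡ 1#))

module ImaginaryAxes {q : ℕ} (F₀ : FiniteField q) (K₀ : FiniteField (q ℕ.* q)) (E : Embedding F₀ K₀)
                     (q%3≡1 : q % 3 ≡ 1) where

  open import Data.Empty using (⊥-elim)
  open import Data.Integer as ℤ using (ℤ)
  open import Data.List using (List; []; _∷_; _++_; length; map; filter; concat)
  open import Data.List.Properties using (length-map; length-++)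
  open import Data.List.Membership.Propositional using (_∈_; _∉_; lose)
  open import Data.List.Membership.Propositional.Properties using (∈-map⁺; ∈-map⁻; ∈-++⁺ˡ; ∈-++⁺ʳ; ∈-++⁻; ∈-filter⁺; ∈-filter⁻;
    ∈-cartesianProduct⁺; ∈-concat⁺′; ∈-concat⁻′)
  open import Data.List.Relation.Unary.All using (All; []; _∷_)
  open import Data.List.Relation.Unary.Any using (here; there; any?; satisfied)
  open import Data.List.Relation.Unary.Unique.Propositional using (Unique)
  import Data.List.Relation.Unary.Unique.Propositional.Properties as Unique
  open import Data.Nat using (suc)
  import Data.Nat.Properties as ℕ
  open import Data.Product using (Σ; _×_; _,_; proj₁; proj₂)
  open import Data.Product.Properties using (≡-dec)
  open import Data.Sum using (_⊎_; inj₁; inj₂)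
  open import Function.Bundles using (_⇔_; mk⇔; Equivalence)
  open import Relation.Binary.PropositionalEquality
  open import Relation.Nullary using (¬_; yes; no; ¬?)
  open import Data.List.Relation.Unary.AllPairs using ([])
  open UniqueLists using (unique-∷; unique-⇔⇒length≡; HasCount-unique; OrbitRepresentatives; orbitRepresentatives; C2-double;
    unorderedPairs; length-unorderedPairs; unorderedPairs-unique; unorderedPairs-antisym; map-unique-on;
    unique-⊆-covers; length-cartesianProduct; length-concat-const; concat-map-unique; suc-C2)

  open Geometry F₀ K₀ E
  open QuadraticExtension F₀ K₀ E
  open OrderOneModThree q%3≡1
  open K using (_+_; _*_; -_; _-_; 0#; 1#; _^_; _⁻¹)

  cong₄ : ∀ {A B C D X : Set} (f : A → B → C → D → X) {a a′ b b′ c c′ d d′} →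
          a ≡ a′ → b ≡ b′ → c ≡ c′ → d ≡ d′ → f a b c d ≡ f a′ b′ c′ d′
  cong₄ f refl refl refl refl = refl

  ι-3 : ι F.3# ≡ K.3#
  ι-3 = ι-fromℕ 3

  3⁻¹ : F.Carrier
  3⁻¹ = F.3# F.⁻¹

  3*3⁻¹≡1 : F.3# F.* 3⁻¹ ≡ F.1#
  3*3⁻¹≡1 = F.inverse F.3# 3≢0

  -- Planes through an imaginary axis

  OscK-P : ∀ σ t → OscK σ (P t) ≡ (ι t - σ) ^ 3
  OscK-P σ t = begin
    OscK σ (P t)
      ≡⟨ cong₂ (λ u v → u + - (K.3# * σ) * v + K.3# * (σ ^ 2) * ι t + - (σ ^ 3) * ι F.1#) (ι-^ t 3) (ι-^ t 2) ⟩
    ι t ^ 3 + - (K.3# * σ) * ι t ^ 2 + K.3# * (σ ^ 2) * ι t + - (σ ^ 3) * ι F.1#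
      ≡⟨ cong (λ v → ι t ^ 3 + - (K.3# * σ) * ι t ^ 2 + K.3# * (σ ^ 2) * ι t + - (σ ^ 3) * v) ι-1# ⟩
    ι t ^ 3 + - (K.3# * σ) * ι t ^ 2 + K.3# * (σ ^ 2) * ι t + - (σ ^ 3) * 1#
      ≡⟨ solve 2 (λ T σ → T :^ 3 :+ (:- (con (ℤ.+ 3) :* σ)) :* T :^ 2 :+ con (ℤ.+ 3) :* (σ :^ 2) :* T
                          :+ (:- (σ :^ 3)) :* con (ℤ.+ 1) := (T :- σ) :^ 3) refl (ι t) σ ⟩
    (ι t - σ) ^ 3 ∎
    where
    open ≡-Reasoning
    open K using (solve; _:=_; _:+_; _:*_; _:-_; :-_; _:^_; con)

  OscK-P∞ : ∀ σ → OscK σ P∞ ≡ 1#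
  OscK-P∞ σ = trans (cong₂ (λ u v → u + - (K.3# * σ) * v + K.3# * (σ ^ 2) * v + - (σ ^ 3) * v) ι-1# ι-0#)
    (solve 2 (λ t σ → con (ℤ.+ 1) :+ (:- (t :* σ)) :* con (ℤ.+ 0) :+ t :* (σ :^ 2) :* con (ℤ.+ 0)
                      :+ (:- (σ :^ 3)) :* con (ℤ.+ 0) := con (ℤ.+ 1)) refl K.3# σ)
    where open K using (solve; _:=_; _:+_; _:*_; :-_; _:^_; con)

  ∙P∞ : ∀ c → c ∙ P∞ ≡ c0 c
  ∙P∞ c = F.solve 4 (λ a b c d → a :* con (ℤ.+ 1) :+ b :* con (ℤ.+ 0) :+ c :* con (ℤ.+ 0) :+ d :* con (ℤ.+ 0) := a)
            refl (c0 c) (c1 c) (c2 c) (c3 c)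
    where open F using (_:=_; _:+_; _:*_; con)

  ExactlyOne : (CIndex → Set) → Set
  ExactlyOne P = Σ CIndex λ i → P i × (∀ j → P j → j ≡ i)

  ExactlyOne⇒meets-C-once : ∀ c → ExactlyOne (λ i → c ∙ Cpt i ≡ F.0#) → PlaneMeetsC c 1
  ExactlyOne⇒meets-C-once c (i , i-on , only-i) =
    i ∷ [] , unique-∷ (λ ()) [] , (λ j → mk⇔ (λ { (here refl) → i-on }) (λ j-on → here (only-i j j-on))) , refl

  meets-C-once⇒point : ∀ {c} → PlaneMeetsC c 1 → Σ CIndex λ i → c ∙ Cpt i ≡ F.0#
  meets-C-once⇒point (i ∷ [] , _ , members , _) = i , Equivalence.to (members i) (here refl)

  meets-C-once⇒unique : ∀ {c} → PlaneMeetsC c 1 → ∀ i j → c ∙ Cpt i ≡ F.0# → c ∙ Cpt j ≡ F.0# → i ≡ j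
  meets-C-once⇒unique (k ∷ [] , _ , members , _) i j i-on j-on
    with Equivalence.from (members i) i-on | Equivalence.from (members j) j-on
  ... | here i≡k | here j≡k = trans i≡k (sym j≡k)

  two-points⇒¬OneBarPlane : ∀ c i j → ¬ i ≡ j → c ∙ Cpt i ≡ F.0# → c ∙ Cpt j ≡ F.0# → ¬ OneBarPlane c
  two-points⇒¬OneBarPlane c i j i≢j i-on j-on (_ , once) = i≢j (meets-C-once⇒unique once i j i-on j-on)

  NonzeroPair : F.Carrier → F.Carrier → Set
  NonzeroPair l m = ¬ (l ≡ F.0# × m ≡ F.0#)

  m∞ : F.Carrier
  m∞ = F.- 3⁻¹

  -3m∞≡1 : F.- (F.3# F.* m∞) ≡ F.1#
  -3m∞≡1 = trans (F.solve 2 (λ t u → :- (t :* (:- u)) := t :* u) refl F.3# 3⁻¹) 3*3⁻¹≡1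
    where open F using (_:=_; _:*_; :-_)

  module Axis (s : K.Carrier) where

    s̄ : K.Carrier
    s̄ = φ s

    opaque
      trace : InF (s + s̄)
      trace = φ-fixed⇒InF (s + s̄) (trans (φ-+ s s̄) (trans (cong (s̄ +_) (φ-involutive s)) (K.+-comm s̄ s)))

      norm : InF (s * s̄)
      norm = φ-fixed⇒InF (s * s̄) (trans (φ-* s s̄) (trans (cong (s̄ *_) (φ-involutive s)) (K.*-comm s̄ s)))

    A B : F.Carrier
    A = proj₁ trace
    B = proj₁ norm

    ι-A : ι A ≡ s + s̄
    ι-A = proj₂ trace

    ι-B : ι B ≡ s * s̄
    ι-B = proj₂ norm

    -- The F-rational linear forms with OscK σ x = R x + σ * I x for both roots σ of
    -- X² - A X + B; they cut out the axis.
    R I : V4 → F.Carrier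
    R x = c0 x F.- F.3# F.* B F.* c2 x F.+ A F.* B F.* c3 x
    I x = F.- F.3# F.* c1 x F.+ F.3# F.* A F.* c2 x F.- (A F.* A F.- B) F.* c3 x

    planeThrough : F.Carrier → F.Carrier → V4
    planeThrough l m = ⟨ l , F.- (F.3# F.* m) , F.- (l F.* F.3# F.* B) F.+ m F.* F.3# F.* A ,
                         l F.* A F.* B F.- m F.* (A F.* A F.- B) ⟩

    ∙-planeThrough : ∀ l m x → planeThrough l m ∙ x ≡ l F.* R x F.+ m F.* I x
    ∙-planeThrough l m x = F.solve 9 (λ l m x0 x1 x2 x3 t a b →
        l :* x0 :+ (:- (t :* m)) :* x1 :+ ((:- (l :* t :* b)) :+ m :* t :* a) :* x2 :+ (l :* a :* b :- m :* (a :* a :- b)) :* x3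
        := l :* (x0 :- t :* b :* x2 :+ a :* b :* x3) :+ m :* ((:- t) :* x1 :+ t :* a :* x2 :- (a :* a :- b) :* x3))
      refl l m (c0 x) (c1 x) (c2 x) (c3 x) F.3# A B
      where open F using (_:=_; _:+_; _:-_; _:*_; :-_)

    OscK-split : ∀ σ σ′ → ι A ≡ σ + σ′ → ι B ≡ σ * σ′ → ∀ x → OscK σ x ≡ ι (R x) + σ * ι (I x)
    OscK-split σ σ′ ι-A≡ ι-B≡ x = begin
      OscK σ x
        ≡⟨ solve 6 (λ s s′ x0 x1 x2 x3 →
             x0 :+ (:- (three :* s)) :* x1 :+ three :* (s :^ 2) :* x2 :+ (:- (s :^ 3)) :* x3
             := (x0 :- three :* (s :* s′) :* x2 :+ (s :+ s′) :* (s :* s′) :* x3)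
                :+ s :* ((:- three) :* x1 :+ three :* (s :+ s′) :* x2 :- ((s :+ s′) :* (s :+ s′) :- s :* s′) :* x3))
           refl σ σ′ (ι (c0 x)) (ι (c1 x)) (ι (c2 x)) (ι (c3 x)) ⟩
      (X0 - K.3# * (σ * σ′) * X2 + (σ + σ′) * (σ * σ′) * X3)
        + σ * (- K.3# * X1 + K.3# * (σ + σ′) * X2 - ((σ + σ′) * (σ + σ′) - σ * σ′) * X3)
        ≡⟨ cong₂ (λ a b → (X0 - K.3# * b * X2 + a * b * X3) + σ * (- K.3# * X1 + K.3# * a * X2 - (a * a - b) * X3))
             (sym ι-A≡) (sym ι-B≡) ⟩
      (X0 - K.3# * ι B * X2 + ι A * ι B * X3) + σ * (- K.3# * X1 + K.3# * ι A * X2 - (ι A * ι A - ι B) * X3)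
        ≡⟨ sym (cong₂ (λ u v → u + σ * v) ι-R ι-I) ⟩
      ι (R x) + σ * ι (I x) ∎
      where
      open ≡-Reasoning
      open K using (solve; _:=_; _:+_; _:-_; _:*_; :-_; _:^_; con)
      three = con (ℤ.+ 3)
      X0 = ι (c0 x)
      X1 = ι (c1 x)
      X2 = ι (c2 x)
      X3 = ι (c3 x)
      ι-sub : ∀ a b → ι (a F.- b) ≡ ι a - ι b
      ι-sub a b = trans (ι-+ a (F.- b)) (cong (ι a +_) (ι-neg b))
      ι-R : ι (R x) ≡ X0 - K.3# * ι B * X2 + ι A * ι B * X3
      ι-R = trans (ι-+ _ _) (cong₂ _+_ (trans (ι-sub _ _) (cong (λ w → X0 - w)
              (trans (ι-* _ _) (cong (_* X2) (trans (ι-* _ _) (cong (_* ι B) ι-3))))))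
              (trans (ι-* _ _) (cong (_* X3) (ι-* A B))))
      ι-I : ι (I x) ≡ - K.3# * X1 + K.3# * ι A * X2 - (ι A * ι A - ι B) * X3
      ι-I = trans (ι-sub _ _) (cong₂ _-_
              (trans (ι-+ _ _) (cong₂ _+_ (trans (ι-* _ _) (cong (_* X1) (trans (ι-neg _) (cong -_ ι-3))))
                (trans (ι-* _ _) (cong (_* X2) (trans (ι-* _ _) (cong (_* ι A) ι-3))))))
              (trans (ι-* _ _) (cong (_* X3) (trans (ι-sub _ _) (cong (_- ι B) (ι-* A A))))))

    OscK-s : ∀ x → OscK s x ≡ ι (R x) + s * ι (I x)
    OscK-s = OscK-split s s̄ ι-A ι-B

    OscK-s̄ : ∀ x → OscK s̄ x ≡ ι (R x) + s̄ * ι (I x)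
    OscK-s̄ = OscK-split s̄ s (trans ι-A (K.+-comm s s̄)) (trans ι-B (K.*-comm s s̄))

    InPencil : V4 → Set
    InPencil c = Σ F.Carrier λ l → Σ F.Carrier λ m → c ≡ planeThrough l m

    pencil : List V4
    pencil = map (planeThrough F.1#) F.elements ++ planeThrough F.0# m∞ ∷ []

    pencilPlaneAt : CIndex → V4
    pencilPlaneAt ∞ = planeThrough F.0# m∞
    pencilPlaneAt (fin r) = planeThrough F.1# (F.- (R (P r)) F.* (I (P r)) F.⁻¹)

    pencilPlaneAt-Normalized : ∀ i → Normalized (pencilPlaneAt i)
    pencilPlaneAt-Normalized ∞ = inj₂ (inj₁ (refl , -3m∞≡1))
    pencilPlaneAt-Normalized (fin r) = inj₁ refl

    pencilPlaneAt-InPencil : ∀ i → InPencil (pencilPlaneAt i)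
    pencilPlaneAt-InPencil ∞ = F.0# , m∞ , refl
    pencilPlaneAt-InPencil (fin r) = F.1# , _ , refl

    module _ (s∉F : NotInF s) where

      s≢s̄ : ¬ s ≡ s̄
      s≢s̄ s≡s̄ = s∉F (φ-fixed⇒InF s (sym s≡s̄))

      s̄∉F : NotInF s̄
      s̄∉F (a , ιa≡s̄) = s∉F (a , trans (sym (φ-ι a)) (trans (cong φ ιa≡s̄) (φ-involutive s)))

      s̄-s≢0 : ¬ s̄ - s ≡ 0#
      s̄-s≢0 s̄-s≡0 = s≢s̄ (sym (K.x-y≡0⇒x≡y s̄-s≡0))

      OnAxis⇒R≡0×I≡0 : ∀ x → OnAxis s x → R x ≡ F.0# × I x ≡ F.0#
      OnAxis⇒R≡0×I≡0 x (oscs≡0 , oscs̄≡0) = ι≡0⇒≡0 ιR≡0 , ι≡0⇒≡0 ιI≡0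
        where
        open K using (solve; _:=_; _:+_; _:-_; _:*_)
        r = ι (R x)
        i = ι (I x)
        r+si≡0 : r + s * i ≡ 0#
        r+si≡0 = trans (sym (OscK-s x)) oscs≡0
        r+s̄i≡0 : r + s̄ * i ≡ 0#
        r+s̄i≡0 = trans (sym (OscK-s̄ x)) oscs̄≡0
        ιI≡0 : i ≡ 0#
        ιI≡0 = K.*-cancelˡ-zero (λ s-s̄≡0 → s≢s̄ (K.x-y≡0⇒x≡y s-s̄≡0))
          (trans (solve 4 (λ r i s t → (s :- t) :* i := (r :+ s :* i) :- (r :+ t :* i)) refl r i s s̄)
            (trans (cong₂ _-_ r+si≡0 r+s̄i≡0) (K.-‿inverseʳ 0#)))
        ιR≡0 : r ≡ 0#
        ιR≡0 = trans (sym (trans (cong (λ w → r + s * w) ιI≡0) (trans (cong (r +_) (K.zeroʳ s)) (K.+-identityʳ r)))) r+si≡0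

      R≡0×I≡0⇒OnAxis : ∀ x → R x ≡ F.0# → I x ≡ F.0# → OnAxis s x
      R≡0×I≡0⇒OnAxis x R≡0 I≡0 = trans (OscK-s x) (vanish s) , trans (OscK-s̄ x) (vanish s̄)
        where
        vanish : ∀ σ → ι (R x) + σ * ι (I x) ≡ 0#
        vanish σ = trans (cong₂ (λ u v → u + σ * v) (trans (cong ι R≡0) ι-0#) (trans (cong ι I≡0) ι-0#))
                     (trans (K.+-identityˡ _) (K.zeroʳ σ))

      InPencil⇒ContainsAxis : ∀ c → InPencil c → ContainsAxis c s
      InPencil⇒ContainsAxis c (l , m , c≡) x x∈axis = begin
        c ∙ x                            ≡⟨ cong (_∙ x) c≡ ⟩
        planeThrough l m ∙ x             ≡⟨ ∙-planeThrough l m x ⟩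
        l F.* R x F.+ m F.* I x          ≡⟨ cong₂ (λ u v → l F.* u F.+ m F.* v) R≡0 I≡0 ⟩
        l F.* F.0# F.+ m F.* F.0#        ≡⟨ F.solve 2 (λ l m → l :* con (ℤ.+ 0) :+ m :* con (ℤ.+ 0) := con (ℤ.+ 0)) refl l m ⟩
        F.0#                             ∎
        where
        open ≡-Reasoning
        open F using (_:=_; _:+_; _:*_; con)
        R≡0 = proj₁ (OnAxis⇒R≡0×I≡0 x x∈axis)
        I≡0 = proj₂ (OnAxis⇒R≡0×I≡0 x x∈axis)

      -- Two F-rational points spanning the axis.
      X₁ X₂ : V4
      X₁ = ⟨ F.3# F.* B , A , F.1# , F.0# ⟩
      X₂ = ⟨ F.- (F.3# F.* A F.* B) , F.- (A F.* A F.- B) , F.0# , F.3# ⟩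

      X₁-on-axis : OnAxis s X₁
      X₁-on-axis = R≡0×I≡0⇒OnAxis X₁
        (F.solve 3 (λ t a b → t :* b :- t :* b :* con (ℤ.+ 1) :+ a :* b :* con (ℤ.+ 0) := con (ℤ.+ 0)) refl F.3# A B)
        (F.solve 3 (λ t a b → (:- t) :* a :+ t :* a :* con (ℤ.+ 1) :- (a :* a :- b) :* con (ℤ.+ 0) := con (ℤ.+ 0)) refl F.3# A B)
        where open F using (_:=_; _:+_; _:*_; :-_; _:-_; con)

      X₂-on-axis : OnAxis s X₂
      X₂-on-axis = R≡0×I≡0⇒OnAxis X₂
        (F.solve 3 (λ t a b → (:- (t :* a :* b)) :- t :* b :* con (ℤ.+ 0) :+ a :* b :* t := con (ℤ.+ 0)) refl F.3# A B)
        (F.solve 3 (λ t a b → (:- t) :* (:- (a :* a :- b)) :+ t :* a :* con (ℤ.+ 0) :- (a :* a :- b) :* t := con (ℤ.+ 0)) refl F.3# A B)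
        where open F using (_:=_; _:+_; _:*_; :-_; _:-_; con)

      ContainsAxis⇒InPencil : ∀ c → ContainsAxis c s → InPencil c
      ContainsAxis⇒InPencil c contains = C0 , m , cong₄ ⟨_,_,_,_⟩ refl C1≡ C2≡ C3≡
        where
        open ≡-Reasoning
        open F using (_:=_; _:+_; _:*_; :-_; _:-_; con)
        C0 = c0 c
        C1 = c1 c
        C2 = c2 c
        C3 = c3 c
        m = F.- (C1 F.* 3⁻¹)
        ∙X₁≡0 : c ∙ X₁ ≡ F.0#
        ∙X₁≡0 = contains X₁ X₁-on-axis
        ∙X₂≡0 : c ∙ X₂ ≡ F.0#
        ∙X₂≡0 = contains X₂ X₂-on-axis
        C1≡ : C1 ≡ F.- (F.3# F.* m)
        C1≡ = begin
          C1                        ≡⟨ sym (F.*-identityʳ C1) ⟩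
          C1 F.* F.1#               ≡⟨ cong (C1 F.*_) (sym 3*3⁻¹≡1) ⟩
          C1 F.* (F.3# F.* 3⁻¹)     ≡⟨ F.solve 3 (λ c t u → c :* (t :* u) := :- (t :* (:- (c :* u)))) refl C1 F.3# 3⁻¹ ⟩
          F.- (F.3# F.* m)          ∎
        C2≡ : C2 ≡ F.- (C0 F.* F.3# F.* B) F.+ m F.* F.3# F.* A
        C2≡ = begin
          C2                     ≡⟨ F.solve 7 (λ c0 c1 c2 c3 t a b → c2 := (:- (c0 :* t :* b) :- c1 :* a :* con (ℤ.+ 1))
                                      :+ (c0 :* (t :* b) :+ c1 :* a :+ c2 :* con (ℤ.+ 1) :+ c3 :* con (ℤ.+ 0)))
                                      refl C0 C1 C2 C3 F.3# A B ⟩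
          (F.- (C0 F.* F.3# F.* B) F.- C1 F.* A F.* F.1#) F.+ c ∙ X₁
                                 ≡⟨ cong₂ (λ u v → (F.- (C0 F.* F.3# F.* B) F.- C1 F.* A F.* u) F.+ v) (sym 3*3⁻¹≡1) ∙X₁≡0 ⟩
          (F.- (C0 F.* F.3# F.* B) F.- C1 F.* A F.* (F.3# F.* 3⁻¹)) F.+ F.0#
                                 ≡⟨ F.solve 6 (λ c0 c1 t a b u → (:- (c0 :* t :* b) :- c1 :* a :* (t :* u)) :+ con (ℤ.+ 0)
                                      := :- (c0 :* t :* b) :+ (:- (c1 :* u)) :* t :* a) refl C0 C1 F.3# A B 3⁻¹ ⟩
          F.- (C0 F.* F.3# F.* B) F.+ m F.* F.3# F.* A ∎
        C3≡ : C3 ≡ C0 F.* A F.* B F.- m F.* (A F.* A F.- B)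
        C3≡ = begin
          C3                     ≡⟨ sym (F.*-identityʳ C3) ⟩
          C3 F.* F.1#            ≡⟨ cong (C3 F.*_) (sym 3*3⁻¹≡1) ⟩
          C3 F.* (F.3# F.* 3⁻¹)  ≡⟨ F.solve 8 (λ c0 c1 c2 c3 t a b u →
                                      c3 :* (t :* u) := u :* (c0 :* (:- (t :* a :* b)) :+ c1 :* (:- (a :* a :- b)) :+ c2 :* con (ℤ.+ 0) :+ c3 :* t)
                                                        :+ c0 :* (a :* b) :* (t :* u) :+ c1 :* u :* (a :* a :- b))
                                      refl C0 C1 C2 C3 F.3# A B 3⁻¹ ⟩
          3⁻¹ F.* (c ∙ X₂) F.+ C0 F.* (A F.* B) F.* (F.3# F.* 3⁻¹) F.+ C1 F.* 3⁻¹ F.* (A F.* A F.- B)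
                                 ≡⟨ cong₂ (λ v w → 3⁻¹ F.* v F.+ C0 F.* (A F.* B) F.* w F.+ C1 F.* 3⁻¹ F.* (A F.* A F.- B)) ∙X₂≡0 3*3⁻¹≡1 ⟩
          3⁻¹ F.* F.0# F.+ C0 F.* (A F.* B) F.* F.1# F.+ C1 F.* 3⁻¹ F.* (A F.* A F.- B)
                                 ≡⟨ F.solve 5 (λ c0 c1 a b u → u :* con (ℤ.+ 0) :+ c0 :* (a :* b) :* con (ℤ.+ 1) :+ c1 :* u :* (a :* a :- b)
                                      := c0 :* a :* b :- (:- (c1 :* u)) :* (a :* a :- b)) refl C0 C1 A B 3⁻¹ ⟩
          C0 F.* A F.* B F.- m F.* (A F.* A F.- B) ∎

      α ᾱ : F.Carrier → F.Carrier → K.Carrier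
      α l m = ι l * s̄ - ι m
      ᾱ l m = ι l * s - ι m

      ∙-planeThrough-osculating : ∀ l m y →
        (s̄ - s) * ι (planeThrough l m ∙ y) ≡ α l m * OscK s y - ᾱ l m * OscK s̄ y
      ∙-planeThrough-osculating l m y = begin
        (s̄ - s) * ι (planeThrough l m ∙ y)         ≡⟨ cong (λ w → (s̄ - s) * ι w) (∙-planeThrough l m y) ⟩
        (s̄ - s) * ι (l F.* R y F.+ m F.* I y)      ≡⟨ cong ((s̄ - s) *_) (trans (ι-+ _ _) (cong₂ _+_ (ι-* l (R y)) (ι-* m (I y)))) ⟩
        (s̄ - s) * (ι l * r + ι m * i)              ≡⟨ solve 6 (λ s̄ s L M r i → (s̄ :- s) :* (L :* r :+ M :* i)
                                                        := (L :* s̄ :- M) :* (r :+ s :* i) :- (L :* s :- M) :* (r :+ s̄ :* i))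
                                                        refl s̄ s (ι l) (ι m) r i ⟩
        α l m * (r + s * i) - ᾱ l m * (r + s̄ * i)  ≡⟨ sym (cong₂ (λ u v → α l m * u - ᾱ l m * v) (OscK-s y) (OscK-s̄ y)) ⟩
        α l m * OscK s y - ᾱ l m * OscK s̄ y        ∎
        where
        open ≡-Reasoning
        open K using (solve; _:=_; _:+_; _:*_; _:-_)
        r = ι (R y)
        i = ι (I y)

      on-planeThrough⇒ : ∀ l m y → planeThrough l m ∙ y ≡ F.0# → α l m * OscK s y ≡ ᾱ l m * OscK s̄ y
      on-planeThrough⇒ l m y y∈ = K.x-y≡0⇒x≡y (begin
        α l m * OscK s y - ᾱ l m * OscK s̄ y        ≡⟨ sym (∙-planeThrough-osculating l m y) ⟩
        (s̄ - s) * ι (planeThrough l m ∙ y)         ≡⟨ cong (λ w → (s̄ - s) * ι w) y∈ ⟩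
        (s̄ - s) * ι F.0#                           ≡⟨ cong ((s̄ - s) *_) ι-0# ⟩
        (s̄ - s) * 0#                               ≡⟨ K.zeroʳ _ ⟩
        0#                                         ∎)
        where open ≡-Reasoning

      on-planeThrough⇐ : ∀ l m y → α l m * OscK s y ≡ ᾱ l m * OscK s̄ y → planeThrough l m ∙ y ≡ F.0#
      on-planeThrough⇐ l m y eq = ι≡0⇒≡0 (K.*-cancelˡ-zero s̄-s≢0
        (trans (∙-planeThrough-osculating l m y) (trans (cong (_- ᾱ l m * OscK s̄ y) eq) (K.-‿inverseʳ _))))

      φ-α : ∀ l m → φ (α l m) ≡ ᾱ l m
      φ-α l m = trans (φ-+ _ _) (cong₂ _+_ (trans (φ-* (ι l) s̄) (cong₂ _*_ (φ-ι l) (φ-involutive s)))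
                                          (trans (φ-neg (ι m)) (cong -_ (φ-ι m))))

      φ-ᾱ : ∀ l m → φ (ᾱ l m) ≡ α l m
      φ-ᾱ l m = trans (sym (cong φ (φ-α l m))) (φ-involutive (α l m))

      α-nonzero : ∀ l m → NonzeroPair l m → ¬ α l m ≡ 0#
      α-nonzero l m lm≢0 α≡0 with l F.≟ F.0#
      ... | yes l≡0 = lm≢0 (l≡0 , ι≡0⇒≡0 (begin
          ι m                ≡⟨ sym ιl*s̄≡ιm ⟩
          ι l * s̄            ≡⟨ cong (λ w → ι w * s̄) l≡0 ⟩
          ι F.0# * s̄         ≡⟨ cong (_* s̄) ι-0# ⟩
          0# * s̄             ≡⟨ K.zeroˡ s̄ ⟩
          0#                 ∎))
        where
        open ≡-Reasoning
        ιl*s̄≡ιm = K.x-y≡0⇒x≡y α≡0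
      ... | no l≢0 = s̄∉F (m F.* l F.⁻¹ , K.*-cancelˡ (ι l) (ι-nonzero l≢0) (begin
          ι l * ι (m F.* l F.⁻¹)       ≡⟨ cong (ι l *_) (ι-* m (l F.⁻¹)) ⟩
          ι l * (ι m * ι (l F.⁻¹))     ≡⟨ K.solve 3 (λ L M V → L :* (M :* V) := M :* (L :* V)) refl (ι l) (ι m) (ι (l F.⁻¹)) ⟩
          ι m * (ι l * ι (l F.⁻¹))     ≡⟨ cong (ι m *_) (trans (sym (ι-* l (l F.⁻¹))) (trans (cong ι (F.inverse l l≢0)) ι-1#)) ⟩
          ι m * 1#                     ≡⟨ K.*-identityʳ _ ⟩
          ι m                          ≡⟨ sym (K.x-y≡0⇒x≡y α≡0) ⟩
          ι l * s̄                      ∎))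
        where
        open ≡-Reasoning
        open K using (_:=_; _:*_)

      ᾱ-nonzero : ∀ l m → NonzeroPair l m → ¬ ᾱ l m ≡ 0#
      ᾱ-nonzero l m lm≢0 ᾱ≡0 = φ-nonzero (α-nonzero l m lm≢0) (trans (φ-α l m) ᾱ≡0)

      l≡0⇒α≡ᾱ : ∀ l m → l ≡ F.0# → α l m ≡ ᾱ l m
      l≡0⇒α≡ᾱ l m l≡0 = begin
        ι l * s̄ - ι m      ≡⟨ cong (λ w → w * s̄ - ι m) ιl≡0 ⟩
        0# * s̄ - ι m       ≡⟨ K.solve 3 (λ M b s → con (ℤ.+ 0) :* b :- M := con (ℤ.+ 0) :* s :- M) refl (ι m) s̄ s ⟩
        0# * s - ι m       ≡⟨ cong (λ w → w * s - ι m) (sym ιl≡0) ⟩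
        ι l * s - ι m      ∎
        where
        open ≡-Reasoning
        open K using (_:=_; _:*_; _:-_; con)
        ιl≡0 : ι l ≡ 0#
        ιl≡0 = trans (cong ι l≡0) ι-0#

      P∞-on⇒l≡0 : ∀ l m → planeThrough l m ∙ P∞ ≡ F.0# → l ≡ F.0#
      P∞-on⇒l≡0 l m P∞-on = ι≡0⇒≡0 (K.*-cancelˡ-zero s̄-s≢0 (begin
        (s̄ - s) * ι l                  ≡⟨ K.solve 4 (λ L M b s → (b :- s) :* L := (L :* b :- M) :- (L :* s :- M)) refl (ι l) (ι m) s̄ s ⟩
        α l m - ᾱ l m                  ≡⟨ cong (λ w → α l m - w) (sym α≡ᾱ) ⟩
        α l m - α l m                  ≡⟨ K.-‿inverseʳ _ ⟩
        0#                             ∎))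
        where
        open ≡-Reasoning
        open K using (_:=_; _:*_; _:-_)
        α≡ᾱ : α l m ≡ ᾱ l m
        α≡ᾱ = begin
          α l m               ≡⟨ sym (K.*-identityʳ _) ⟩
          α l m * 1#          ≡⟨ cong (α l m *_) (sym (OscK-P∞ s)) ⟩
          α l m * OscK s P∞   ≡⟨ on-planeThrough⇒ l m P∞ P∞-on ⟩
          ᾱ l m * OscK s̄ P∞   ≡⟨ cong (ᾱ l m *_) (OscK-P∞ s̄) ⟩
          ᾱ l m * 1#          ≡⟨ K.*-identityʳ _ ⟩
          ᾱ l m               ∎

      α≡ᾱ⇒P∞-on : ∀ l m → α l m ≡ ᾱ l m → planeThrough l m ∙ P∞ ≡ F.0#
      α≡ᾱ⇒P∞-on l m α≡ᾱ = on-planeThrough⇐ l m P∞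
        (trans (cong (α l m *_) (OscK-P∞ s)) (trans (cong (_* 1#) α≡ᾱ) (cong (ᾱ l m *_) (sym (OscK-P∞ s̄)))))

      ρ : F.Carrier → K.Carrier
      ρ t = (ι t - s) * (ι t - s̄) ⁻¹

      μ : F.Carrier → F.Carrier → K.Carrier
      μ l m = ᾱ l m * (α l m) ⁻¹

      t-s≢0 : ∀ t → ¬ ι t - s ≡ 0#
      t-s≢0 t eq = s∉F (t , K.x-y≡0⇒x≡y eq)

      t-s̄≢0 : ∀ t → ¬ ι t - s̄ ≡ 0#
      t-s̄≢0 t eq = s̄∉F (t , K.x-y≡0⇒x≡y eq)

      ρ*[t-s̄]≡t-s : ∀ t → ρ t * (ι t - s̄) ≡ ι t - s
      ρ*[t-s̄]≡t-s t = trans (K.*-assoc _ _ _) (trans (cong ((ι t - s) *_) (K.⁻¹-inverseˡ _ (t-s̄≢0 t))) (K.*-identityʳ _))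

      ρ-nonzero : ∀ t → ¬ ρ t ≡ 0#
      ρ-nonzero t = K.*-nonzero (t-s≢0 t) (K.⁻¹-nonzero _ (t-s̄≢0 t))

      -- x ^ suc q = x * φ x is the norm of x.
      norm-one : ∀ x → ¬ x ≡ 0# → (x * (φ x) ⁻¹) ^ suc q ≡ 1#
      norm-one x x≢0 = begin
        (x * (φ x) ⁻¹) * φ (x * (φ x) ⁻¹)       ≡⟨ cong ((x * (φ x) ⁻¹) *_) (trans (φ-* x ((φ x) ⁻¹))
                                                      (cong (φ x *_) (trans (φ-⁻¹ (φ x) (φ-nonzero x≢0)) (cong _⁻¹ (φ-involutive x))))) ⟩
        (x * (φ x) ⁻¹) * (φ x * x ⁻¹)           ≡⟨ K.solve 4 (λ x y x′ y′ → (x :* y′) :* (y :* x′) := (x :* x′) :* (y :* y′))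
                                                      refl x (φ x) (x ⁻¹) ((φ x) ⁻¹) ⟩
        (x * x ⁻¹) * (φ x * (φ x) ⁻¹)           ≡⟨ cong₂ _*_ (K.inverse x x≢0) (K.inverse (φ x) (φ-nonzero x≢0)) ⟩
        1# * 1#                                 ≡⟨ K.*-identityˡ 1# ⟩
        1#                                      ∎
        where
        open ≡-Reasoning
        open K using (_:=_; _:*_)

      φ[t-s]≡t-s̄ : ∀ t → φ (ι t - s) ≡ ι t - s̄
      φ[t-s]≡t-s̄ t = trans (φ-+ (ι t) (- s)) (cong₂ _+_ (φ-ι t) (φ-neg s))

      ρ-norm : ∀ t → ρ t ^ suc q ≡ 1#
      ρ-norm t = subst (λ y → ((ι t - s) * y ⁻¹) ^ suc q ≡ 1#) (φ[t-s]≡t-s̄ t) (norm-one (ι t - s) (t-s≢0 t))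

      μ-norm : ∀ l m → NonzeroPair l m → μ l m ^ suc q ≡ 1#
      μ-norm l m lm≢0 = subst (λ y → (ᾱ l m * y ⁻¹) ^ suc q ≡ 1#) (φ-ᾱ l m) (norm-one (ᾱ l m) (ᾱ-nonzero l m lm≢0))

      ρ-injective : ∀ {t t′} → ρ t ≡ ρ t′ → t ≡ t′
      ρ-injective {t} {t′} ρt≡ρt′ = ι-injective (K.x-y≡0⇒x≡y
        (K.*-cancelˡ-zero s-s̄≢0 (trans (K.*-comm _ _) (begin
          (ι t - ι t′) * (s - s̄)                     ≡⟨ K.solve 4 (λ T T′ s b → (T :- T′) :* (s :- b)
                                                           := (T :- s) :* (T′ :- b) :- (T′ :- s) :* (T :- b)) refl (ι t) (ι t′) s s̄ ⟩
          (ι t - s) * (ι t′ - s̄) - (ι t′ - s) * (ι t - s̄) ≡⟨ cong (_- (ι t′ - s) * (ι t - s̄)) cross ⟩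
          (ι t′ - s) * (ι t - s̄) - (ι t′ - s) * (ι t - s̄) ≡⟨ K.-‿inverseʳ _ ⟩
          0#                                         ∎))))
        where
        open ≡-Reasoning
        open K using (_:=_; _:*_; _:-_)
        s-s̄≢0 : ¬ s - s̄ ≡ 0#
        s-s̄≢0 eq = s≢s̄ (K.x-y≡0⇒x≡y eq)
        cross : (ι t - s) * (ι t′ - s̄) ≡ (ι t′ - s) * (ι t - s̄)
        cross = begin
          (ι t - s) * (ι t′ - s̄)               ≡⟨ cong (_* (ι t′ - s̄)) (sym (ρ*[t-s̄]≡t-s t)) ⟩
          ρ t * (ι t - s̄) * (ι t′ - s̄)         ≡⟨ cong (λ w → w * (ι t - s̄) * (ι t′ - s̄)) ρt≡ρt′ ⟩
          ρ t′ * (ι t - s̄) * (ι t′ - s̄)        ≡⟨ K.solve 3 (λ a b c → a :* b :* c := a :* c :* b) refl (ρ t′) (ι t - s̄) (ι t′ - s̄) ⟩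
          ρ t′ * (ι t′ - s̄) * (ι t - s̄)        ≡⟨ cong (_* (ι t - s̄)) (ρ*[t-s̄]≡t-s t′) ⟩
          (ι t′ - s) * (ι t - s̄)               ∎

      ρ³-injective : ∀ {t t′} → ρ t ^ 3 ≡ ρ t′ ^ 3 → t ≡ t′
      ρ³-injective {t} {t′} eq = ρ-injective (cube-injective (ρ t) (ρ t′) eq (ρ-norm t) (ρ-norm t′) (ρ-nonzero t′))

      ρ≢1 : ∀ t → ¬ ρ t ≡ 1#
      ρ≢1 t ρ≡1 = s≢s̄ (sym (K.x-y≡0⇒x≡y (begin
        s̄ - s                          ≡⟨ K.solve 3 (λ T s b → b :- s := (T :- s) :- (T :- b)) refl (ι t) s s̄ ⟩
        (ι t - s) - (ι t - s̄)          ≡⟨ cong (_- (ι t - s̄)) (sym (ρ*[t-s̄]≡t-s t)) ⟩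
        ρ t * (ι t - s̄) - (ι t - s̄)    ≡⟨ cong (λ w → w * (ι t - s̄) - (ι t - s̄)) ρ≡1 ⟩
        1# * (ι t - s̄) - (ι t - s̄)     ≡⟨ K.solve 1 (λ y → con (ℤ.+ 1) :* y :- y := con (ℤ.+ 0)) refl (ι t - s̄) ⟩
        0#                             ∎)))
        where
        open ≡-Reasoning
        open K using (_:=_; _:*_; _:-_; con)

      ρ³≢1 : ∀ t → ¬ ρ t ^ 3 ≡ 1#
      ρ³≢1 t ρ³≡1 = ρ≢1 t (cube-root-of-unity (ρ t) ρ³≡1 (ρ-norm t))

      P-on⇒ρ³≡μ : ∀ l m t → NonzeroPair l m → planeThrough l m ∙ P t ≡ F.0# → ρ t ^ 3 ≡ μ l m
      P-on⇒ρ³≡μ l m t lm≢0 Pt-on = K.*-cancelˡ (α l m * Y) (K.*-nonzero (α-nonzero l m lm≢0) (K.^-nonzero _ 3 (t-s̄≢0 t))) (begin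
        α l m * Y * ρ t ^ 3              ≡⟨ K.solve 3 (λ a y r → a :* y :* r := a :* (r :* y)) refl (α l m) Y (ρ t ^ 3) ⟩
        α l m * (ρ t ^ 3 * Y)            ≡⟨ cong (α l m *_) (sym (trans (cong (_^ 3) (sym (ρ*[t-s̄]≡t-s t))) (K.^-distrib-* (ρ t) _ 3))) ⟩
        α l m * (ι t - s) ^ 3            ≡⟨ cong (α l m *_) (sym (OscK-P s t)) ⟩
        α l m * OscK s (P t)             ≡⟨ on-planeThrough⇒ l m (P t) Pt-on ⟩
        ᾱ l m * OscK s̄ (P t)             ≡⟨ cong (ᾱ l m *_) (OscK-P s̄ t) ⟩
        ᾱ l m * Y                        ≡⟨ K.solve 4 (λ a b a′ y → b :* y := a :* y :* (b :* a′) :+ b :* y :* (con (ℤ.+ 1) :- a :* a′))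
                                              refl (α l m) (ᾱ l m) (α l m ⁻¹) Y ⟩
        α l m * Y * μ l m + ᾱ l m * Y * (1# - α l m * α l m ⁻¹)
                                         ≡⟨ cong (λ w → α l m * Y * μ l m + ᾱ l m * Y * (1# - w)) (K.inverse _ (α-nonzero l m lm≢0)) ⟩
        α l m * Y * μ l m + ᾱ l m * Y * (1# - 1#)
                                         ≡⟨ K.solve 3 (λ p b u → p :* u :+ b :* (con (ℤ.+ 1) :- con (ℤ.+ 1)) := p :* u)
                                              refl (α l m * Y) (ᾱ l m * Y) (μ l m) ⟩
        α l m * Y * μ l m                ∎)
        where
        open ≡-Reasoning
        open K using (_:=_; _:*_; _:+_; _:-_; con)
        Y = (ι t - s̄) ^ 3

      ρ³≡μ⇒P-on : ∀ l m t → NonzeroPair l m → ρ t ^ 3 ≡ μ l m → planeThrough l m ∙ P t ≡ F.0#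
      ρ³≡μ⇒P-on l m t lm≢0 ρ³≡μ = on-planeThrough⇐ l m (P t) (begin
        α l m * OscK s (P t)                      ≡⟨ cong (α l m *_) (OscK-P s t) ⟩
        α l m * (ι t - s) ^ 3                     ≡⟨ cong (λ w → α l m * w ^ 3) (sym (ρ*[t-s̄]≡t-s t)) ⟩
        α l m * (ρ t * (ι t - s̄)) ^ 3             ≡⟨ cong (α l m *_) (K.^-distrib-* (ρ t) _ 3) ⟩
        α l m * (ρ t ^ 3 * Y)                     ≡⟨ cong (λ w → α l m * (w * Y)) ρ³≡μ ⟩
        α l m * (ᾱ l m * α l m ⁻¹ * Y)            ≡⟨ K.solve 4 (λ a b a′ y → a :* (b :* a′ :* y) := (a :* a′) :* (b :* y))
                                                       refl (α l m) (ᾱ l m) (α l m ⁻¹) Y ⟩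
        (α l m * α l m ⁻¹) * (ᾱ l m * Y)          ≡⟨ cong (_* (ᾱ l m * Y)) (K.inverse _ (α-nonzero l m lm≢0)) ⟩
        1# * (ᾱ l m * Y)                          ≡⟨ K.*-identityˡ _ ⟩
        ᾱ l m * Y                                 ≡⟨ cong (ᾱ l m *_) (sym (OscK-P s̄ t)) ⟩
        ᾱ l m * OscK s̄ (P t)                      ∎)
        where
        open ≡-Reasoning
        open K using (_:=_; _:*_)
        Y = (ι t - s̄) ^ 3

      μ≢1 : ∀ l m → NonzeroPair l m → ¬ l ≡ F.0# → ¬ μ l m ≡ 1#
      μ≢1 l m lm≢0 l≢0 μ≡1 = l≢0 (P∞-on⇒l≡0 l m (α≡ᾱ⇒P∞-on l m (sym (begin
        ᾱ l m                          ≡⟨ K.solve 3 (λ b a′ a → b := b :* a′ :* a :+ b :* (con (ℤ.+ 1) :- a :* a′)) refl (ᾱ l m) (α l m ⁻¹) (α l m) ⟩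
        μ l m * α l m + ᾱ l m * (1# - α l m * α l m ⁻¹)
                                       ≡⟨ cong₂ (λ u w → u * α l m + ᾱ l m * (1# - w)) μ≡1 (K.inverse _ (α-nonzero l m lm≢0)) ⟩
        1# * α l m + ᾱ l m * (1# - 1#)  ≡⟨ K.solve 2 (λ a b → con (ℤ.+ 1) :* a :+ b :* (con (ℤ.+ 1) :- con (ℤ.+ 1)) := a) refl (α l m) (ᾱ l m) ⟩
        α l m                          ∎))))
        where
        open ≡-Reasoning
        open K using (_:=_; _:*_; _:+_; _:-_; con)

      -- Otherwise μ l m, 1 and the q values ρ t ^ 3 would be q + 2 distinct roots of X^(q+1) - 1.
      ρ³-hits-μ : ∀ l m → NonzeroPair l m → ¬ l ≡ F.0# → Σ F.Carrier λ t → ρ t ^ 3 ≡ μ l m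
      ρ³-hits-μ l m lm≢0 l≢0 with any? (λ t → (ρ t ^ 3) K.≟ μ l m) F.elements
      ... | yes found = satisfied found
      ... | no not-found = ⊥-elim (monic-root-bound (- 1# ∷ []) q roots roots-unique
            (ℕ.≤-reflexive (sym (cong (λ k → suc (suc k)) (trans (length-map _ F.elements) F.size))))
            (root (μ-norm l m lm≢0) ∷ root (K.1^ (suc q)) ∷ cubes F.elements))
        where
        open K.Polynomial using (eval; monic-root-bound)
        cubes′ = map (λ t → ρ t ^ 3) F.elements
        roots = μ l m ∷ 1# ∷ cubes′
        ∉cubes′ : ∀ {w} → (∀ t → ¬ ρ t ^ 3 ≡ w) → w ∉ cubes′
        ∉cubes′ h w∈ = let (t , _ , w≡) = ∈-map⁻ _ w∈ in h t (sym w≡)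
        roots-unique : Unique roots
        roots-unique = unique-∷ μ∉ (unique-∷ (∉cubes′ ρ³≢1) (Unique.map⁺ ρ³-injective F.unique))
          where
          μ∉ : μ l m ∉ 1# ∷ cubes′
          μ∉ (here μ≡1) = μ≢1 l m lm≢0 l≢0 μ≡1
          μ∉ (there μ∈) = ∉cubes′ (λ t eq → not-found (lose (F.complete t) eq)) μ∈
        root : ∀ {r} → r ^ suc q ≡ 1# → eval (- 1# ∷ []) r + r ^ suc q ≡ 0#
        root {r} r^[q+1]≡1 = trans (cong (eval (- 1# ∷ []) r +_) r^[q+1]≡1)
          (K.solve 1 (λ r → (:- con (ℤ.+ 1) :+ r :* con (ℤ.+ 0)) :+ con (ℤ.+ 1) := con (ℤ.+ 0)) refl r)
          where open K using (_:=_; _:*_; _:+_; :-_; con)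
        cubes : ∀ ts → All (λ r → eval (- 1# ∷ []) r + r ^ suc q ≡ 0#) (map (λ t → ρ t ^ 3) ts)
        cubes [] = []
        cubes (t ∷ ts) = root ρ³-norm ∷ cubes ts
          where
          ρ³-norm : (ρ t ^ 3) ^ suc q ≡ 1#
          ρ³-norm = begin
            (ρ t ^ 3) ^ suc q       ≡⟨ sym (K.^-assocʳ (ρ t) 3 (suc q)) ⟩
            ρ t ^ (3 ℕ.* suc q)     ≡⟨ cong (ρ t ^_) (ℕ.*-comm 3 (suc q)) ⟩
            ρ t ^ (suc q ℕ.* 3)     ≡⟨ K.^-assocʳ (ρ t) (suc q) 3 ⟩
            (ρ t ^ suc q) ^ 3       ≡⟨ cong (_^ 3) (ρ-norm t) ⟩
            1# ^ 3                  ≡⟨ K.1^ 3 ⟩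
            1#                      ∎
            where open ≡-Reasoning

      meets-C-once : ∀ l m → NonzeroPair l m → ExactlyOne (λ i → planeThrough l m ∙ Cpt i ≡ F.0#)
      meets-C-once l m lm≢0 with l F.≟ F.0#
      ... | yes l≡0 = ∞ , α≡ᾱ⇒P∞-on l m (l≡0⇒α≡ᾱ l m l≡0) , only-∞
        where
        μ≡1 : μ l m ≡ 1#
        μ≡1 = trans (cong (_* (α l m) ⁻¹) (sym (l≡0⇒α≡ᾱ l m l≡0))) (K.inverse _ (α-nonzero l m lm≢0))
        only-∞ : ∀ j → planeThrough l m ∙ Cpt j ≡ F.0# → j ≡ ∞
        only-∞ (fin t) Pt-on = ⊥-elim (ρ³≢1 t (trans (P-on⇒ρ³≡μ l m t lm≢0 Pt-on) μ≡1))
        only-∞ ∞ _ = refl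
      ... | no l≢0 = fin t₀ , ρ³≡μ⇒P-on l m t₀ lm≢0 ρ³≡μ , only-t₀
        where
        t₀ = proj₁ (ρ³-hits-μ l m lm≢0 l≢0)
        ρ³≡μ = proj₂ (ρ³-hits-μ l m lm≢0 l≢0)
        only-t₀ : ∀ j → planeThrough l m ∙ Cpt j ≡ F.0# → j ≡ fin t₀
        only-t₀ (fin t) Pt-on = cong fin (ρ³-injective (trans (P-on⇒ρ³≡μ l m t lm≢0 Pt-on) (sym ρ³≡μ)))
        only-t₀ ∞ P∞-on = ⊥-elim (l≢0 (P∞-on⇒l≡0 l m P∞-on))

      3m≡0⇒m≡0 : ∀ {m} → F.- (F.3# F.* m) ≡ F.0# → m ≡ F.0#
      3m≡0⇒m≡0 eq = F.*-cancelˡ-zero 3≢0 (F.-‿injective (trans eq (sym F.-0≡0)))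

      not-Γ : ∀ l m → NonzeroPair l m → ¬ ΓPlane (planeThrough l m)
      not-Γ l m lm≢0 (inj₂ (κ , _ , eq)) =
        lm≢0 (trans (cong c0 eq) (F.zeroʳ κ) , 3m≡0⇒m≡0 (trans (cong c1 eq) (F.zeroʳ κ)))
      not-Γ l m lm≢0 (inj₁ (t , κ , κ≢0 , eq)) = K.*-nonzero (t-s≢0 t) (t-s̄≢0 t) [t-s][t-s̄]≡0
        where
        open ≡-Reasoning
        l≡κ : l ≡ κ
        l≡κ = trans (cong c0 eq) (F.*-identityʳ κ)
        m≡κt : m ≡ κ F.* t
        m≡κt = F.*-cancelˡ F.3# 3≢0 (F.-‿injective (trans (cong c1 eq)
                 (F.solve 3 (λ k t h → k :* (:- (h :* t)) := :- (h :* (k :* t))) refl κ t F.3#)))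
          where open F using (_:=_; _:*_; :-_)
        quadratic : F.Carrier
        quadratic = t F.* t F.- A F.* t F.+ B
        quadratic≡0 : quadratic ≡ F.0#
        quadratic≡0 = F.*-cancelˡ-zero (F.*-nonzero 3≢0 κ≢0) (begin
          F.3# F.* κ F.* quadratic
            ≡⟨ F.solve 5 (λ h k t a b → h :* k :* (t :* t :- a :* t :+ b)
                 := k :* (h :* (t :^ 2)) :- ((:- (k :* h :* b)) :+ k :* t :* h :* a)) refl F.3# κ t A B ⟩
          κ F.* (F.3# F.* (t F.^ 2)) F.- (F.- (κ F.* F.3# F.* B) F.+ κ F.* t F.* F.3# F.* A)
            ≡⟨ cong₂ (λ u v → u F.- (F.- (v F.* F.3# F.* B) F.+ κ F.* t F.* F.3# F.* A)) (sym (cong c2 eq)) (sym l≡κ) ⟩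
          c2 (planeThrough l m) F.- (F.- (l F.* F.3# F.* B) F.+ κ F.* t F.* F.3# F.* A)
            ≡⟨ cong (λ v → c2 (planeThrough l m) F.- (F.- (l F.* F.3# F.* B) F.+ v F.* F.3# F.* A)) (sym m≡κt) ⟩
          c2 (planeThrough l m) F.- c2 (planeThrough l m)
            ≡⟨ F.-‿inverseʳ _ ⟩
          F.0# ∎)
          where open F using (_:=_; _:*_; _:+_; _:-_; :-_; _:^_)
        [t-s][t-s̄]≡0 : (ι t - s) * (ι t - s̄) ≡ 0#
        [t-s][t-s̄]≡0 = begin
          (ι t - s) * (ι t - s̄)               ≡⟨ K.solve 3 (λ T s b → (T :- s) :* (T :- b) := T :* T :- (s :+ b) :* T :+ s :* b)
                                                    refl (ι t) s s̄ ⟩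
          ι t * ι t - (s + s̄) * ι t + s * s̄   ≡⟨ cong₂ (λ u v → ι t * ι t - u * ι t + v) (sym ι-A) (sym ι-B) ⟩
          ι t * ι t - ι A * ι t + ι B         ≡⟨ sym (trans (ι-+ _ B) (cong (_+ ι B) (trans (ι-+ _ _)
                                                    (cong₂ _+_ (ι-* t t) (trans (ι-neg _) (cong -_ (ι-* A t))))))) ⟩
          ι quadratic                         ≡⟨ cong ι quadratic≡0 ⟩
          ι F.0#                              ≡⟨ ι-0# ⟩
          0#                                  ∎
          where open K using (_:=_; _:*_; _:+_; _:-_)

      planeThrough-0-0 : Zero (planeThrough F.0# F.0#)
      planeThrough-0-0 = refl , F.solve 1 (λ t → :- (t :* con (ℤ.+ 0)) := con (ℤ.+ 0)) refl F.3#
                       , F.solve 3 (λ t a b → :- (con (ℤ.+ 0) :* t :* b) :+ con (ℤ.+ 0) :* t :* a := con (ℤ.+ 0)) refl F.3# A B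
                       , F.solve 2 (λ a b → con (ℤ.+ 0) :* a :* b :- con (ℤ.+ 0) :* (a :* a :- b) := con (ℤ.+ 0)) refl A B
        where open F using (_:=_; _:*_; _:+_; _:-_; :-_; con)

      nonzero-planeThrough : ∀ {c} l m → ¬ Zero c → c ≡ planeThrough l m → NonzeroPair l m
      nonzero-planeThrough {c} l m c≢0 c≡ (refl , refl) = c≢0 (subst Zero (sym c≡) planeThrough-0-0)

      planeThrough-OneBar : ∀ l m → NonzeroPair l m → OneBarPlane (planeThrough l m)
      planeThrough-OneBar l m lm≢0 = not-Γ l m lm≢0 , ExactlyOne⇒meets-C-once (planeThrough l m) (meets-C-once l m lm≢0)

      ContainsAxis⇒OneBarPlane : ∀ c → ¬ Zero c → ContainsAxis c s → OneBarPlane c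
      ContainsAxis⇒OneBarPlane c c≢0 contains =
        subst OneBarPlane (sym c≡) (planeThrough-OneBar l m (nonzero-planeThrough l m c≢0 c≡))
        where
        l m : F.Carrier
        l = proj₁ (ContainsAxis⇒InPencil c contains)
        m = proj₁ (proj₂ (ContainsAxis⇒InPencil c contains))
        c≡ : c ≡ planeThrough l m
        c≡ = proj₂ (proj₂ (ContainsAxis⇒InPencil c contains))

      ∈-pencil⇒ : ∀ {c} → c ∈ pencil → Normalized c × InPencil c
      ∈-pencil⇒ {c} c∈ with ∈-++⁻ (map (planeThrough F.1#) F.elements) c∈
      ... | inj₁ c∈₁ = let (m , _ , c≡) = ∈-map⁻ (planeThrough F.1#) c∈₁ in inj₁ (cong c0 c≡) , F.1# , m , c≡
      ... | inj₂ (here c≡) = inj₂ (inj₁ (cong c0 c≡ , trans (cong c1 c≡) -3m∞≡1)) , F.0# , m∞ , c≡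

      ∈-pencil⇐ : ∀ {c} → Normalized c → InPencil c → c ∈ pencil
      ∈-pencil⇐ {c} normalized (l , m , c≡) = go normalized
        where
        open ≡-Reasoning
        c0≡l : c0 c ≡ l
        c0≡l = cong c0 c≡
        m≡0 : c1 c ≡ F.0# → m ≡ F.0#
        m≡0 c1≡0 = 3m≡0⇒m≡0 (trans (sym (cong c1 c≡)) c1≡0)
        zero-when : c0 c ≡ F.0# → c1 c ≡ F.0# → Zero c
        zero-when c0≡0 c1≡0 = subst Zero (sym (trans c≡ (cong₂ planeThrough (trans (sym c0≡l) c0≡0) (m≡0 c1≡0))))
                                planeThrough-0-0
        go : Normalized c → c ∈ pencil
        go (inj₁ c0≡1) = ∈-++⁺ˡ (subst (_∈ map (planeThrough F.1#) F.elements)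
          (sym (trans c≡ (cong (λ w → planeThrough w m) (trans (sym c0≡l) c0≡1)))) (∈-map⁺ (planeThrough F.1#) (F.complete m)))
        go (inj₂ (inj₁ (c0≡0 , c1≡1))) = ∈-++⁺ʳ (map (planeThrough F.1#) F.elements)
          (here (trans c≡ (cong₂ planeThrough (trans (sym c0≡l) c0≡0) m≡m∞)))
          where
          m≡m∞ : m ≡ m∞
          m≡m∞ = F.-‿injective (F.*-cancelˡ F.3# 3≢0 (begin
            F.3# F.* F.- m            ≡⟨ F.solve 2 (λ t m → t :* (:- m) := :- (t :* m)) refl F.3# m ⟩
            F.- (F.3# F.* m)          ≡⟨ trans (sym (cong c1 c≡)) c1≡1 ⟩
            F.1#                      ≡⟨ sym -3m∞≡1 ⟩
            F.- (F.3# F.* m∞)         ≡⟨ F.solve 2 (λ t m → :- (t :* m) := t :* (:- m)) refl F.3# m∞ ⟩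
            F.3# F.* F.- m∞           ∎))
            where open F using (_:=_; _:*_; :-_)
        go (inj₂ (inj₂ (inj₁ (c0≡0 , c1≡0 , c2≡1)))) =
          ⊥-elim (F.0≢1 (trans (sym (proj₁ (proj₂ (proj₂ (zero-when c0≡0 c1≡0))))) c2≡1))
        go (inj₂ (inj₂ (inj₂ (c0≡0 , c1≡0 , _ , c3≡1)))) =
          ⊥-elim (F.0≢1 (trans (sym (proj₂ (proj₂ (proj₂ (zero-when c0≡0 c1≡0))))) c3≡1))

      pencil-unique : Unique pencil
      pencil-unique = Unique.++⁺ (Unique.map⁺ injective F.unique) (unique-∷ (λ ()) []) disjoint
        where
        injective : ∀ {m m′} → planeThrough F.1# m ≡ planeThrough F.1# m′ → m ≡ m′
        injective eq = F.*-cancelˡ F.3# 3≢0 (F.-‿injective (cong c1 eq))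
        disjoint : ∀ {v} → ¬ (v ∈ map (planeThrough F.1#) F.elements × v ∈ planeThrough F.0# m∞ ∷ [])
        disjoint (v∈ , here v≡) = let (_ , _ , v≡′) = ∈-map⁻ (planeThrough F.1#) v∈ in
          F.0≢1 (trans (sym (cong c0 v≡)) (cong c0 v≡′))

      length-pencil : length pencil ≡ q ℕ.+ 1
      length-pencil = trans (length-++ (map (planeThrough F.1#) F.elements))
        (cong (ℕ._+ 1) (trans (length-map _ F.elements) F.size))

      pencil-count : HasCount (λ c → Normalized c × ContainsAxis c s) (q ℕ.+ 1)
      pencil-count = pencil , pencil-unique , members , length-pencil
        where
        members : ∀ c → (c ∈ pencil) ⇔ (Normalized c × ContainsAxis c s)
        members c = mk⇔ (λ c∈ → proj₁ (∈-pencil⇒ c∈) , InPencil⇒ContainsAxis c (proj₂ (∈-pencil⇒ c∈)))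
                        (λ (normalized , contains) → ∈-pencil⇐ normalized (ContainsAxis⇒InPencil c contains))

      pencilPlaneAt-∈ : ∀ i → pencilPlaneAt i ∈ pencil
      pencilPlaneAt-∈ i = ∈-pencil⇐ (pencilPlaneAt-Normalized i) (pencilPlaneAt-InPencil i)

      pencilPlaneAt-OneBar : ∀ i → OneBarPlane (pencilPlaneAt i)
      pencilPlaneAt-OneBar ∞ = planeThrough-OneBar F.0# m∞ (λ (_ , m∞≡0) → F.0≢1 (trans (sym (trans
        (cong (λ w → F.- (F.3# F.* w)) m∞≡0) (trans (cong F.-_ (F.zeroʳ F.3#)) F.-0≡0))) -3m∞≡1))
      pencilPlaneAt-OneBar (fin r) = planeThrough-OneBar F.1# _ (λ (1≡0 , _) → F.1≢0 1≡0)

      -- I itself is a plane of the pencil; it contains P(∞), hence no other point of C.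
      I-P≢0 : ∀ r → ¬ I (P r) ≡ F.0#
      I-P≢0 r I≡0 = fin≢∞ (meets-C-once⇒unique (proj₂ (planeThrough-OneBar F.0# F.1# (λ (_ , 1≡0) → F.1≢0 1≡0)))
        (fin r) ∞ P-on (α≡ᾱ⇒P∞-on F.0# F.1# (l≡0⇒α≡ᾱ F.0# F.1# refl)))
        where
        fin≢∞ : ¬ fin r ≡ ∞
        fin≢∞ ()
        P-on : planeThrough F.0# F.1# ∙ P r ≡ F.0#
        P-on = trans (∙-planeThrough F.0# F.1# (P r)) (trans (cong (λ w → F.0# F.* R (P r) F.+ F.1# F.* w) I≡0)
          (F.solve 1 (λ x → con (ℤ.+ 0) :* x :+ con (ℤ.+ 1) :* con (ℤ.+ 0) := con (ℤ.+ 0)) refl (R (P r))))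
          where open F using (_:=_; _:*_; _:+_; con)

      pencilPlaneAt-through : ∀ i → pencilPlaneAt i ∙ Cpt i ≡ F.0#
      pencilPlaneAt-through ∞ = α≡ᾱ⇒P∞-on F.0# m∞ (l≡0⇒α≡ᾱ F.0# m∞ refl)
      pencilPlaneAt-through (fin r) = begin
        pencilPlaneAt (fin r) ∙ P r                  ≡⟨ ∙-planeThrough F.1# _ (P r) ⟩
        F.1# F.* x F.+ F.- x F.* y F.⁻¹ F.* y        ≡⟨ F.solve 3 (λ x y y′ → con (ℤ.+ 1) :* x :+ (:- x) :* y′ :* y := x :- x :* (y :* y′))
                                                          refl x y (y F.⁻¹) ⟩
        x F.- x F.* (y F.* y F.⁻¹)                   ≡⟨ cong (λ w → x F.- x F.* w) (F.inverse y (I-P≢0 r)) ⟩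
        x F.- x F.* F.1#                             ≡⟨ F.solve 1 (λ x → x :- x :* con (ℤ.+ 1) := con (ℤ.+ 0)) refl x ⟩
        F.0#                                         ∎
        where
        open ≡-Reasoning
        open F using (_:=_; _:*_; _:+_; _:-_; :-_; con)
        x = R (P r)
        y = I (P r)

  -- Two imaginary axes in a common plane

  OscK-⟨⟩ : ∀ σ {a b c d a′ b′ c′ d′} → ι a ≡ a′ → ι b ≡ b′ → ι c ≡ c′ → ι d ≡ d′ →
            OscK σ ⟨ a , b , c , d ⟩ ≡ a′ + - (K.3# * σ) * b′ + K.3# * (σ ^ 2) * c′ + - (σ ^ 3) * d′
  OscK-⟨⟩ σ = cong₄ (λ a b c d → a + - (K.3# * σ) * b + K.3# * (σ ^ 2) * c + - (σ ^ 3) * d)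

  OscK-e₀ : ∀ σ → OscK σ ⟨ F.1# , F.0# , F.0# , F.0# ⟩ ≡ 1# * 1#
  OscK-e₀ σ = trans (OscK-⟨⟩ σ ι-1# ι-0# ι-0# ι-0#) (solve 2 (λ t σ →
    con (ℤ.+ 1) :+ (:- (t :* σ)) :* con (ℤ.+ 0) :+ t :* (σ :^ 2) :* con (ℤ.+ 0) :+ (:- (σ :^ 3)) :* con (ℤ.+ 0)
    := con (ℤ.+ 1) :* con (ℤ.+ 1)) refl K.3# σ)
    where open K using (solve; _:=_; _:+_; _:*_; :-_; _:^_; con)

  OscK-e₁ : ∀ σ → OscK σ ⟨ F.0# , F.1# , F.0# , F.0# ⟩ ≡ - K.3# * σ
  OscK-e₁ σ = trans (OscK-⟨⟩ σ ι-0# ι-1# ι-0# ι-0#) (solve 2 (λ t σ →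
    con (ℤ.+ 0) :+ (:- (t :* σ)) :* con (ℤ.+ 1) :+ t :* (σ :^ 2) :* con (ℤ.+ 0) :+ (:- (σ :^ 3)) :* con (ℤ.+ 0)
    := (:- t) :* σ) refl K.3# σ)
    where open K using (solve; _:=_; _:+_; _:*_; :-_; _:^_; con)

  OscK-e₂ : ∀ σ → OscK σ ⟨ F.0# , F.0# , F.1# , F.0# ⟩ ≡ K.3# * (σ * σ)
  OscK-e₂ σ = trans (OscK-⟨⟩ σ ι-0# ι-0# ι-1# ι-0#) (solve 2 (λ t σ →
    con (ℤ.+ 0) :+ (:- (t :* σ)) :* con (ℤ.+ 0) :+ t :* (σ :^ 2) :* con (ℤ.+ 1) :+ (:- (σ :^ 3)) :* con (ℤ.+ 0)
    := t :* (σ :* σ)) refl K.3# σ)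
    where open K using (solve; _:=_; _:+_; _:*_; :-_; _:^_; con)

  OscK-e₃ : ∀ σ → OscK σ ⟨ F.0# , F.0# , F.0# , F.1# ⟩ ≡ - 1# * (σ * σ * σ)
  OscK-e₃ σ = trans (OscK-⟨⟩ σ ι-0# ι-0# ι-0# ι-1#) (solve 2 (λ t σ →
    con (ℤ.+ 0) :+ (:- (t :* σ)) :* con (ℤ.+ 0) :+ t :* (σ :^ 2) :* con (ℤ.+ 0) :+ (:- (σ :^ 3)) :* con (ℤ.+ 1)
    := (:- con (ℤ.+ 1)) :* (σ :* σ :* σ)) refl K.3# σ)
    where open K using (solve; _:=_; _:+_; _:*_; :-_; _:^_; con)

  3≢0ᴷ : ¬ K.3# ≡ 0#
  3≢0ᴷ 3≡0 = ι-nonzero 3≢0 (trans ι-3 3≡0)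

  -- Writing a plane through two axes in both pencils and evaluating at the
  -- unit points gives a Vandermonde system in s, s̄, s′ and s̄′.
  common-plane⇒same-axis : ∀ s s′ → NotInF s → NotInF s′ → ∀ c → ¬ Zero c →
                           ContainsAxis c s → ContainsAxis c s′ → s′ ≡ s ⊎ s′ ≡ φ s
  common-plane⇒same-axis s s′ s∉F s′∉F c c≢0 c⊇s c⊇s′ with s′ K.≟ s | s′ K.≟ φ s
  ... | yes s′≡s | _ = inj₁ s′≡s
  ... | no _ | yes s′≡s̄ = inj₂ s′≡s̄
  ... | no s′≢s | no s′≢s̄ = ⊥-elim (A.α-nonzero s∉F l m (A.nonzero-planeThrough s∉F l m c≢0 c≡) α≡0)
    where
    module A = Axis s
    module B = Axis s′
    open ≡-Reasoning
    l = proj₁ (A.ContainsAxis⇒InPencil s∉F c c⊇s)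
    m = proj₁ (proj₂ (A.ContainsAxis⇒InPencil s∉F c c⊇s))
    c≡ : c ≡ A.planeThrough l m
    c≡ = proj₂ (proj₂ (A.ContainsAxis⇒InPencil s∉F c c⊇s))
    l′ = proj₁ (B.ContainsAxis⇒InPencil s′∉F c c⊇s′)
    m′ = proj₁ (proj₂ (B.ContainsAxis⇒InPencil s′∉F c c⊇s′))
    c≡′ : c ≡ B.planeThrough l′ m′
    c≡′ = proj₂ (proj₂ (B.ContainsAxis⇒InPencil s′∉F c c⊇s′))
    s̄ = φ s
    s̄′ = φ s′
    D D′ α ᾱ γ γ̄ : K.Carrier
    D = s̄ - s
    D′ = s̄′ - s′
    α = A.α s∉F l m
    ᾱ = A.ᾱ s∉F l m
    γ = B.α s′∉F l′ m′
    γ̄ = B.ᾱ s′∉F l′ m′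
    x₁ x₂ x₃ x₄ : K.Carrier
    x₁ = D′ * α
    x₂ = - (D′ * ᾱ)
    x₃ = - (D * γ)
    x₄ = D * γ̄
    both-pencils : ∀ y → D′ * (α * OscK s y - ᾱ * OscK s̄ y) ≡ D * (γ * OscK s′ y - γ̄ * OscK s̄′ y)
    both-pencils y = begin
      D′ * (α * OscK s y - ᾱ * OscK s̄ y)       ≡⟨ cong (D′ *_) (sym (A.∙-planeThrough-osculating s∉F l m y)) ⟩
      D′ * (D * ι (A.planeThrough l m ∙ y))    ≡⟨ cong (λ w → D′ * (D * ι (w ∙ y))) (trans (sym c≡) c≡′) ⟩
      D′ * (D * ι (B.planeThrough l′ m′ ∙ y))  ≡⟨ K.solve 3 (λ a b c → a :* (b :* c) := b :* (a :* c)) refl D′ D _ ⟩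
      D * (D′ * ι (B.planeThrough l′ m′ ∙ y))  ≡⟨ cong (D *_) (B.∙-planeThrough-osculating s′∉F l′ m′ y) ⟩
      D * (γ * OscK s′ y - γ̄ * OscK s̄′ y)      ∎
      where open K using (_:=_; _:*_)
    moment : ∀ y κ (f : K.Carrier → K.Carrier) → ¬ κ ≡ 0# → (∀ σ → OscK σ y ≡ κ * f σ) →
             x₁ * f s + x₂ * f s̄ + x₃ * f s′ + x₄ * f s̄′ ≡ 0#
    moment y κ f κ≢0 osc = K.*-cancelˡ-zero κ≢0 (begin
      κ * (x₁ * f s + x₂ * f s̄ + x₃ * f s′ + x₄ * f s̄′)
        ≡⟨ K.solve 11 (λ k d d′ a b g h p₁ p₂ p₃ p₄ →
             k :* ((d′ :* a) :* p₁ :+ (:- (d′ :* b)) :* p₂ :+ (:- (d :* g)) :* p₃ :+ (d :* h) :* p₄)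
             := d′ :* (a :* (k :* p₁) :- b :* (k :* p₂)) :- d :* (g :* (k :* p₃) :- h :* (k :* p₄)))
             refl κ D D′ α ᾱ γ γ̄ (f s) (f s̄) (f s′) (f s̄′) ⟩
      D′ * (α * (κ * f s) - ᾱ * (κ * f s̄)) - D * (γ * (κ * f s′) - γ̄ * (κ * f s̄′))
        ≡⟨ cong₂ (λ u v → u - v) (cong₂ (λ u v → D′ * (α * u - ᾱ * v)) (sym (osc s)) (sym (osc s̄)))
                                  (cong₂ (λ u v → D * (γ * u - γ̄ * v)) (sym (osc s′)) (sym (osc s̄′))) ⟩
      D′ * (α * OscK s y - ᾱ * OscK s̄ y) - D * (γ * OscK s′ y - γ̄ * OscK s̄′ y)
        ≡⟨ cong (_- D * (γ * OscK s′ y - γ̄ * OscK s̄′ y)) (both-pencils y) ⟩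
      D * (γ * OscK s′ y - γ̄ * OscK s̄′ y) - D * (γ * OscK s′ y - γ̄ * OscK s̄′ y)
        ≡⟨ K.-‿inverseʳ _ ⟩
      0# ∎)
      where open K using (_:=_; _:*_; _:+_; _:-_; :-_)
    x₁≡0 : x₁ ≡ 0#
    x₁≡0 = K.vandermonde₄ x₁ x₂ x₃ x₄ s s̄ s′ s̄′ (A.s≢s̄ s∉F) (λ s≡s′ → s′≢s (sym s≡s′))
      (λ s≡s̄′ → s′≢s̄ (trans (sym (φ-involutive s′)) (cong φ (sym s≡s̄′)))) (λ s̄≡s′ → s′≢s̄ (sym s̄≡s′))
      (trans (K.solve 4 (λ a b c d → a :+ b :+ c :+ d := a :* con (ℤ.+ 1) :+ b :* con (ℤ.+ 1) :+ c :* con (ℤ.+ 1) :+ d :* con (ℤ.+ 1))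
               refl x₁ x₂ x₃ x₄)
             (moment ⟨ F.1# , F.0# , F.0# , F.0# ⟩ 1# (λ _ → 1#) K.1≢0 OscK-e₀))
      (moment ⟨ F.0# , F.1# , F.0# , F.0# ⟩ (- K.3#) (λ σ → σ) (K.-‿nonzero 3≢0ᴷ) OscK-e₁)
      (moment ⟨ F.0# , F.0# , F.1# , F.0# ⟩ K.3# (λ σ → σ * σ) 3≢0ᴷ OscK-e₂)
      (moment ⟨ F.0# , F.0# , F.0# , F.1# ⟩ (- 1#) (λ σ → σ * σ * σ) (K.-‿nonzero K.1≢0) OscK-e₃)
      where open K using (_:=_; _:*_; _:+_; con)
    α≡0 : α ≡ 0#
    α≡0 = K.*-cancelˡ-zero (B.s̄-s≢0 s′∉F) x₁≡0


  -- Planes through a point of C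

  -- The normalized planes through a point of C correspond to monic quadratics
  -- X² + p X + e: the plane cuts C in that point and in the roots of the quadratic.
  planeAt : CIndex → F.Carrier × F.Carrier → V4
  planeAt ∞ (p , e) = ⟨ F.0# , F.1# , p , e ⟩
  planeAt (fin r) (p , e) = ⟨ F.1# , p F.- r , e F.- r F.* p , F.- (r F.* e) ⟩

  quadraticAt : CIndex → V4 → F.Carrier × F.Carrier
  quadraticAt ∞ c = c2 c , c3 c
  quadraticAt (fin r) c = c1 c F.+ r , c2 c F.+ r F.* (c1 c F.+ r)

  planeAt-quadraticAt : ∀ i c → Normalized c → OneBarPlane c → c ∙ Cpt i ≡ F.0# → planeAt i (quadraticAt i c) ≡ c
  planeAt-quadraticAt ∞ c normalized oneBar P∞-on = go normalized
    where
    c0≡0 : c0 c ≡ F.0#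
    c0≡0 = trans (sym (∙P∞ c)) P∞-on
    go : Normalized c → planeAt ∞ (quadraticAt ∞ c) ≡ c
    go (inj₁ c0≡1) = ⊥-elim (F.0≢1 (trans (sym c0≡0) c0≡1))
    go (inj₂ (inj₁ (c0≡0 , c1≡1))) = cong₄ ⟨_,_,_,_⟩ (sym c0≡0) (sym c1≡1) refl refl
    go (inj₂ (inj₂ (inj₁ (c0≡0 , c1≡0 , c2≡1)))) =
      ⊥-elim (two-points⇒¬OneBarPlane c ∞ (fin t) (λ ()) P∞-on Pt-on oneBar)
      where
      open F using (_:=_; _:+_; _:*_; :-_; _:^_; con)
      t = F.- (c3 c)
      Pt-on : c ∙ P t ≡ F.0#
      Pt-on = trans (cong₄ (λ x y z w → x F.* (t F.^ 3) F.+ y F.* (t F.^ 2) F.+ z F.* t F.+ w F.* F.1#) c0≡0 c1≡0 c2≡1 refl)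
        (F.solve 1 (λ d → con (ℤ.+ 0) :* (:- d) :^ 3 :+ con (ℤ.+ 0) :* (:- d) :^ 2 :+ con (ℤ.+ 1) :* (:- d) :+ d :* con (ℤ.+ 1)
                          := con (ℤ.+ 0)) refl (c3 c))
    go (inj₂ (inj₂ (inj₂ (c0≡0 , c1≡0 , c2≡0 , c3≡1)))) = ⊥-elim (proj₁ oneBar (inj₂ (F.1# , F.1≢0 ,
      cong₄ ⟨_,_,_,_⟩ (trans c0≡0 (sym (F.zeroʳ F.1#))) (trans c1≡0 (sym (F.zeroʳ F.1#))) (trans c2≡0 (sym (F.zeroʳ F.1#)))
                      (trans c3≡1 (sym (F.*-identityʳ F.1#))))))
  planeAt-quadraticAt (fin r) c normalized oneBar Pr-on = go normalized
    where
    c0≢0 : ¬ c0 c ≡ F.0#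
    c0≢0 c0≡0 = two-points⇒¬OneBarPlane c (fin r) ∞ (λ ()) Pr-on (trans (∙P∞ c) c0≡0) oneBar
    go : Normalized c → planeAt (fin r) (quadraticAt (fin r) c) ≡ c
    go (inj₁ c0≡1) = cong₄ ⟨_,_,_,_⟩ (sym c0≡1) (F.solve 2 (λ a r → (a :+ r) :- r := a) refl (c1 c) r)
      (F.solve 3 (λ a b r → (b :+ r :* (a :+ r)) :- r :* (a :+ r) := b) refl (c1 c) (c2 c) r) c3≡
      where
      open ≡-Reasoning
      open F using (_:=_; _:+_; _:*_; _:-_; :-_; _:^_; con)
      c3≡ : F.- (r F.* (c2 c F.+ r F.* (c1 c F.+ r))) ≡ c3 c
      c3≡ = begin
        F.- (r F.* (c2 c F.+ r F.* (c1 c F.+ r)))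
          ≡⟨ F.solve 5 (λ a b d e r → :- (r :* (d :+ r :* (b :+ r)))
               := e :- (a :* r :^ 3 :+ b :* r :^ 2 :+ d :* r :+ e :* con (ℤ.+ 1)) :+ (a :- con (ℤ.+ 1)) :* r :^ 3)
               refl (c0 c) (c1 c) (c2 c) (c3 c) r ⟩
        c3 c F.- c ∙ P r F.+ (c0 c F.- F.1#) F.* r F.^ 3   ≡⟨ cong₂ (λ u v → c3 c F.- u F.+ (v F.- F.1#) F.* r F.^ 3) Pr-on c0≡1 ⟩
        c3 c F.- F.0# F.+ (F.1# F.- F.1#) F.* r F.^ 3      ≡⟨ F.solve 2 (λ e r → e :- con (ℤ.+ 0) :+ (con (ℤ.+ 1) :- con (ℤ.+ 1)) :* r :^ 3
                                                               := e) refl (c3 c) r ⟩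
        c3 c                                              ∎
    go (inj₂ (inj₁ (c0≡0 , _))) = ⊥-elim (c0≢0 c0≡0)
    go (inj₂ (inj₂ (inj₁ (c0≡0 , _)))) = ⊥-elim (c0≢0 c0≡0)
    go (inj₂ (inj₂ (inj₂ (c0≡0 , _)))) = ⊥-elim (c0≢0 c0≡0)

  quadraticWithRoots : F.Carrier × F.Carrier → F.Carrier × F.Carrier
  quadraticWithRoots (r₁ , r₂) = F.- (r₁ F.+ r₂) , r₁ F.* r₂

  ∙-planeAt-split : ∀ r r₁ r₂ t →
                    planeAt (fin r) (quadraticWithRoots (r₁ , r₂)) ∙ P t ≡ (t F.- r) F.* ((t F.- r₁) F.* (t F.- r₂))
  ∙-planeAt-split r r₁ r₂ t = F.solve 4 (λ r a b t →
      con (ℤ.+ 1) :* t :^ 3 :+ ((:- (a :+ b)) :- r) :* t :^ 2 :+ (a :* b :- r :* (:- (a :+ b))) :* t :+ (:- (r :* (a :* b))) :* con (ℤ.+ 1)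
      := (t :- r) :* ((t :- a) :* (t :- b))) refl r r₁ r₂ t
    where open F using (_:=_; _:+_; _:*_; _:-_; :-_; _:^_; con)

  -- Such a plane meets C twice, unless r = r₁ = r₂ and it is the osculating plane at P(r).
  planeAt-split-¬OneBar : ∀ i r₁ r₂ → ¬ OneBarPlane (planeAt i (quadraticWithRoots (r₁ , r₂)))
  planeAt-split-¬OneBar ∞ r₁ r₂ = two-points⇒¬OneBarPlane _ ∞ (fin r₁) (λ ()) (∙P∞ _)
    (F.solve 2 (λ a b → con (ℤ.+ 0) :* a :^ 3 :+ con (ℤ.+ 1) :* a :^ 2 :+ (:- (a :+ b)) :* a :+ (a :* b) :* con (ℤ.+ 1)
                        := con (ℤ.+ 0)) refl r₁ r₂)
    where open F using (_:=_; _:+_; _:*_; :-_; _:^_; con)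
  planeAt-split-¬OneBar (fin r) r₁ r₂ oneBar with r₁ F.≟ r | r₂ F.≟ r
  ... | no r₁≢r | _ = two-points⇒¬OneBarPlane c (fin r) (fin r₁) (λ { refl → r₁≢r refl })
        (vanish r (F.solve 3 (λ x a b → (x :- x) :* ((x :- a) :* (x :- b)) := con (ℤ.+ 0)) refl r r₁ r₂))
        (vanish r₁ (F.solve 3 (λ x y r → (x :- r) :* ((x :- x) :* (x :- y)) := con (ℤ.+ 0)) refl r₁ r₂ r)) oneBar
    where
    open F using (_:=_; _:+_; _:*_; _:-_; con)
    c = planeAt (fin r) (quadraticWithRoots (r₁ , r₂))
    vanish : ∀ t → (t F.- r) F.* ((t F.- r₁) F.* (t F.- r₂)) ≡ F.0# → c ∙ P t ≡ F.0#
    vanish t eq = trans (∙-planeAt-split r r₁ r₂ t) eq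
  ... | yes _ | no r₂≢r = two-points⇒¬OneBarPlane c (fin r) (fin r₂) (λ { refl → r₂≢r refl })
        (vanish r (F.solve 3 (λ x a b → (x :- x) :* ((x :- a) :* (x :- b)) := con (ℤ.+ 0)) refl r r₁ r₂))
        (vanish r₂ (F.solve 3 (λ x a r → (x :- r) :* ((x :- a) :* (x :- x)) := con (ℤ.+ 0)) refl r₂ r₁ r)) oneBar
    where
    open F using (_:=_; _:+_; _:*_; _:-_; con)
    c = planeAt (fin r) (quadraticWithRoots (r₁ , r₂))
    vanish : ∀ t → (t F.- r) F.* ((t F.- r₁) F.* (t F.- r₂)) ≡ F.0# → c ∙ P t ≡ F.0#
    vanish t eq = trans (∙-planeAt-split r r₁ r₂ t) eq
  ... | yes refl | yes refl = proj₁ oneBar (inj₁ (r , F.1# , F.1≢0 , cong₄ ⟨_,_,_,_⟩ (sym (F.*-identityʳ F.1#))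
        (F.solve 1 (λ r → (:- (r :+ r)) :- r := con (ℤ.+ 1) :* (:- ((con (ℤ.+ 1) :+ con (ℤ.+ 1) :+ con (ℤ.+ 1)) :* r))) refl r)
        (F.solve 1 (λ r → r :* r :- r :* (:- (r :+ r)) := con (ℤ.+ 1) :* ((con (ℤ.+ 1) :+ con (ℤ.+ 1) :+ con (ℤ.+ 1)) :* (r :^ 2))) refl r)
        (F.solve 1 (λ r → :- (r :* (r :* r)) := con (ℤ.+ 1) :* (:- (r :^ 3))) refl r)))
    where open F using (_:=_; _:+_; _:*_; _:-_; :-_; _:^_; con)

  -- The partition of the 1̄_C-planes into pencils

  Normalized⇒nonzero : ∀ c → Normalized c → ¬ Zero c
  Normalized⇒nonzero c (inj₁ c0≡1) (c0≡0 , _) = F.0≢1 (trans (sym c0≡0) c0≡1)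
  Normalized⇒nonzero c (inj₂ (inj₁ (_ , c1≡1))) (_ , c1≡0 , _) = F.0≢1 (trans (sym c1≡0) c1≡1)
  Normalized⇒nonzero c (inj₂ (inj₂ (inj₁ (_ , _ , c2≡1)))) (_ , _ , c2≡0 , _) = F.0≢1 (trans (sym c2≡0) c2≡1)
  Normalized⇒nonzero c (inj₂ (inj₂ (inj₂ (_ , _ , _ , c3≡1)))) (_ , _ , _ , c3≡0) = F.0≢1 (trans (sym c3≡0) c3≡1)

  ∙-· : ∀ κ c y → (κ · c) ∙ y ≡ κ F.* (c ∙ y)
  ∙-· κ c y = F.solve 9 (λ k a b d e w x y z → k :* a :* w :+ k :* b :* x :+ k :* d :* y :+ k :* e :* z
                                               := k :* (a :* w :+ b :* x :+ d :* y :+ e :* z))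
    refl κ (c0 c) (c1 c) (c2 c) (c3 c) (c0 y) (c1 y) (c2 y) (c3 y)
    where open F using (_:=_; _:+_; _:*_)

  Proportional-· : ∀ κ c d → ¬ κ ≡ F.0# → Proportional (κ · c) d → Proportional c d
  Proportional-· κ c d κ≢0 (λ′ , λ′≢0 , κc≡λ′d) = κ F.⁻¹ F.* λ′ , F.*-nonzero (F.⁻¹-nonzero κ κ≢0) λ′≢0 ,
    cong₄ ⟨_,_,_,_⟩ (divide (cong c0 κc≡λ′d)) (divide (cong c1 κc≡λ′d)) (divide (cong c2 κc≡λ′d)) (divide (cong c3 κc≡λ′d))
    where
    divide : ∀ {x y} → κ F.* x ≡ λ′ F.* y → x ≡ (κ F.⁻¹ F.* λ′) F.* y
    divide {x} {y} eq = begin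
      x                          ≡⟨ sym (F.*-identityˡ x) ⟩
      F.1# F.* x                 ≡⟨ cong (F._* x) (sym (F.⁻¹-inverseˡ κ κ≢0)) ⟩
      κ F.⁻¹ F.* κ F.* x         ≡⟨ F.*-assoc _ _ _ ⟩
      κ F.⁻¹ F.* (κ F.* x)       ≡⟨ cong (κ F.⁻¹ F.*_) eq ⟩
      κ F.⁻¹ F.* (λ′ F.* y)      ≡⟨ sym (F.*-assoc _ _ _) ⟩
      κ F.⁻¹ F.* λ′ F.* y        ∎
      where open ≡-Reasoning

  OneBarPlane-· : ∀ κ c → ¬ κ ≡ F.0# → OneBarPlane c → OneBarPlane (κ · c)
  OneBarPlane-· κ c κ≢0 (¬Γ , points , points-unique , members , length≡1) =
    ¬Γ′ , points , points-unique , (λ i → mk⇔ (to i) (from i)) , length≡1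
    where
    ¬Γ′ : ¬ ΓPlane (κ · c)
    ¬Γ′ (inj₁ (t , prop)) = ¬Γ (inj₁ (t , Proportional-· κ c _ κ≢0 prop))
    ¬Γ′ (inj₂ prop) = ¬Γ (inj₂ (Proportional-· κ c _ κ≢0 prop))
    to : ∀ i → i ∈ points → (κ · c) ∙ Cpt i ≡ F.0#
    to i i∈ = trans (∙-· κ c (Cpt i)) (trans (cong (κ F.*_) (Equivalence.to (members i) i∈)) (F.zeroʳ κ))
    from : ∀ i → (κ · c) ∙ Cpt i ≡ F.0# → i ∈ points
    from i on = Equivalence.from (members i) (F.*-cancelˡ-zero κ≢0 (trans (sym (∙-· κ c (Cpt i))) on))

  ContainsAxis-·⁻¹ : ∀ κ c s → ¬ κ ≡ F.0# → ContainsAxis (κ · c) s → ContainsAxis c s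
  ContainsAxis-·⁻¹ κ c s κ≢0 contains x x∈axis = F.*-cancelˡ-zero κ≢0 (trans (sym (∙-· κ c x)) (contains x x∈axis))

  scaled-zero : ∀ {κ x} → x ≡ F.0# → κ F.* x ≡ F.0#
  scaled-zero {κ} x≡0 = trans (cong (κ F.*_) x≡0) (F.zeroʳ κ)

  normalize : ∀ c → ¬ Zero c → Σ F.Carrier λ κ → ¬ κ ≡ F.0# × Normalized (κ · c)
  normalize c c≢0 with c0 c F.≟ F.0# | c1 c F.≟ F.0# | c2 c F.≟ F.0# | c3 c F.≟ F.0#
  ... | no c0≢0 | _ | _ | _ = c0 c F.⁻¹ , F.⁻¹-nonzero _ c0≢0 , inj₁ (F.⁻¹-inverseˡ _ c0≢0)
  ... | yes c0≡0 | no c1≢0 | _ | _ =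
    c1 c F.⁻¹ , F.⁻¹-nonzero _ c1≢0 , inj₂ (inj₁ (scaled-zero c0≡0 , F.⁻¹-inverseˡ _ c1≢0))
  ... | yes c0≡0 | yes c1≡0 | no c2≢0 | _ =
    c2 c F.⁻¹ , F.⁻¹-nonzero _ c2≢0 , inj₂ (inj₂ (inj₁ (scaled-zero c0≡0 , scaled-zero c1≡0 , F.⁻¹-inverseˡ _ c2≢0)))
  ... | yes c0≡0 | yes c1≡0 | yes c2≡0 | no c3≢0 =
    c3 c F.⁻¹ , F.⁻¹-nonzero _ c3≢0 ,
    inj₂ (inj₂ (inj₂ (scaled-zero c0≡0 , scaled-zero c1≡0 , scaled-zero c2≡0 , F.⁻¹-inverseˡ _ c3≢0)))
  ... | yes c0≡0 | yes c1≡0 | yes c2≡0 | yes c3≡0 = ⊥-elim (c≢0 (c0≡0 , c1≡0 , c2≡0 , c3≡0))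


  imaginary : List K.Carrier
  imaginary = filter (λ w → ¬? (InF? w)) K.elements

  imaginary-sound : ∀ {w} → w ∈ imaginary → NotInF w
  imaginary-sound w∈ (a , ιa≡w) = proj₂ (∈-filter⁻ (λ w → ¬? (InF? w)) {xs = K.elements} w∈) (lose (F.complete a) ιa≡w)

  imaginary-complete : ∀ {w} → NotInF w → w ∈ imaginary
  imaginary-complete {w} w∉F = ∈-filter⁺ (λ w → ¬? (InF? w)) (K.complete w) (λ found → w∉F (satisfied found))

  imaginary-unique : Unique imaginary
  imaginary-unique = Unique.filter⁺ (λ w → ¬? (InF? w)) K.unique

  length-imaginary : length imaginary ℕ.+ q ≡ q ℕ.* q
  length-imaginary = begin
    length imaginary ℕ.+ q                          ≡⟨ cong (length imaginary ℕ.+_) (sym (trans (length-map ι F.elements) F.size)) ⟩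
    length imaginary ℕ.+ length (map ι F.elements)  ≡⟨ sym (length-++ imaginary) ⟩
    length (imaginary ++ map ι F.elements)          ≡⟨ unique-⇔⇒length≡ split-unique K.unique (λ {w} → mk⇔ (λ _ → K.complete w) split-complete) ⟩
    length K.elements                               ≡⟨ K.size ⟩
    q ℕ.* q                                         ∎
    where
    open ≡-Reasoning
    split-unique : Unique (imaginary ++ map ι F.elements)
    split-unique = Unique.++⁺ imaginary-unique (Unique.map⁺ ι-injective F.unique)
      (λ (w∈ , w∈ι) → let (a , _ , w≡ιa) = ∈-map⁻ ι w∈ι in imaginary-sound w∈ (a , sym w≡ιa))
    split-complete : ∀ {w} → w ∈ K.elements → w ∈ imaginary ++ map ι F.elements
    split-complete {w} _ with InF? w
    ... | yes found = let (a , ιa≡w) = satisfied found in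
                      ∈-++⁺ʳ imaginary (subst (_∈ map ι F.elements) ιa≡w (∈-map⁺ ι (F.complete a)))
    ... | no not-found = ∈-++⁺ˡ (∈-filter⁺ (λ w → ¬? (InF? w)) (K.complete w) not-found)

  -- One representative of each conjugate pair {s, s̄}, i.e. of each imaginary axis.
  axisRepresentatives : OrbitRepresentatives φ φ-involutive imaginary
  axisRepresentatives = orbitRepresentatives φ φ-involutive (length imaginary) imaginary ℕ.≤-refl imaginary-unique
    (λ {w} w∈ → imaginary-complete (Axis.s̄∉F w (imaginary-sound w∈)))
    (λ {w} w∈ φw≡w → Axis.s≢s̄ w (imaginary-sound w∈) (sym φw≡w))

  open OrbitRepresentatives axisRepresentatives renaming (reps to axes) using (reps-unique; reps-⊆; reps-separated; length-double)

  axes-imaginary : ∀ {s} → s ∈ axes → NotInF s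
  axes-imaginary s∈ = imaginary-sound (reps-⊆ s∈)

  length-axes : length axes ≡ q C 2
  length-axes = halve (ℕ.+-cancelʳ-≡ q (length axes ℕ.+ length axes) (q C 2 ℕ.+ q C 2)
    (trans (cong (ℕ._+ q) (sym length-double)) (trans length-imaginary (sym (C2-double q)))))
    where
    halve : ∀ {a b} → a ℕ.+ a ≡ b ℕ.+ b → a ≡ b
    halve {a} {b} eq = ℕ.*-cancelˡ-≡ a b 2
      (trans (cong (a ℕ.+_) (ℕ.+-identityʳ a)) (trans eq (sym (cong (b ℕ.+_) (ℕ.+-identityʳ b)))))

  axes-common-plane : ∀ {s s′} → s ∈ axes → s′ ∈ axes → ∀ c → ¬ Zero c →
                      ContainsAxis c s → ContainsAxis c s′ → s ≡ s′
  axes-common-plane {s} {s′} s∈ s′∈ c c≢0 c⊇s c⊇s′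
    with common-plane⇒same-axis s s′ (axes-imaginary s∈) (axes-imaginary s′∈) c c≢0 c⊇s c⊇s′
  ... | inj₁ s′≡s = sym s′≡s
  ... | inj₂ s′≡s̄ = ⊥-elim (reps-separated s∈ s′∈ s′≡s̄)

  splitQuadratics : List (F.Carrier × F.Carrier)
  splitQuadratics = map quadraticWithRoots (unorderedPairs F.elements)

  quadraticWithRoots-roots : ∀ r₁ r₂ r₃ r₄ → quadraticWithRoots (r₁ , r₂) ≡ quadraticWithRoots (r₃ , r₄) →
                             (r₃ ≡ r₁ × r₄ ≡ r₂) ⊎ (r₃ ≡ r₂ × r₄ ≡ r₁)
  quadraticWithRoots-roots r₁ r₂ r₃ r₄ eq with F.*-zero-product (r₃ F.- r₁) (r₃ F.- r₂) r₃-root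
    where
    open ≡-Reasoning
    open F using (_:=_; _:+_; _:*_; _:-_; con)
    r₃-root : (r₃ F.- r₁) F.* (r₃ F.- r₂) ≡ F.0#
    r₃-root = begin
      (r₃ F.- r₁) F.* (r₃ F.- r₂)                       ≡⟨ F.solve 3 (λ a b c → (c :- a) :* (c :- b) := c :* c :- (a :+ b) :* c :+ a :* b)
                                                             refl r₁ r₂ r₃ ⟩
      r₃ F.* r₃ F.- (r₁ F.+ r₂) F.* r₃ F.+ r₁ F.* r₂     ≡⟨ cong₂ (λ u v → r₃ F.* r₃ F.- u F.* r₃ F.+ v) (F.-‿injective (cong proj₁ eq)) (cong proj₂ eq) ⟩
      r₃ F.* r₃ F.- (r₃ F.+ r₄) F.* r₃ F.+ r₃ F.* r₄     ≡⟨ F.solve 2 (λ c d → c :* c :- (c :+ d) :* c :+ c :* d := con (ℤ.+ 0)) refl r₃ r₄ ⟩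
      F.0#                                              ∎
  ... | inj₁ r₃-r₁≡0 = inj₁ (F.x-y≡0⇒x≡y r₃-r₁≡0 , other-root r₁ r₂ (F.x-y≡0⇒x≡y r₃-r₁≡0) refl)
    where
    other-root : ∀ a b → r₃ ≡ a → r₁ F.+ r₂ ≡ a F.+ b → r₄ ≡ b
    other-root a b r₃≡a sum≡ = F.x+z≡y+z⇒x≡y r₃ (trans (F.+-comm r₄ r₃) (trans (sym (F.-‿injective (cong proj₁ eq)))
                                 (trans sum≡ (trans (F.+-comm a b) (cong (b F.+_) (sym r₃≡a))))))
  ... | inj₂ r₃-r₂≡0 = inj₂ (F.x-y≡0⇒x≡y r₃-r₂≡0 , F.x+z≡y+z⇒x≡y r₃ (trans (F.+-comm r₄ r₃)
          (trans (sym (F.-‿injective (cong proj₁ eq))) (cong (r₁ F.+_) (sym (F.x-y≡0⇒x≡y r₃-r₂≡0))))))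

  splitQuadratics-unique : Unique splitQuadratics
  splitQuadratics-unique = map-unique-on quadraticWithRoots (unorderedPairs-unique F.unique) injective
    where
    injective : ∀ {x y} → x ∈ unorderedPairs F.elements → y ∈ unorderedPairs F.elements →
                quadraticWithRoots x ≡ quadraticWithRoots y → x ≡ y
    injective {r₁ , r₂} {r₃ , r₄} x∈ y∈ eq with quadraticWithRoots-roots r₁ r₂ r₃ r₄ eq
    ... | inj₁ (r₃≡r₁ , r₄≡r₂) = sym (cong₂ _,_ r₃≡r₁ r₄≡r₂)
    ... | inj₂ (r₃≡r₂ , r₄≡r₁) = sym (cong₂ _,_ (trans r₃≡r₂ (sym r₁≡r₂)) (trans r₄≡r₁ r₁≡r₂))
      where
      r₁≡r₂ : r₁ ≡ r₂
      r₁≡r₂ = unorderedPairs-antisym F.unique x∈ (subst (_∈ unorderedPairs F.elements) (cong₂ _,_ r₃≡r₂ r₄≡r₁) y∈)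

  length-splitQuadratics : length splitQuadratics ≡ suc q C 2
  length-splitQuadratics = trans (length-map _ (unorderedPairs F.elements))
    (trans (length-unorderedPairs F.elements) (cong (λ n → suc n C 2) F.size))

  splitQuadratics-¬OneBar : ∀ i {g} → g ∈ splitQuadratics → ¬ OneBarPlane (planeAt i g)
  splitQuadratics-¬OneBar i g∈ oneBar with ∈-map⁻ quadraticWithRoots g∈
  ... | (r₁ , r₂) , _ , refl = planeAt-split-¬OneBar i r₁ r₂ oneBar

  -- At each point of C, the q C 2 pencil planes and the (q + 1) C 2 split planes
  -- are distinct and exhaust all q² normalized planes through that point.
  module AtPoint (i : CIndex) where

    pencilQuadratic : K.Carrier → F.Carrier × F.Carrier
    pencilQuadratic s = quadraticAt i (Axis.pencilPlaneAt s i)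

    planeAt-pencilQuadratic : ∀ {s} → s ∈ axes → planeAt i (pencilQuadratic s) ≡ Axis.pencilPlaneAt s i
    planeAt-pencilQuadratic {s} s∈ = planeAt-quadraticAt i _ (Axis.pencilPlaneAt-Normalized s i)
      (Axis.pencilPlaneAt-OneBar s (axes-imaginary s∈) i) (Axis.pencilPlaneAt-through s (axes-imaginary s∈) i)

    pencilQuadratics : List (F.Carrier × F.Carrier)
    pencilQuadratics = map pencilQuadratic axes

    pencilQuadratics-unique : Unique pencilQuadratics
    pencilQuadratics-unique = map-unique-on pencilQuadratic reps-unique injective
      where
      injective : ∀ {s s′} → s ∈ axes → s′ ∈ axes → pencilQuadratic s ≡ pencilQuadratic s′ → s ≡ s′
      injective {s} {s′} s∈ s′∈ eq = axes-common-plane s∈ s′∈ (Axis.pencilPlaneAt s i)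
        (Normalized⇒nonzero _ (Axis.pencilPlaneAt-Normalized s i))
        (Axis.InPencil⇒ContainsAxis s (axes-imaginary s∈) _ (Axis.pencilPlaneAt-InPencil s i))
        (Axis.InPencil⇒ContainsAxis s′ (axes-imaginary s′∈) _ (subst (Axis.InPencil s′)
          (trans (sym (planeAt-pencilQuadratic s′∈)) (trans (cong (planeAt i) (sym eq)) (planeAt-pencilQuadratic s∈)))
          (Axis.pencilPlaneAt-InPencil s′ i)))

    quadratics : List (F.Carrier × F.Carrier)
    quadratics = pencilQuadratics ++ splitQuadratics

    quadratics-unique : Unique quadratics
    quadratics-unique = Unique.++⁺ pencilQuadratics-unique splitQuadratics-unique disjoint
      where
      disjoint : ∀ {g} → ¬ (g ∈ pencilQuadratics × g ∈ splitQuadratics)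
      disjoint (g∈ , g∈split) with ∈-map⁻ pencilQuadratic g∈
      ... | s , s∈ , refl = splitQuadratics-¬OneBar i g∈split
        (subst OneBarPlane (sym (planeAt-pencilQuadratic s∈)) (Axis.pencilPlaneAt-OneBar s (axes-imaginary s∈) i))

    length-quadratics : length quadratics ≡ q ℕ.* q
    length-quadratics = begin
      length (pencilQuadratics ++ splitQuadratics)            ≡⟨ length-++ pencilQuadratics ⟩
      length pencilQuadratics ℕ.+ length splitQuadratics      ≡⟨ cong₂ ℕ._+_ (trans (length-map _ axes) length-axes) length-splitQuadratics ⟩
      q C 2 ℕ.+ suc q C 2                                     ≡⟨ cong (q C 2 ℕ.+_) (suc-C2 q) ⟩
      q C 2 ℕ.+ (q ℕ.+ q C 2)                                 ≡⟨ solve-∀′ (q C 2) q ⟩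
      q C 2 ℕ.+ q C 2 ℕ.+ q                                   ≡⟨ C2-double q ⟩
      q ℕ.* q                                                 ∎
      where
      open ≡-Reasoning
      solve-∀′ : ∀ a b → a ℕ.+ (b ℕ.+ a) ≡ a ℕ.+ a ℕ.+ b
      solve-∀′ a b = trans (cong (a ℕ.+_) (ℕ.+-comm b a)) (sym (ℕ.+-assoc a a b))

    all-quadratics : ∀ g → g ∈ quadratics
    all-quadratics g = unique-⊆-covers (≡-dec F._≟_ F._≟_) quadratics-unique
      (λ {x} _ → ∈-cartesianProduct⁺ (F.complete (proj₁ x)) (F.complete (proj₂ x)))
      (ℕ.≤-reflexive (trans (length-cartesianProduct F.elements F.elements)
        (trans (cong₂ ℕ._*_ F.size F.size) (sym length-quadratics))))
      (∈-cartesianProduct⁺ (F.complete (proj₁ g)) (F.complete (proj₂ g)))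

    OneBar⇒pencilPlaneAt : ∀ c → Normalized c → OneBarPlane c → c ∙ Cpt i ≡ F.0# →
                          Σ K.Carrier λ s → s ∈ axes × c ≡ Axis.pencilPlaneAt s i
    OneBar⇒pencilPlaneAt c normalized oneBar on = classify (∈-++⁻ pencilQuadratics (all-quadratics g))
      where
      g : F.Carrier × F.Carrier
      g = quadraticAt i c
      planeAt-g : planeAt i g ≡ c
      planeAt-g = planeAt-quadraticAt i c normalized oneBar on
      classify : g ∈ pencilQuadratics ⊎ g ∈ splitQuadratics → Σ K.Carrier λ s → s ∈ axes × c ≡ Axis.pencilPlaneAt s i
      classify (inj₁ g∈) = let (s , s∈ , g≡) = ∈-map⁻ pencilQuadratic g∈ in
        s , s∈ , trans (sym planeAt-g) (trans (cong (planeAt i) g≡) (planeAt-pencilQuadratic s∈))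
      classify (inj₂ g∈split) = ⊥-elim (splitQuadratics-¬OneBar i g∈split (subst OneBarPlane (sym planeAt-g) oneBar))

  OneBar⇒pencilPlane : ∀ c → Normalized c → OneBarPlane c →
                       Σ K.Carrier λ s → s ∈ axes × Σ CIndex λ i → c ≡ Axis.pencilPlaneAt s i
  OneBar⇒pencilPlane c normalized oneBar =
    let (i , on) = meets-C-once⇒point (proj₂ oneBar)
        (s , s∈ , c≡) = AtPoint.OneBar⇒pencilPlaneAt i c normalized oneBar on
    in s , s∈ , i , c≡

  OneBar⇒ContainsAxis : ∀ c → ¬ Zero c → OneBarPlane c → Σ K.Carrier λ s → NotInF s × ContainsAxis c s
  OneBar⇒ContainsAxis c c≢0 oneBar = s , s∉F ,
    ContainsAxis-·⁻¹ κ c s κ≢0 (Axis.InPencil⇒ContainsAxis s s∉F (κ · c) (subst (Axis.InPencil s) (sym κc≡) (Axis.pencilPlaneAt-InPencil s i)))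
    where
    κ = proj₁ (normalize c c≢0)
    κ≢0 = proj₁ (proj₂ (normalize c c≢0))
    found = OneBar⇒pencilPlane (κ · c) (proj₂ (proj₂ (normalize c c≢0))) (OneBarPlane-· κ c κ≢0 oneBar)
    s = proj₁ found
    s∉F = axes-imaginary (proj₁ (proj₂ found))
    i = proj₁ (proj₂ (proj₂ found))
    κc≡ : κ · c ≡ Axis.pencilPlaneAt s i
    κc≡ = proj₂ (proj₂ (proj₂ found))

  oneBarPlanes : List V4
  oneBarPlanes = concat (map Axis.pencil axes)

  oneBarPlanes-count : HasCount (λ c → Normalized c × OneBarPlane c) ((q C 2) ℕ.* (q ℕ.+ 1))
  oneBarPlanes-count = oneBarPlanes , unique , (λ c → mk⇔ (sound c) (complete c)) , length≡
    where
    unique : Unique oneBarPlanes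
    unique = concat-map-unique Axis.pencil reps-unique (λ s∈ → Axis.pencil-unique _ (axes-imaginary s∈))
      (λ {s} {s′} s∈ s′∈ s≢s′ (c∈ , c∈′) →
        let (normalized , inPencil) = Axis.∈-pencil⇒ s (axes-imaginary s∈) c∈
            (_ , inPencil′) = Axis.∈-pencil⇒ s′ (axes-imaginary s′∈) c∈′
        in s≢s′ (axes-common-plane s∈ s′∈ _ (Normalized⇒nonzero _ normalized)
             (Axis.InPencil⇒ContainsAxis s (axes-imaginary s∈) _ inPencil)
             (Axis.InPencil⇒ContainsAxis s′ (axes-imaginary s′∈) _ inPencil′)))
    sound : ∀ c → c ∈ oneBarPlanes → Normalized c × OneBarPlane c
    sound c c∈ = let (cs , c∈cs , cs∈) = ∈-concat⁻′ (map Axis.pencil axes) c∈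
                     (s , s∈ , cs≡) = ∈-map⁻ Axis.pencil cs∈
                     (normalized , inPencil) = Axis.∈-pencil⇒ s (axes-imaginary s∈) (subst (c ∈_) cs≡ c∈cs)
                 in normalized , Axis.ContainsAxis⇒OneBarPlane s (axes-imaginary s∈) c (Normalized⇒nonzero c normalized)
                                   (Axis.InPencil⇒ContainsAxis s (axes-imaginary s∈) c inPencil)
    complete : ∀ c → Normalized c × OneBarPlane c → c ∈ oneBarPlanes
    complete c (normalized , oneBar) = let (s , s∈ , i , c≡) = OneBar⇒pencilPlane c normalized oneBar in
      ∈-concat⁺′ (subst (_∈ Axis.pencil s) (sym c≡) (Axis.pencilPlaneAt-∈ s (axes-imaginary s∈) i)) (∈-map⁺ Axis.pencil s∈)
    length≡ : length oneBarPlanes ≡ (q C 2) ℕ.* (q ℕ.+ 1)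
    length≡ = trans (length-concat-const Axis.pencil axes (q ℕ.+ 1) (λ s∈ → Axis.length-pencil _ (axes-imaginary s∈)))
                (cong (ℕ._* (q ℕ.+ 1)) length-axes)

  OneBar⇒¬dCPlane : ∀ {c} → OneBarPlane c → ∀ d → ¬ d ≡ 1 → ¬ dCPlane d c
  OneBar⇒¬dCPlane (_ , once) d d≢1 d-count = d≢1 (HasCount-unique d-count once)

  conjugate-SameAxis : ∀ s s′ → s′ ≡ s ⊎ s′ ≡ φ s → SameAxis s s′
  conjugate-SameAxis s s′ (inj₁ refl) x = mk⇔ (λ on → on) (λ on → on)
  conjugate-SameAxis s s′ (inj₂ refl) x =
    mk⇔ (λ (on , on̄) → on̄ , subst (λ w → OscK w x ≡ 0#) (sym (φ-involutive s)) on)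
        (λ (on̄ , on) → subst (λ w → OscK w x ≡ 0#) (φ-involutive s) on , on̄)


-- Imported only here: the field operations _+_ and _*_ are opened unqualified above.
open import Data.Nat using (_*_; _+_)

corollary5p9 :
    (q : ℕ) → 5 ≤ q → q % 3 ≡ 1 →
    (F : FiniteField q) (K : FiniteField (q * q)) (E : Embedding F K) →
    let open Geometry F K E in
    -- no 0_C-, 2_C-, 3_C-plane and no Γ-plane contains an imaginary axis
    (∀ (s : FiniteField.Carrier K) → NotInF s → ∀ (c : V4) → ¬ Zero c →
       ContainsAxis c s →
       ¬ dCPlane 0 c × ¬ dCPlane 2 c × ¬ dCPlane 3 c × ¬ ΓPlane c)
    -- every plane through an imaginary axis is a 1̄_C-plane, and there are
    -- exactly q+1 planes through it (the pencil with that axis)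
    × (∀ (s : FiniteField.Carrier K) → NotInF s →
         (∀ (c : V4) → ¬ Zero c → ContainsAxis c s → OneBarPlane c)
         × HasCount (λ c → Normalized c × ContainsAxis c s) (q + 1))
    -- there are (q choose 2)(q+1) 1̄_C-planes
    × HasCount (λ c → Normalized c × OneBarPlane c) ((q C 2) * (q + 1))
    -- they are partitioned into the pencils with imaginary axes as axes:
    -- each 1̄_C-plane contains an imaginary axis, and exactly one
    × (∀ (c : V4) → ¬ Zero c → OneBarPlane c →
         Σ (FiniteField.Carrier K) (λ s → NotInF s × ContainsAxis c s))
    × (∀ (c : V4) → ¬ Zero c → OneBarPlane c →
       ∀ (s s' : FiniteField.Carrier K) → NotInF s → NotInF s' →
         ContainsAxis c s → ContainsAxis c s' → SameAxis s s')
corollary5p9 q _ q%3≡1 F K E =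
    (λ s s∉F c c≢0 c⊇s → let oneBar = Axis.ContainsAxis⇒OneBarPlane s s∉F c c≢0 c⊇s in
       OneBar⇒¬dCPlane oneBar 0 (λ ()) , OneBar⇒¬dCPlane oneBar 2 (λ ()) , OneBar⇒¬dCPlane oneBar 3 (λ ()) , proj₁ oneBar)
  , (λ s s∉F → Axis.ContainsAxis⇒OneBarPlane s s∉F , Axis.pencil-count s s∉F)
  , oneBarPlanes-count
  , OneBar⇒ContainsAxis
  , (λ c c≢0 _ s s′ s∉F s′∉F c⊇s c⊇s′ →
       conjugate-SameAxis s s′ (common-plane⇒same-axis s s′ s∉F s′∉F c c≢0 c⊇s c⊇s′))
  where open ImaginaryAxes F K E q%3≡1
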